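{- Let $n\ge 2$, let $1\le i\le n-1$, and let $(Q,L)$ be one of the following pairs: (a) $i\le n-1$, $Q=s_is_{i+1}\cdots s_j$ with $i\le j\le n-1$, and $L=[i+1,\dots,j+1]$; (b) $i\le n-2$, $Q=s_i\cdots s_{n-2}s_ns_{n-1}s_{n-2}\cdots s_j$ with $i\le j\le n-1$ (for $j=n-1$ this is $s_i\cdots s_{n-2}s_ns_{n-1}$), and $L=[i+1,\dots,n,-n,-(n-1),\dots,-(j+1)]$ (for $j=n-1$ this is $[i+1,\dots,n,-n]$); (c) $i=n-1$, $Q=s_ns_{n-1}$, and $L=[n,-n]$; (d) $i\le n-2$, $Q=s_i\cdots s_{n-2}s_n$, and $L=[i+1,\dots,n-1,-n]$; (e) $i=n-1$, $Q=s_n$, and $L=[-n]$. Then for every $w\in D_n$, $Q\star w=h_{i,L}(Qw)$.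
   Context: Order $\pm[n]=\{1,\dots,n,-1,\dots,-n\}$ totally by $1<2<\dots<n<-n<\dots<-2<-1$. A signed permutation is a bijection $w$ of $\pm[n]$ with $w(-a)=-w(a)$, written $[w(1),\dots,w(n)]$; it is even if an even number of $w(1),\dots,w(n)$ are negative. $D_n$ is the group of even signed permutations under composition $(uv)(a)=u(v(a))$, with Coxeter generators $s_i$ ($1\le i\le n-1$) exchanging $i$ and $i+1$ and fixing the other elements of $[n]$, and $s_n$ with $s_n(n-1)=-n$, $s_n(n)=-(n-1)$, $s_n(a)=a$ for $a\le n-2$. Let $\ell$ be the Coxeter length. Demazure product: for a generator $s$, $s\star y=sy$ if $\ell(sy)>\ell(y)$ and $s\star y=y$ otherwise; for $x=s_{a_1}\cdots s_{a_k}$ reduced, $x\star y=s_{a_1}\star(\cdots(s_{a_k}\star y))$. The unfolding of a signed permutation $u$ is the sequence $u(1),\dots,u(n),-u(n),\dots,-u(1)$. For $t\in\pm[n]$ and an ordered list $L$ of distinct elements of $\pm[n]$, $h_{t,L}(u)$ is computed by: among elements of $L$ greater than $t$ (total order) appearing to the right of the entry $t$ in the unfolding of $u$, take the one $q$ occurring latest in $L$; if none, stop; otherwise exchange the entries $t$ and $q$ and the entries $-t$ and $-q$ in the unfolding (if $q=-t$, just exchange $t$ and $-t$), and repeat. -}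

module Defs where

open import Data.Bool using (Bool; true; false; if_then_else_; _∧_; _∨_; not)
open import Data.Nat as ℕ using (ℕ; zero; suc; _+_; _*_; _∸_; _≤_; _<_; _≡ᵇ_; _<ᵇ_)
open import Data.Integer as ℤ using (ℤ; +_; -[1+_]; ∣_∣)
open import Data.List using (List; []; _∷_; map; _++_; reverse; length; upTo; take; filterᵇ; last; foldr)
open import Data.Bool.ListAction using (any)
open import Data.List.Relation.Unary.All using (All)
open import Data.List.Relation.Binary.Permutation.Propositional using (_↭_)
open import Data.Maybe using (Maybe; just; nothing)
open import Data.Product using (Σ; _×_; _,_; ∃)
open import Data.Sum using (_⊎_)
open import Relation.Nullary.Decidable using (⌊_⌋)
open import Relation.Binary.PropositionalEquality using (_≡_)

-- Signed permutations of ±[n] are represented by their window [w(1),…,w(n)],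
-- a list of n nonzero integers (negative integer -a stands for the element -a).

neg1 : ℤ → ℤ
neg1 = ℤ.-_

_==_ : ℤ → ℤ → Bool
x == y = ⌊ x ℤ.≟ y ⌋

elem : ℤ → List ℤ → Bool
elem x = any (λ y → x == y)

-- the total order 1 < 2 < … < n < -n < … < -1 on ±[n], via a rank in ℕ
-- (a ↦ a for a > 0 ; -a ↦ 2n+1-a)
rank : ℕ → ℤ → ℕ
rank n (+ m)     = m
rank n -[1+ k ]  = 2 * n ∸ k

-- entry k (0-based) of a list, default 0
nth : List ℤ → ℕ → ℤ
nth []       _       = + 0
nth (x ∷ xs) zero    = x
nth (x ∷ xs) (suc k) = nth xs k

apply : List ℤ → ℤ → ℤ
apply u (+ zero)    = + 0
apply u (+ suc k)   = nth u k
apply u -[1+ k ]    = neg1 (nth u k)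

-- composition (uv)(a) = u(v(a)), on windows
compose : List ℤ → List ℤ → List ℤ
compose u v = map (apply u) v

idPerm : ℕ → List ℤ
idPerm n = map (λ k → + suc k) (upTo n)

gen : ℕ → ℕ → List ℤ
gen n a = map (λ k → f (suc k)) (upTo n)
  where
  f : ℕ → ℤ
  f v = if a ≡ᵇ n
          then (if v ≡ᵇ (n ∸ 1) then neg1 (+ n)
                else if v ≡ᵇ n then neg1 (+ (n ∸ 1)) else + v)
          else (if v ≡ᵇ a then + suc a
                else if v ≡ᵇ suc a then + a else + v)

ValidGen : ℕ → ℕ → Set
ValidGen n a = 1 ≤ a × a ≤ n

prodW : ℕ → List ℕ → List ℤ
prodW n = foldr (λ a acc → compose (gen n a) acc) (idPerm n)

isNeg : ℤ → Bool
isNeg (+ _)     = false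
isNeg -[1+ _ ]  = true

InD : ℕ → List ℤ → Set
InD n w = length w ≡ n
        × map ∣_∣ w ↭ map suc (upTo n)
        × ∃ λ k → length (filterᵇ isNeg w) ≡ 2 * k

HasLength : ℕ → List ℤ → ℕ → Set
HasLength n w k =
  (Σ (List ℕ) λ ws → All (ValidGen n) ws × length ws ≡ k × prodW n ws ≡ w)
  × ((ws : List ℕ) → All (ValidGen n) ws → prodW n ws ≡ w → k ≤ length ws)

DemStep : ℕ → ℕ → List ℤ → List ℤ → Set
DemStep n a y z = Σ ℕ λ p → Σ ℕ λ q →
  HasLength n (compose (gen n a) y) p × HasLength n y q ×
  ((q < p × z ≡ compose (gen n a) y) ⊎ (p ≤ q × z ≡ y))

-- (s_{a_1} ⋯ s_{a_k}) ⋆ y = z, computed as s_{a_1} ⋆ (⋯ (s_{a_k} ⋆ y))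
data Demazure (n : ℕ) : List ℕ → List ℤ → List ℤ → Set where
  dem-nil  : ∀ {y} → Demazure n [] y y
  dem-cons : ∀ {a as y z' z} → Demazure n as y z' → DemStep n a z' z →
             Demazure n (a ∷ as) y z

unfold : List ℤ → List ℤ
unfold u = u ++ reverse (map neg1 u)

after : ℤ → List ℤ → List ℤ
after t []       = []
after t (x ∷ xs) = if x == t then xs else after t xs

-- exchange entries t ↔ q and -t ↔ -q (if q = -t this just exchanges t and -t)
exch : ℤ → ℤ → ℤ → ℤ
exch t q x = if x == t then q else (if x == q then t
             else (if x == neg1 t then neg1 q else (if x == neg1 q then neg1 t else x)))

hStep : ℕ → ℤ → List ℤ → List ℤ → Maybe (List ℤ)
hStep n t L unf with last (filterᵇ (λ x → (rank n t <ᵇ rank n x) ∧ elem x (after t unf)) L)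
... | nothing = nothing
... | just q  = just (map (exch t q) unf)

hIter : ℕ → ℕ → ℤ → List ℤ → List ℤ → List ℤ
hIter zero    n t L unf = unf
hIter (suc f) n t L unf with hStep n t L unf
... | nothing   = unf
... | just unf' = hIter f n t L unf'

-- h_{t,L}(u).  Each step moves the entry t strictly to the right in the
-- unfolding (of length 2n), so the process stops after < 2n steps; the fuel
-- 2n+1 is therefore never exhausted.
h : ℕ → ℤ → List ℤ → List ℤ → List ℤ
h n t L u = take n (hIter (suc (2 * n)) n t L (unfold u))

-- [a, a+1, …, b] (empty if b < a)
rangeUp : ℕ → ℕ → List ℕ
rangeUp a b = map (λ k → a + k) (upTo (suc b ∸ a))

rangeDown : ℕ → ℕ → List ℕ
rangeDown a b = reverse (rangeUp a b)

pos : List ℕ → List ℤ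
pos = map (λ k → + k)

neg : List ℕ → List ℤ
neg = map (λ k → neg1 (+ k))

data Admissible (n i : ℕ) : List ℕ → List ℤ → Set where
  caseA : ∀ j → i ≤ n ∸ 1 → i ≤ j → j ≤ n ∸ 1 →
          Admissible n i (rangeUp i j) (pos (rangeUp (suc i) (suc j)))
  caseB : ∀ j → i ≤ n ∸ 2 → i ≤ j → j ≤ n ∸ 1 →
          Admissible n i (rangeUp i (n ∸ 2) ++ n ∷ rangeDown j (n ∸ 1))
                         (pos (rangeUp (suc i) n) ++ neg (rangeDown (suc j) n))
  caseC : i ≡ n ∸ 1 → Admissible n i (n ∷ (n ∸ 1) ∷ []) (+ n ∷ neg1 (+ n) ∷ [])
  caseD : i ≤ n ∸ 2 →
          Admissible n i (rangeUp i (n ∸ 2) ++ n ∷ [])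
                         (pos (rangeUp (suc i) (n ∸ 1)) ++ neg1 (+ n) ∷ [])
  caseE : i ≡ n ∸ 1 → Admissible n i (n ∷ []) (neg1 (+ n) ∷ [])

module Submission where

-- Induction on Q, appending one generator s_a (and the last entry q of L) at a time. When Q carries the
-- pair exchanged by s_a to (t, q), or to (-q, -t), we have Q s_a = (t q) Q. Now s_a ⋆ w is s_a w or w
-- according as s_a is an ascent or a descent of w, i.e. as q lies left or right of t in the unfolding of
-- Q s_a w. An entry left of t is never chosen by h_{t,L}, while the last entry q of L, when right of t, is
-- chosen first and turns Q s_a w into Q w. In cases (b) and (c) the step through s_{n-1} instead inserts n
-- before the final -n of L, and h may then exchange t with -n before n. Ascents and descents are read off
-- the type-D inversion number dLength, which is the Coxeter length because every generator changes it by
-- exactly one and a window without descents is the identity.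

open import Defs
open import Data.Bool using (Bool; true; false; if_then_else_; _∧_; not; T; _xor_)
import Data.Bool.Properties as BoolP
open import Data.Nat as ℕ using (ℕ; zero; suc; _+_; _*_; _∸_; _≤_; _<_; _<ᵇ_; _≡ᵇ_; z≤n; s≤s)
import Data.Nat.Properties as ℕP
open import Algebra.Properties.CommutativeSemigroup ℕP.+-commutativeSemigroup using (xy∙z≈xz∙y; xy∙z≈zy∙x)
open import Data.Integer as ℤ using (ℤ; +_; -[1+_]; ∣_∣)
import Data.Integer.Properties as ℤP
open import Data.List using (List; []; _∷_; map; _++_; reverse; length; upTo; applyUpTo; filterᵇ; last; take)
import Data.List.Properties as ListP
open import Data.List.Relation.Unary.All as All using (All; []; _∷_)
import Data.List.Relation.Unary.All.Properties as AllP
open import Data.List.Relation.Unary.Any using (here; there)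
import Data.List.Relation.Unary.Any.Properties as AnyP
open import Data.List.Membership.Propositional using (_∈_; _∉_)
import Data.List.Membership.Propositional.Properties as ∈P
open import Data.List.Relation.Unary.AllPairs as AllPairs using (AllPairs; []; _∷_)
import Data.List.Relation.Unary.AllPairs.Properties as AllPairsP
open import Data.List.Relation.Unary.Unique.Propositional using (Unique)
import Data.List.Relation.Unary.Unique.Propositional.Properties as UniqueP
open import Data.List.Relation.Binary.Permutation.Propositional using (_↭_; ↭-sym; ↭⇒↭ₛ)
import Data.List.Relation.Binary.Permutation.Propositional.Properties as PermutationP
import Data.List.Relation.Binary.Permutation.Setoid.Properties as PermutationSetoidP
open import Data.Maybe using (Maybe; just; nothing)
open import Data.Product using (Σ; _×_; _,_; proj₁; proj₂; ∃)
open import Data.Sum as Sum using (_⊎_; inj₁; inj₂; [_,_]′)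
open import Data.Empty using (⊥; ⊥-elim)
open import Relation.Nullary using (Dec; yes; no; ¬_)
open import Relation.Nullary.Decidable using (T?)
open import Function using (_∘_; Equivalence)
open import Relation.Binary using (tri<; tri≈; tri>)
open import Relation.Binary.PropositionalEquality

<⇒<ᵇ≡true : ∀ {a b} → a < b → (a <ᵇ b) ≡ true
<⇒<ᵇ≡true a<b = Equivalence.to BoolP.T-≡ (ℕP.<⇒<ᵇ a<b)

≤⇒<ᵇ≡false : ∀ {a b} → b ≤ a → (a <ᵇ b) ≡ false
≤⇒<ᵇ≡false {a} {b} b≤a with a <ᵇ b in eq
... | false = refl
... | true  = ⊥-elim (ℕP.<⇒≱ (ℕP.<ᵇ⇒< a b (subst T (sym eq) _)) b≤a)

reflect-< : ∀ {a b N} → a < b → b < N → N ∸ suc b < N ∸ suc a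
reflect-< a<b b<N = ℕP.∸-monoʳ-< (s≤s a<b) b<N

reflect-<⁻ : ∀ {a b N} → a < N → b < N → N ∸ suc a < N ∸ suc b → b < a
reflect-<⁻ {a} {b} {N} a<N b<N reflected with ℕP.<-cmp a b
... | tri< a<b _ _   = ⊥-elim (ℕP.<-asym reflected (reflect-< a<b b<N))
... | tri≈ _ refl _  = ⊥-elim (ℕP.<-irrefl refl reflected)
... | tri> _ _ b<a   = b<a

reflect-swap : ∀ {a b N} → b < N → a < N ∸ suc b → b < N ∸ suc a
reflect-swap {a} {b} {N} b<N a< =
  ℕP.m+n≤o⇒m≤o∸n (suc b) (subst (_≤ N) (ℕP.+-comm (suc a) (suc b)) (ℕP.m≤o∸n⇒m+n≤o (suc a) b<N a<))

filterᵇ-unfold : ∀ {A : Set} (p : A → Bool) x xs →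
                 filterᵇ p (x ∷ xs) ≡ (if p x then x ∷ filterᵇ p xs else filterᵇ p xs)
filterᵇ-unfold p x xs with p x
... | true  = refl
... | false = refl

filterᵇ-cong-local : ∀ {A : Set} (p r : A → Bool) xs → All (λ x → p x ≡ r x) xs → filterᵇ p xs ≡ filterᵇ r xs
filterᵇ-cong-local p r [] _ = refl
filterᵇ-cong-local p r (x ∷ xs) (px≡rx ∷ eqs) rewrite filterᵇ-unfold p x xs | filterᵇ-unfold r x xs | px≡rx =
  cong (λ z → if r x then x ∷ z else z) (filterᵇ-cong-local p r xs eqs)

last-∷ʳ : ∀ {A : Set} (xs : List A) q → last (xs ++ q ∷ []) ≡ just q
last-∷ʳ []           q = refl
last-∷ʳ (x ∷ [])     q = refl
last-∷ʳ (x ∷ y ∷ xs) q = last-∷ʳ (y ∷ xs) q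

last-∈ : ∀ {A : Set} (xs : List A) {q} → last xs ≡ just q → q ∈ xs
last-∈ (x ∷ [])     refl = here refl
last-∈ (x ∷ y ∷ xs) eq   = there (last-∈ (y ∷ xs) eq)

take-length-++ : ∀ {A : Set} (xs ys : List A) → take (length xs) (xs ++ ys) ≡ xs
take-length-++ []       ys = refl
take-length-++ (x ∷ xs) ys = cong (x ∷_) (take-length-++ xs ys)

-- Entries of ±[n] and the exchange of two entries

record ValidEntry (n : ℕ) (x : ℤ) : Set where
  constructor entry
  field
    entry-lower : 1 ≤ ∣ x ∣
    entry-upper : ∣ x ∣ ≤ n
open ValidEntry public

Nonzero : ℤ → Set
Nonzero x = x ≢ + 0

entry-nonzero : ∀ {n x} → ValidEntry n x → Nonzero x
entry-nonzero (entry () _) refl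

neg-entry : ∀ {n x} → ValidEntry n x → ValidEntry n (neg1 x)
neg-entry {n} {x} (entry a b) =
  entry (subst (1 ≤_) (sym (ℤP.∣-i∣≡∣i∣ x)) a) (subst (_≤ n) (sym (ℤP.∣-i∣≡∣i∣ x)) b)

nonzero⇒≢neg : ∀ {x} → Nonzero x → x ≢ neg1 x
nonzero⇒≢neg {+ zero}    x≢0 _ = x≢0 refl
nonzero⇒≢neg {+ suc k}   _ ()
nonzero⇒≢neg { -[1+ k ]} _ ()

≡neg⇒neg≡ : ∀ {x y} → x ≡ neg1 y → neg1 x ≡ y
≡neg⇒neg≡ {x} {y} x≡-y = trans (cong neg1 x≡-y) (ℤP.neg-involutive y)

≢neg⇒neg≢ : ∀ {x y} → x ≢ neg1 y → neg1 x ≢ y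
≢neg⇒neg≢ x≢-y -x≡y = x≢-y (sym (≡neg⇒neg≡ (sym -x≡y)))

neg-≢ : ∀ {x y} → x ≢ y → neg1 x ≢ neg1 y
neg-≢ x≢y -x≡-y = x≢y (ℤP.neg-injective -x≡-y)

==-refl : ∀ x → (x == x) ≡ true
==-refl x with x ℤ.≟ x
... | yes _   = refl
... | no x≢x = ⊥-elim (x≢x refl)

==-≢ : ∀ {x y} → x ≢ y → (x == y) ≡ false
==-≢ {x} {y} x≢y with x ℤ.≟ y
... | yes x≡y = ⊥-elim (x≢y x≡y)
... | no _    = refl

data ExchView (t q x : ℤ) : ℤ → Set where
  at-t    : x ≡ t → ExchView t q x q
  at-q    : x ≢ t → x ≡ q → ExchView t q x t
  at-negt : x ≢ t → x ≢ q → x ≡ neg1 t → ExchView t q x (neg1 q)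
  at-negq : x ≢ t → x ≢ q → x ≢ neg1 t → x ≡ neg1 q → ExchView t q x (neg1 t)
  fixed   : x ≢ t → x ≢ q → x ≢ neg1 t → x ≢ neg1 q → ExchView t q x x

exch-view : ∀ t q x → ExchView t q x (exch t q x)
exch-view t q x with x ℤ.≟ t
... | yes p = at-t p
... | no p with x ℤ.≟ q
... | yes p₂ = at-q p p₂
... | no p₂ with x ℤ.≟ neg1 t
... | yes p₃ = at-negt p p₂ p₃
... | no p₃ with x ℤ.≟ neg1 q
... | yes p₄ = at-negq p p₂ p₃ p₄
... | no p₄ = fixed p p₂ p₃ p₄

exch-t : ∀ t q → exch t q t ≡ q
exch-t t q with exch t q t | exch-view t q t
... | _ | at-t _           = refl
... | _ | at-q t≢t _       = ⊥-elim (t≢t refl)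
... | _ | at-negt t≢t _ _  = ⊥-elim (t≢t refl)
... | _ | at-negq t≢t _ _ _ = ⊥-elim (t≢t refl)
... | _ | fixed t≢t _ _ _  = ⊥-elim (t≢t refl)

exch-q : ∀ t q → exch t q q ≡ t
exch-q t q with exch t q q | exch-view t q q
... | _ | at-t q≡t          = q≡t
... | _ | at-q _ _          = refl
... | _ | at-negt _ q≢q _   = ⊥-elim (q≢q refl)
... | _ | at-negq _ q≢q _ _ = ⊥-elim (q≢q refl)
... | _ | fixed _ q≢q _ _   = ⊥-elim (q≢q refl)

exch-negt : ∀ t q → Nonzero t → exch t q (neg1 t) ≡ neg1 q
exch-negt t q t≢0 with exch t q (neg1 t) | exch-view t q (neg1 t)
... | _ | at-t p          = ⊥-elim (nonzero⇒≢neg t≢0 (sym p))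
... | _ | at-q _ p        = trans (sym (ℤP.neg-involutive t)) (cong neg1 p)
... | _ | at-negt _ _ _   = refl
... | _ | at-negq _ _ p _ = ⊥-elim (p refl)
... | _ | fixed _ _ p _   = ⊥-elim (p refl)

exch-negq : ∀ t q → Nonzero q → exch t q (neg1 q) ≡ neg1 t
exch-negq t q q≢0 with exch t q (neg1 q) | exch-view t q (neg1 q)
... | _ | at-t p          = sym (≡neg⇒neg≡ (sym p))
... | _ | at-q _ p        = ⊥-elim (nonzero⇒≢neg q≢0 (sym p))
... | _ | at-negt _ _ p   = p
... | _ | at-negq _ _ _ _ = refl
... | _ | fixed _ _ _ p   = ⊥-elim (p refl)

exch-fixed : ∀ t q x → x ≢ t → x ≢ q → x ≢ neg1 t → x ≢ neg1 q → exch t q x ≡ x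
exch-fixed t q x a b c d with exch t q x | exch-view t q x
... | _ | at-t p          = ⊥-elim (a p)
... | _ | at-q _ p        = ⊥-elim (b p)
... | _ | at-negt _ _ p   = ⊥-elim (c p)
... | _ | at-negq _ _ _ p = ⊥-elim (d p)
... | _ | fixed _ _ _ _   = refl

exch-neg : ∀ t q x → Nonzero t → Nonzero q → exch t q (neg1 x) ≡ neg1 (exch t q x)
exch-neg t q x t≢0 q≢0 with exch t q x | exch-view t q x
... | _ | at-t refl         = exch-negt t q t≢0
... | _ | at-q _ refl       = exch-negq t q q≢0
... | _ | at-negt _ _ refl  =
  trans (cong (exch t q) (ℤP.neg-involutive t)) (trans (exch-t t q) (sym (ℤP.neg-involutive q)))
... | _ | at-negq _ _ _ refl =
  trans (cong (exch t q) (ℤP.neg-involutive q)) (trans (exch-q t q) (sym (ℤP.neg-involutive t)))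
... | _ | fixed a b c d     = exch-fixed t q (neg1 x) (≢neg⇒neg≢ c) (≢neg⇒neg≢ d) (neg-≢ a) (neg-≢ b)

exch-involutive : ∀ t q x → Nonzero t → Nonzero q → exch t q (exch t q x) ≡ x
exch-involutive t q x t≢0 q≢0 with exch t q x | exch-view t q x
... | _ | at-t refl          = exch-q t q
... | _ | at-q _ refl        = exch-t t q
... | _ | at-negt _ _ refl   = exch-negq t q q≢0
... | _ | at-negq _ _ _ refl = exch-negt t q t≢0
... | _ | fixed a b c d      = exch-fixed t q x a b c d

exch-injective : ∀ t q {x y} → Nonzero t → Nonzero q → exch t q x ≡ exch t q y → x ≡ y
exch-injective t q {x} {y} t≢0 q≢0 eq = begin
  x                      ≡⟨ exch-involutive t q x t≢0 q≢0 ⟨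
  exch t q (exch t q x)  ≡⟨ cong (exch t q) eq ⟩
  exch t q (exch t q y)  ≡⟨ exch-involutive t q y t≢0 q≢0 ⟩
  y                      ∎
  where open ≡-Reasoning

exch-neg-swap : ∀ t q x → Nonzero t → Nonzero q → exch (neg1 q) (neg1 t) x ≡ exch t q x
exch-neg-swap t q x t≢0 q≢0 with exch t q x | exch-view t q x
... | _ | at-t refl =
  trans (cong (exch (neg1 q) (neg1 t)) (sym (ℤP.neg-involutive x)))
        (trans (exch-negq (neg1 q) (neg1 x) (neg-≢ t≢0)) (ℤP.neg-involutive q))
... | _ | at-q _ refl =
  trans (cong (exch (neg1 x) (neg1 t)) (sym (ℤP.neg-involutive x)))
        (trans (exch-negt (neg1 x) (neg1 t) (neg-≢ q≢0)) (ℤP.neg-involutive t))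
... | _ | at-negt _ _ refl  = exch-q (neg1 q) (neg1 t)
... | _ | at-negq _ _ _ refl = exch-t (neg1 q) (neg1 t)
... | _ | fixed a b c d =
  exch-fixed (neg1 q) (neg1 t) x d c
    (λ e → b (trans e (ℤP.neg-involutive q))) (λ e → a (trans e (ℤP.neg-involutive t)))

exch-valid : ∀ {n t q x} → ValidEntry n t → ValidEntry n q → ValidEntry n x → ValidEntry n (exch t q x)
exch-valid {n} {t} {q} {x} vt vq vx with exch t q x | exch-view t q x
... | _ | at-t _          = vq
... | _ | at-q _ _        = vt
... | _ | at-negt _ _ _   = neg-entry vq
... | _ | at-negq _ _ _ _ = neg-entry vt
... | _ | fixed _ _ _ _   = vx

record SignedMap (n : ℕ) (φ : ℤ → ℤ) : Set where
  field
    maps-entries : ∀ {x} → ValidEntry n x → ValidEntry n (φ x)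
    commutes-neg : ∀ {x} → ValidEntry n x → φ (neg1 x) ≡ neg1 (φ x)
    injective    : ∀ {x y} → ValidEntry n x → ValidEntry n y → φ x ≡ φ y → x ≡ y
open SignedMap public

exch-conjugate : ∀ {n φ} → SignedMap n φ → ∀ {a b x} → ValidEntry n a → ValidEntry n b → ValidEntry n x →
                 φ (exch a b x) ≡ exch (φ a) (φ b) (φ x)
exch-conjugate {n} {φ} Φ {a} {b} {x} va vb vx with exch a b x | exch-view a b x
... | _ | at-t refl          = sym (exch-t (φ a) (φ b))
... | _ | at-q _ refl        = sym (exch-q (φ a) (φ b))
... | _ | at-negt _ _ refl   =
  trans (commutes-neg Φ vb)
        (sym (trans (cong (exch (φ a) (φ b)) (commutes-neg Φ va))
                    (exch-negt (φ a) (φ b) (entry-nonzero (maps-entries Φ va)))))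
... | _ | at-negq _ _ _ refl =
  trans (commutes-neg Φ va)
        (sym (trans (cong (exch (φ a) (φ b)) (commutes-neg Φ vb))
                    (exch-negq (φ a) (φ b) (entry-nonzero (maps-entries Φ vb)))))
... | _ | fixed c d e f = sym (exch-fixed (φ a) (φ b) (φ x)
  (λ p → c (injective Φ vx va p)) (λ p → d (injective Φ vx vb p))
  (λ p → e (injective Φ vx (neg-entry va) (trans p (sym (commutes-neg Φ va)))))
  (λ p → f (injective Φ vx (neg-entry vb) (trans p (sym (commutes-neg Φ vb))))))

exch-negq′ : ∀ t m → Nonzero m → exch t (neg1 m) m ≡ neg1 t
exch-negq′ t m m≢0 = trans (cong (exch t (neg1 m)) (sym (ℤP.neg-involutive m))) (exch-negq t (neg1 m) (neg-≢ m≢0))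

exch-comm-neg : ∀ t m x → Nonzero t → Nonzero m → m ≢ t → m ≢ neg1 t →
                exch t m (exch t (neg1 m) x) ≡ exch t (neg1 m) (exch t m x)
exch-comm-neg t m x t≢0 m≢0 _ _ with exch t m x | exch-view t m x
... | _ | at-t refl =
  trans (cong (exch x m) (exch-t x (neg1 m))) (trans (exch-negq x m m≢0) (sym (exch-negq′ x m m≢0)))
... | _ | at-q _ refl =
  trans (cong (exch t x) (exch-negq′ t x m≢0)) (trans (exch-negt t x t≢0) (sym (exch-t t (neg1 x))))
... | _ | at-negt _ _ refl =
  trans (cong (exch t m) (exch-negt t (neg1 m) t≢0))
        (trans (cong (exch t m) (ℤP.neg-involutive m)) (trans (exch-q t m) (sym (exch-q t (neg1 m)))))
... | _ | at-negq _ _ _ refl =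
  trans (cong (exch t m) (exch-q t (neg1 m)))
        (trans (exch-t t m) (trans (sym (ℤP.neg-involutive m)) (sym (exch-negt t (neg1 m) t≢0))))
... | _ | fixed a b c d =
  trans (cong (exch t m) fixed-by-neg) (trans (exch-fixed t m x a b c d) (sym fixed-by-neg))
  where
  fixed-by-neg : exch t (neg1 m) x ≡ x
  fixed-by-neg = exch-fixed t (neg1 m) x a d c (λ e → b (trans e (ℤP.neg-involutive m)))

-- Positions in lists without repetitions

position : ℤ → List ℤ → ℕ
position v []       = 0
position v (x ∷ xs) = if x == v then 0 else suc (position v xs)

position-head : ∀ v xs → position v (v ∷ xs) ≡ 0
position-head v xs rewrite ==-refl v = refl

position-tail : ∀ {v x} xs → x ≢ v → position v (x ∷ xs) ≡ suc (position v xs)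
position-tail xs x≢v rewrite ==-≢ x≢v = refl

position-< : ∀ {v xs} → v ∈ xs → position v xs < length xs
position-< {v} {x ∷ xs} (here refl) rewrite position-head v xs = s≤s z≤n
position-< {v} {x ∷ xs} (there v∈xs) with x ℤ.≟ v
... | yes _ = s≤s z≤n
... | no _  = s≤s (position-< v∈xs)

position-++ˡ : ∀ {v} xs ys → v ∈ xs → position v (xs ++ ys) ≡ position v xs
position-++ˡ {v} (x ∷ xs) ys v∈ with x ℤ.≟ v
... | yes _ = refl
... | no x≢v with v∈
... | here v≡x    = ⊥-elim (x≢v (sym v≡x))
... | there v∈xs = cong suc (position-++ˡ xs ys v∈xs)

position-++ʳ : ∀ {v} xs ys → v ∉ xs → position v (xs ++ ys) ≡ length xs + position v ys
position-++ʳ [] ys _ = refl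
position-++ʳ {v} (x ∷ xs) ys v∉ with x ℤ.≟ v
... | yes x≡v = ⊥-elim (v∉ (here (sym x≡v)))
... | no _    = cong suc (position-++ʳ xs ys (λ v∈xs → v∉ (there v∈xs)))

lookup-position : ∀ {v xs} → v ∈ xs → nth xs (position v xs) ≡ v
lookup-position {v} {x ∷ xs} v∈ with x ℤ.≟ v
... | yes x≡v = x≡v
... | no x≢v with v∈
... | here v≡x    = ⊥-elim (x≢v (sym v≡x))
... | there v∈xs = lookup-position v∈xs

lookup-∈ : ∀ (xs : List ℤ) p → p < length xs → nth xs p ∈ xs
lookup-∈ (x ∷ xs) zero    _         = here refl
lookup-∈ (x ∷ xs) (suc p) (s≤s p<) = there (lookup-∈ xs p p<)

position-lookup : ∀ {xs : List ℤ} → Unique xs → ∀ p → p < length xs → position (nth xs p) xs ≡ p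
position-lookup {x ∷ xs} _ zero _ = position-head x xs
position-lookup {x ∷ xs} (x≢ ∷ u) (suc p) (s≤s p<) =
  trans (position-tail xs (λ x≡ → AllP.All¬⇒¬Any x≢ (subst (_∈ xs) (sym x≡) (lookup-∈ xs p p<))))
        (cong suc (position-lookup u p p<))

position-map : ∀ (f : ℤ → ℤ) {v} xs → (∀ {y} → y ∈ xs → f y ≡ f v → y ≡ v) →
               position (f v) (map f xs) ≡ position v xs
position-map f [] _ = refl
position-map f {v} (y ∷ ys) f-inj with y ℤ.≟ v
... | yes refl rewrite ==-refl (f y) = refl
... | no y≢v with f y ℤ.≟ f v
... | yes fy≡fv = ⊥-elim (y≢v (f-inj (here refl) fy≡fv))
... | no _      = cong suc (position-map f ys (λ y∈ → f-inj (there y∈)))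

position-reverse : ∀ {v} xs → Unique xs → v ∈ xs → position v (reverse xs) ≡ length xs ∸ suc (position v xs)
position-reverse {v} (x ∷ xs) (x≢ ∷ u) v∈ rewrite ListP.unfold-reverse x xs with x ℤ.≟ v
... | yes refl = begin
  position x (reverse xs ++ x ∷ [])          ≡⟨ position-++ʳ (reverse xs) (x ∷ []) x∉rev ⟩
  length (reverse xs) + position x (x ∷ [])  ≡⟨ cong₂ _+_ (ListP.length-reverse xs) (position-head x []) ⟩
  length xs + 0                              ≡⟨ ℕP.+-identityʳ _ ⟩
  length xs                                  ∎
  where
  open ≡-Reasoning
  x∉rev : x ∉ reverse xs
  x∉rev x∈ = AllP.All¬⇒¬Any x≢ (AnyP.reverse⁻ x∈)
... | no x≢v with v∈
... | here v≡x    = ⊥-elim (x≢v (sym v≡x))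
... | there v∈xs =
  trans (position-++ˡ (reverse xs) (x ∷ []) (AnyP.reverse⁺ v∈xs)) (position-reverse xs u v∈xs)

position-before : ∀ A {x y R} → Unique (A ++ x ∷ R) → y ∈ R → position x (A ++ x ∷ R) < position y (A ++ x ∷ R)
position-before [] {x} {y} {R} (x≢ ∷ _) y∈R with x ℤ.≟ x | x ℤ.≟ y
... | yes _ | yes refl = ⊥-elim (AllP.All¬⇒¬Any x≢ y∈R)
... | yes _ | no _     = s≤s z≤n
... | no x≢x | _       = ⊥-elim (x≢x refl)
position-before (a ∷ A) {x} {y} {R} (a≢ ∷ u) y∈R with a ℤ.≟ x | a ℤ.≟ y
... | yes refl | _    = ⊥-elim (AllP.All¬⇒¬Any a≢ (∈P.∈-++⁺ʳ A (here refl)))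
... | no _ | yes refl = ⊥-elim (AllP.All¬⇒¬Any a≢ (∈P.∈-++⁺ʳ A (there y∈R)))
... | no _ | no _     = s≤s (position-before A u y∈R)

unique-resp-↭ : ∀ {A : Set} {xs ys : List A} → xs ↭ ys → Unique xs → Unique ys
unique-resp-↭ {A} xs↭ys = PermutationSetoidP.Unique-resp-↭ (setoid A) (↭⇒↭ₛ xs↭ys)

unique-reverse : ∀ {xs : List ℤ} → Unique xs → Unique (reverse xs)
unique-reverse {xs} = unique-resp-↭ (↭-sym (PermutationP.↭-reverse xs))

∉⇒elem-false : ∀ {x ys} → x ∉ ys → elem x ys ≡ false
∉⇒elem-false {x} {[]} _ = refl
∉⇒elem-false {x} {y ∷ ys} x∉ with x ℤ.≟ y
... | yes x≡y = ⊥-elim (x∉ (here x≡y))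
... | no _    = ∉⇒elem-false (λ x∈ → x∉ (there x∈))

∈⇒elem-true : ∀ {x ys} → x ∈ ys → elem x ys ≡ true
∈⇒elem-true {x} {y ∷ ys} x∈ with x ℤ.≟ y
... | yes _ = refl
... | no x≢y with x∈
... | here x≡y    = ⊥-elim (x≢y x≡y)
... | there x∈ys = ∈⇒elem-true x∈ys

∈-after⇒∈ : ∀ {x} t ys → x ∈ after t ys → x ∈ ys
∈-after⇒∈ t (y ∷ ys) x∈ with y ℤ.≟ t
... | yes _ = there x∈
... | no _  = there (∈-after⇒∈ t ys x∈)

elem-after : ∀ {t x} xs → Unique xs → t ∈ xs → x ∈ xs → elem x (after t xs) ≡ (position t xs <ᵇ position x xs)
elem-after {t} {x} (y ∷ ys) (y≢ ∷ u) t∈ x∈ with y ℤ.≟ t | y ℤ.≟ x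
... | yes refl | yes refl = ∉⇒elem-false (AllP.All¬⇒¬Any y≢)
... | yes refl | no y≢x with x∈
... | here x≡y    = ⊥-elim (y≢x (sym x≡y))
... | there x∈ys = ∈⇒elem-true x∈ys
elem-after {t} {x} (y ∷ ys) (y≢ ∷ u) t∈ x∈ | no _ | yes refl =
  ∉⇒elem-false (λ y∈ → AllP.All¬⇒¬Any y≢ (∈-after⇒∈ t ys y∈))
elem-after {t} {x} (y ∷ ys) (y≢ ∷ u) t∈ x∈ | no y≢t | no y≢x with t∈ | x∈
... | here t≡y | _          = ⊥-elim (y≢t (sym t≡y))
... | there _  | here x≡y   = ⊥-elim (y≢x (sym x≡y))
... | there t∈ | there x∈′ = elem-after ys u t∈ x∈′

-- Windows of signed permutations and their unfoldings

AbsDistinct : ℤ → ℤ → Set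
AbsDistinct x y = x ≢ y × x ≢ neg1 y

record SignedPerm (n : ℕ) (w : List ℤ) : Set where
  field
    sp-length   : length w ≡ n
    sp-entries  : All (ValidEntry n) w
    sp-distinct : AllPairs AbsDistinct w
    sp-covers   : ∀ {v} → ValidEntry n v → v ∈ w ⊎ neg1 v ∈ w
open SignedPerm public

sp-unique : ∀ {n w} → SignedPerm n w → Unique w
sp-unique g = AllPairs.map proj₁ (sp-distinct g)

sp-∉-neg : ∀ {n w x y} → SignedPerm n w → x ∈ w → y ∈ w → x ≢ neg1 y
sp-∉-neg g = go (sp-distinct g) (sp-entries g)
  where
  go : ∀ {n w x y} → AllPairs AbsDistinct w → All (ValidEntry n) w → x ∈ w → y ∈ w → x ≢ neg1 y
  go (a ∷ d) (v ∷ _)  (here refl) (here refl) = nonzero⇒≢neg (entry-nonzero v)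
  go (a ∷ d) _        (here refl) (there y∈) = proj₂ (All.lookup a y∈)
  go (a ∷ d) _        (there x∈) (here refl) = λ x≡-y → proj₂ (All.lookup a x∈) (sym (≡neg⇒neg≡ x≡-y))
  go (a ∷ d) (_ ∷ vs) (there x∈) (there y∈) = go d vs x∈ y∈

unique-unfold : ∀ {n w} → SignedPerm n w → Unique (unfold w)
unique-unfold {n} {w} g =
  UniqueP.++⁺ (sp-unique g) (unique-reverse (UniqueP.map⁺ ℤP.neg-injective (sp-unique g))) disjoint
  where
  disjoint : ∀ {v} → ¬ (v ∈ w × v ∈ reverse (map neg1 w))
  disjoint (v∈w , v∈rev) =
    let (z , z∈w , v≡-z) = ∈P.∈-map⁻ neg1 (AnyP.reverse⁻ v∈rev) in sp-∉-neg g v∈w z∈w v≡-z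

∈-unfold : ∀ {n w v} → SignedPerm n w → ValidEntry n v → v ∈ unfold w
∈-unfold {n} {w} {v} g vv with sp-covers g vv
... | inj₁ v∈w  = ∈P.∈-++⁺ˡ v∈w
... | inj₂ -v∈w =
  ∈P.∈-++⁺ʳ w (AnyP.reverse⁺ (subst (_∈ map neg1 w) (ℤP.neg-involutive v) (∈P.∈-map⁺ neg1 -v∈w)))

length-unfold : ∀ {n w} → SignedPerm n w → length (unfold w) ≡ n + n
length-unfold {n} {w} g = begin
  length (w ++ reverse (map neg1 w))        ≡⟨ ListP.length-++ w ⟩
  length w + length (reverse (map neg1 w))  ≡⟨ cong (λ k → length w + k) (ListP.length-reverse (map neg1 w)) ⟩
  length w + length (map neg1 w)            ≡⟨ cong (λ k → length w + k) (ListP.length-map neg1 w) ⟩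
  length w + length w                       ≡⟨ cong₂ _+_ (sp-length g) (sp-length g) ⟩
  n + n                                     ∎
  where open ≡-Reasoning

reverse-unfold : ∀ w → reverse (unfold w) ≡ map neg1 (unfold w)
reverse-unfold w = begin
  reverse (w ++ reverse (map neg1 w))
    ≡⟨ ListP.reverse-++ w (reverse (map neg1 w)) ⟩
  reverse (reverse (map neg1 w)) ++ reverse w
    ≡⟨ cong (_++ reverse w) (ListP.reverse-involutive (map neg1 w)) ⟩
  map neg1 w ++ reverse w
    ≡⟨ cong (λ z → map neg1 w ++ reverse z) (sym map-neg-neg) ⟩
  map neg1 w ++ reverse (map neg1 (map neg1 w))
    ≡⟨ cong (map neg1 w ++_) (ListP.reverse-map neg1 (map neg1 w)) ⟨
  map neg1 w ++ map neg1 (reverse (map neg1 w))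
    ≡⟨ ListP.map-++ neg1 w (reverse (map neg1 w)) ⟨
  map neg1 (w ++ reverse (map neg1 w)) ∎
  where
  open ≡-Reasoning
  map-neg-neg : map neg1 (map neg1 w) ≡ w
  map-neg-neg = trans (sym (ListP.map-∘ w)) (trans (ListP.map-cong ℤP.neg-involutive w) (ListP.map-id w))

unfold-map : ∀ (f : ℤ → ℤ) w → (∀ x → f (neg1 x) ≡ neg1 (f x)) → unfold (map f w) ≡ map f (unfold w)
unfold-map f w f-neg = begin
  map f w ++ reverse (map neg1 (map f w))  ≡⟨ cong (λ z → map f w ++ reverse z) neg-f ⟩
  map f w ++ reverse (map f (map neg1 w))  ≡⟨ cong (map f w ++_) (ListP.reverse-map f (map neg1 w)) ⟨
  map f w ++ map f (reverse (map neg1 w))  ≡⟨ ListP.map-++ f w _ ⟨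
  map f (unfold w)                         ∎
  where
  open ≡-Reasoning
  neg-f : map neg1 (map f w) ≡ map f (map neg1 w)
  neg-f = trans (sym (ListP.map-∘ w)) (trans (sym (ListP.map-cong f-neg w)) (ListP.map-∘ w))

exch-signedPerm : ∀ {n w t q} → SignedPerm n w → ValidEntry n t → ValidEntry n q → SignedPerm n (map (exch t q) w)
exch-signedPerm {n} {w} {t} {q} g vt vq = record
  { sp-length   = trans (ListP.length-map φ w) (sp-length g)
  ; sp-entries  = AllP.map⁺ (All.map (exch-valid vt vq) (sp-entries g))
  ; sp-distinct = AllPairsP.map⁺ (AllPairs.map distinct (sp-distinct g))
  ; sp-covers   = covers
  }
  where
  φ : ℤ → ℤ
  φ = exch t q
  t≢0 : Nonzero t
  t≢0 = entry-nonzero vt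
  q≢0 : Nonzero q
  q≢0 = entry-nonzero vq
  distinct : ∀ {x y} → AbsDistinct x y → AbsDistinct (φ x) (φ y)
  distinct {x} {y} (x≢y , x≢-y) =
    (λ e → x≢y (exch-injective t q t≢0 q≢0 e)) ,
    (λ e → x≢-y (exch-injective t q t≢0 q≢0 (trans e (sym (exch-neg t q y t≢0 q≢0)))))
  covers : ∀ {v} → ValidEntry n v → v ∈ map φ w ⊎ neg1 v ∈ map φ w
  covers {v} vv with sp-covers g (exch-valid vt vq vv)
  ... | inj₁ φv∈w  = inj₁ (subst (_∈ map φ w) (exch-involutive t q v t≢0 q≢0) (∈P.∈-map⁺ φ φv∈w))
  ... | inj₂ -φv∈w = inj₂ (subst (_∈ map φ w)
          (trans (exch-neg t q (φ v) t≢0 q≢0) (cong neg1 (exch-involutive t q v t≢0 q≢0)))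
          (∈P.∈-map⁺ φ -φv∈w))

opaque
  place : List ℤ → ℤ → ℕ
  place w v = position v (unfold w)

  place-< : ∀ {n w v} → SignedPerm n w → ValidEntry n v → place w v < n + n
  place-< {n} {w} {v} g vv = subst (place w v <_) (length-unfold g) (position-< (∈-unfold g vv))

  place-neg : ∀ {n w v} → SignedPerm n w → ValidEntry n v → place w (neg1 v) ≡ (n + n) ∸ suc (place w v)
  place-neg {n} {w} {v} g vv = begin
    position (neg1 v) (unfold w)
      ≡⟨ cong (position (neg1 v)) (sym (ListP.reverse-involutive (unfold w))) ⟩
    position (neg1 v) (reverse (reverse (unfold w)))
      ≡⟨ position-reverse (reverse (unfold w)) (unique-reverse (unique-unfold g))
                          (AnyP.reverse⁺ (∈-unfold g (neg-entry vv))) ⟩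
    length (reverse (unfold w)) ∸ suc (position (neg1 v) (reverse (unfold w)))
      ≡⟨ cong₂ (λ a b → a ∸ suc b) (trans (ListP.length-reverse (unfold w)) (length-unfold g)) neg-position ⟩
    (n + n) ∸ suc (position v (unfold w)) ∎
    where
    open ≡-Reasoning
    neg-position : position (neg1 v) (reverse (unfold w)) ≡ position v (unfold w)
    neg-position = trans (cong (position (neg1 v)) (reverse-unfold w))
                         (position-map neg1 (unfold w) (λ _ e → ℤP.neg-injective e))

  place-∈ : ∀ {n w v} → SignedPerm n w → v ∈ w → place w v ≡ position v w
  place-∈ {n} {w} g v∈w = position-++ˡ w _ v∈w

  place-∈-< : ∀ {n w v} → SignedPerm n w → v ∈ w → place w v < n
  place-∈-< {n} {w} g v∈w = subst (_ <_) (sp-length g) (subst (_< length w) (sym (place-∈ g v∈w)) (position-< v∈w))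

  place-∉ : ∀ {n w v} → SignedPerm n w → v ∉ w → n ≤ place w v
  place-∉ {n} {w} {v} g v∉w =
    subst (_≤ place w v) (sp-length g) (subst (length w ≤_) (sym (position-++ʳ w _ v∉w)) (ℕP.m≤m+n (length w) _))

  place-injective : ∀ {n w a b} → SignedPerm n w → ValidEntry n a → ValidEntry n b → place w a ≡ place w b → a ≡ b
  place-injective {n} {w} {a} {b} g va vb eq = begin
    a                                       ≡⟨ lookup-position (∈-unfold g va) ⟨
    nth (unfold w) (position a (unfold w))  ≡⟨ cong (nth (unfold w)) eq ⟩
    nth (unfold w) (position b (unfold w))  ≡⟨ lookup-position (∈-unfold g vb) ⟩
    b                                       ∎
    where open ≡-Reasoning

  place-exch : ∀ {n w t q} → ValidEntry n t → ValidEntry n q → ∀ v →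
               place (map (exch t q) w) v ≡ place w (exch t q v)
  place-exch {n} {w} {t} {q} vt vq v = begin
    position v (unfold (map φ w))
      ≡⟨ cong (position v) (unfold-map φ w (λ x → exch-neg t q x t≢0 q≢0)) ⟩
    position v (map φ (unfold w))
      ≡⟨ cong (λ z → position z (map φ (unfold w))) (sym (exch-involutive t q v t≢0 q≢0)) ⟩
    position (φ (φ v)) (map φ (unfold w))
      ≡⟨ position-map φ (unfold w) (λ _ e → exch-injective t q t≢0 q≢0 e) ⟩
    position (φ v) (unfold w) ∎
    where
    open ≡-Reasoning
    φ : ℤ → ℤ
    φ = exch t q
    t≢0 : Nonzero t
    t≢0 = entry-nonzero vt
    q≢0 : Nonzero q
    q≢0 = entry-nonzero vq

  elem-after-unfold : ∀ {n u t x} → SignedPerm n u → ValidEntry n t → ValidEntry n x →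
                      elem x (after t (unfold u)) ≡ (place u t <ᵇ place u x)
  elem-after-unfold g vt vx = elem-after _ (unique-unfold g) (∈-unfold g vt) (∈-unfold g vx)

-- The algorithm h as a relation between windows

module Algorithm (n : ℕ) (t : ℤ) (vt : ValidEntry n t) where

  candidate : List ℤ → ℤ → Bool
  candidate u x = (rank n t <ᵇ rank n x) ∧ (place u t <ᵇ place u x)

  choice : List ℤ → List ℤ → Maybe ℤ
  choice L u = last (filterᵇ (candidate u) L)

  data Run (L : List ℤ) (u : List ℤ) : List ℤ → Set where
    stop : choice L u ≡ nothing → Run L u u
    step : ∀ {q v} → choice L u ≡ just q → Run L (map (exch t q) u) v → Run L u v

  candidate-true : ∀ {u x} → rank n t < rank n x → place u t < place u x → T (candidate u x)
  candidate-true r< p< = Equivalence.from BoolP.T-∧ (ℕP.<⇒<ᵇ r< , ℕP.<⇒<ᵇ p<)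

  candidate-false : ∀ {u x} → place u x < place u t → ¬ T (candidate u x)
  candidate-false {u} {x} x<t c = ℕP.<-asym x<t (ℕP.<ᵇ⇒< _ _ (proj₂ (Equivalence.to BoolP.T-∧ c)))

  candidate⇒later : ∀ {u x} → T (candidate u x) → place u t < place u x
  candidate⇒later c = ℕP.<ᵇ⇒< _ _ (proj₂ (Equivalence.to BoolP.T-∧ c))

  hStep-filter : ∀ {u} L → SignedPerm n u → All (ValidEntry n) L →
    filterᵇ (λ x → (rank n t <ᵇ rank n x) ∧ elem x (after t (unfold u))) L ≡ filterᵇ (candidate u) L
  hStep-filter {u} L g vL =
    filterᵇ-cong-local _ _ L (All.map (λ vx → cong (_ ∧_) (elem-after-unfold g vt vx)) vL)

  choice-entry : ∀ u {q} L → All (ValidEntry n) L → choice L u ≡ just q → ValidEntry n q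
  choice-entry u L vL eq = All.lookup vL (proj₁ (∈P.∈-filter⁻ (T? ∘ candidate u) {xs = L} (last-∈ _ eq)))

  choice-candidate : ∀ u {q} L → choice L u ≡ just q → T (candidate u q)
  choice-candidate u L eq = proj₂ (∈P.∈-filter⁻ (T? ∘ candidate u) {xs = L} (last-∈ _ eq))

  hStep-nothing : ∀ {u} L → SignedPerm n u → All (ValidEntry n) L → choice L u ≡ nothing →
                  hStep n t L (unfold u) ≡ nothing
  hStep-nothing {u} L g vL eq rewrite hStep-filter L g vL | eq = refl

  hStep-just : ∀ {u q} L → SignedPerm n u → All (ValidEntry n) L → choice L u ≡ just q →
               hStep n t L (unfold u) ≡ just (unfold (map (exch t q) u))
  hStep-just {u} {q} L g vL eq rewrite hStep-filter L g vL | eq =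
    cong just (sym (unfold-map (exch t q) u (λ x → exch-neg t q x (entry-nonzero vt) (entry-nonzero vq))))
    where
    vq : ValidEntry n q
    vq = choice-entry u L vL eq

  place-t-exch : ∀ {u q} → ValidEntry n q → place (map (exch t q) u) t ≡ place u q
  place-t-exch {u} {q} vq = trans (place-exch {w = u} vt vq t) (cong (place u) (exch-t t q))

  place-q-exch : ∀ {u q} → ValidEntry n q → place (map (exch t q) u) q ≡ place u t
  place-q-exch {u} {q} vq = trans (place-exch {w = u} vt vq q) (cong (place u) (exch-q t q))

  choice-advances : ∀ u {q} L → All (ValidEntry n) L → choice L u ≡ just q →
                    place u t < place (map (exch t q) u) t
  choice-advances u L vL eq =
    subst (place u t <_) (sym (place-t-exch (choice-entry u L vL eq))) (candidate⇒later (choice-candidate u L eq))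

  choice-signedPerm : ∀ {u q} L → All (ValidEntry n) L → SignedPerm n u → choice L u ≡ just q →
                      SignedPerm n (map (exch t q) u)
  choice-signedPerm {u} L vL g eq = exch-signedPerm g vt (choice-entry u L vL eq)

  run-signedPerm : ∀ {L u v} → All (ValidEntry n) L → SignedPerm n u → Run L u v → SignedPerm n v
  run-signedPerm vL g (stop _)    = g
  run-signedPerm vL g (step eq r) = run-signedPerm vL (choice-signedPerm _ vL g eq) r

  -- The entry t moves strictly right at each step, so fuel f with n + n ≤ f + place u t suffices.
  fuel-step : ∀ {u q} L f → All (ValidEntry n) L → choice L u ≡ just q →
              n + n ≤ suc f + place u t → n + n ≤ f + place (map (exch t q) u) t
  fuel-step {u} {q} L f vL eq enough =
    ℕP.≤-trans enough (subst (_≤ f + place (map (exch t q) u) t) (ℕP.+-suc f (place u t))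
                             (ℕP.+-monoʳ-≤ f (choice-advances u L vL eq)))

  hIter-run : ∀ {L u v} → All (ValidEntry n) L → SignedPerm n u → Run L u v →
              ∀ f → n + n ≤ f + place u t → hIter f n t L (unfold u) ≡ unfold v
  hIter-run vL g (stop eq) zero _ = refl
  hIter-run {L} vL g (stop eq) (suc f) _ rewrite hStep-nothing L g vL eq = refl
  hIter-run vL g (step eq r) zero enough = ⊥-elim (ℕP.<⇒≱ (place-< g vt) enough)
  hIter-run {L} vL g (step eq r) (suc f) enough rewrite hStep-just L g vL eq =
    hIter-run vL (choice-signedPerm L vL g eq) r f (fuel-step L f vL eq enough)

  run-exists : ∀ {L} → All (ValidEntry n) L → ∀ f u → SignedPerm n u → n + n ≤ f + place u t → ∃ (Run L u)
  run-exists {L} vL f u g enough with choice L u in eq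
  ... | nothing = u , stop eq
  ... | just q with f
  ...   | zero   = ⊥-elim (ℕP.<⇒≱ (place-< g vt) enough)
  ...   | suc f′ =
    let (v , r) = run-exists vL f′ (map (exch t q) u) (choice-signedPerm L vL g eq) (fuel-step L f′ vL eq enough)
    in v , step eq r

  run : ∀ {L} → All (ValidEntry n) L → ∀ {u} → SignedPerm n u → ∃ (Run L u)
  run vL {u} g = run-exists vL (n + n) u g (ℕP.m≤m+n (n + n) _)

  h-run : ∀ {L u v} → All (ValidEntry n) L → SignedPerm n u → Run L u v → h n t L u ≡ v
  h-run {L} {u} {v} vL g r = begin
    take n (hIter (suc (2 * n)) n t L (unfold u))
      ≡⟨ cong (take n) (hIter-run vL g r (suc (2 * n)) enough) ⟩
    take n (unfold v)
      ≡⟨ cong (λ k → take k (unfold v)) (sym (sp-length (run-signedPerm vL g r))) ⟩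
    take (length v) (unfold v)
      ≡⟨ take-length-++ v _ ⟩
    v ∎
    where
    open ≡-Reasoning
    enough : n + n ≤ suc (2 * n) + place u t
    enough = ℕP.≤-trans (ℕP.≤-reflexive (cong (λ k → n + k) (sym (ℕP.+-identityʳ n))))
                        (ℕP.≤-trans (ℕP.n≤1+n _) (ℕP.m≤m+n _ _))

  h-step : ∀ {L u q} → All (ValidEntry n) L → SignedPerm n u → choice L u ≡ just q →
           h n t L u ≡ h n t L (map (exch t q) u)
  h-step {L} vL g eq =
    let g′ = choice-signedPerm L vL g eq
        (v , r) = run vL g′
    in trans (h-run vL g (step eq r)) (sym (h-run vL g′ r))

  choice-insert : ∀ {u x} A B → ¬ T (candidate u x) → choice (A ++ x ∷ B) u ≡ choice (A ++ B) u
  choice-insert {u} {x} A B not-cand = cong last (begin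
    filterᵇ (candidate u) (A ++ x ∷ B)
      ≡⟨ ListP.filter-++ (T? ∘ candidate u) A (x ∷ B) ⟩
    filterᵇ (candidate u) A ++ filterᵇ (candidate u) (x ∷ B)
      ≡⟨ cong (filterᵇ (candidate u) A ++_) (ListP.filter-reject (T? ∘ candidate u) not-cand) ⟩
    filterᵇ (candidate u) A ++ filterᵇ (candidate u) B
      ≡⟨ ListP.filter-++ (T? ∘ candidate u) A B ⟨
    filterᵇ (candidate u) (A ++ B) ∎)
    where open ≡-Reasoning

  choice-last : ∀ {u q} L → T (candidate u q) → choice (L ++ q ∷ []) u ≡ just q
  choice-last {u} {q} L cand = begin
    last (filterᵇ (candidate u) (L ++ q ∷ []))
      ≡⟨ cong last (ListP.filter-++ (T? ∘ candidate u) L (q ∷ [])) ⟩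
    last (filterᵇ (candidate u) L ++ filterᵇ (candidate u) (q ∷ []))
      ≡⟨ cong (λ z → last (filterᵇ (candidate u) L ++ z)) (ListP.filter-accept (T? ∘ candidate u) cand) ⟩
    last (filterᵇ (candidate u) L ++ q ∷ [])
      ≡⟨ last-∷ʳ (filterᵇ (candidate u) L) q ⟩
    just q ∎
    where open ≡-Reasoning

  choice-penultimate : ∀ {u q m} L → T (candidate u q) → ¬ T (candidate u m) → choice (L ++ q ∷ m ∷ []) u ≡ just q
  choice-penultimate {u} {q} {m} L cand not-cand = begin
    choice (L ++ q ∷ m ∷ []) u          ≡⟨ cong (λ z → choice z u) (sym (ListP.++-assoc L (q ∷ []) (m ∷ []))) ⟩
    choice ((L ++ q ∷ []) ++ m ∷ []) u  ≡⟨ choice-insert (L ++ q ∷ []) [] not-cand ⟩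
    choice ((L ++ q ∷ []) ++ []) u      ≡⟨ cong (λ z → choice z u) (ListP.++-identityʳ (L ++ q ∷ [])) ⟩
    choice (L ++ q ∷ []) u              ≡⟨ choice-last L cand ⟩
    just q                              ∎
    where open ≡-Reasoning

  -- An entry x lying left of t stays left of t along the run, so it is never a candidate.
  run-insert : ∀ {A B x u v} → All (ValidEntry n) (A ++ B) → x ≢ t → x ≢ neg1 t → SignedPerm n u →
               place u x < place u t → Run (A ++ B) u v → Run (A ++ x ∷ B) u v
  run-insert {A} {B} vL x≢t x≢-t g x<t (stop eq) = stop (trans (choice-insert A B (candidate-false x<t)) eq)
  run-insert {A} {B} {x} {u} vL x≢t x≢-t g x<t (step {q} eq r) =
    step (trans (choice-insert A B (candidate-false x<t)) eq)
         (run-insert vL x≢t x≢-t (exch-signedPerm g vt vq) still-left r)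
    where
    vq : ValidEntry n q
    vq = choice-entry u (A ++ B) vL eq
    t<q : place u t < place u q
    t<q = candidate⇒later (choice-candidate u (A ++ B) eq)
    left-of-q : place u (exch t q x) < place u q
    left-of-q with exch t q x | exch-view t q x
    ... | _ | at-t x≡t          = ⊥-elim (x≢t x≡t)
    ... | _ | at-q _ refl       = ⊥-elim (ℕP.<-asym x<t t<q)
    ... | _ | at-negt _ _ x≡-t  = ⊥-elim (x≢-t x≡-t)
    ... | _ | at-negq _ _ _ x≡-q =
      subst₂ _<_ (sym (place-neg g vt)) (sym (trans (cong (place u) (sym (≡neg⇒neg≡ x≡-q))) (place-neg g (x-valid x≡-q))))
                 (reflect-< x<t (place-< g vt))
      where
      x-valid : x ≡ neg1 q → ValidEntry n x
      x-valid refl = neg-entry vq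
    ... | _ | fixed _ _ _ _     = ℕP.<-trans x<t t<q
    still-left : place (map (exch t q) u) x < place (map (exch t q) u) t
    still-left = subst₂ _<_ (sym (place-exch {w = u} vt vq x)) (sym (place-t-exch vq)) left-of-q

  h-insert : ∀ {A B x u} → All (ValidEntry n) (A ++ B) → All (ValidEntry n) (A ++ x ∷ B) → x ≢ t → x ≢ neg1 t →
             SignedPerm n u → place u x < place u t → h n t (A ++ B) u ≡ h n t (A ++ x ∷ B) u
  h-insert vL vL′ x≢t x≢-t g x<t =
    let (v , r) = run vL g in trans (h-run vL g r) (sym (h-run vL′ g (run-insert vL x≢t x≢-t g x<t r)))

  h-snoc-ascent : ∀ {L q u} → All (ValidEntry n) L → All (ValidEntry n) (L ++ q ∷ []) → q ≢ t → q ≢ neg1 t →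
                  SignedPerm n u → place u q < place u t → h n t L u ≡ h n t (L ++ q ∷ []) u
  h-snoc-ascent {L} {q} {u} vL vL′ q≢t q≢-t g q<t =
    trans (cong (λ z → h n t z u) (sym (ListP.++-identityʳ L)))
          (h-insert (subst (All (ValidEntry n)) (sym (ListP.++-identityʳ L)) vL) vL′ q≢t q≢-t g q<t)

  h-snoc-descent : ∀ {L q u} → All (ValidEntry n) L → All (ValidEntry n) (L ++ q ∷ []) → ValidEntry n q →
                   q ≢ t → q ≢ neg1 t → SignedPerm n u → rank n t < rank n q → place u t < place u q →
                   h n t L (map (exch t q) u) ≡ h n t (L ++ q ∷ []) u
  h-snoc-descent {L} {q} {u} vL vL′ vq q≢t q≢-t g r< t<q =
    trans (h-snoc-ascent vL vL′ q≢t q≢-t (exch-signedPerm g vt vq) q<t′)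
          (sym (h-step vL′ g (choice-last L (candidate-true r< t<q))))
    where
    q<t′ : place (map (exch t q) u) q < place (map (exch t q) u) t
    q<t′ = subst₂ _<_ (sym (place-q-exch vq)) (sym (place-t-exch vq)) t<q

  module PairDescent {A : List ℤ} {m : ℤ} (vL : All (ValidEntry n) (A ++ m ∷ neg1 m ∷ []))
    (vD : All (ValidEntry n) (A ++ neg1 m ∷ [])) (vm : ValidEntry n m) (m≢t : m ≢ t) (m≢-t : m ≢ neg1 t)
    (r<m : rank n t < rank n m) (r<-m : rank n t < rank n (neg1 m))
    {u : List ℤ} (g : SignedPerm n u) (t<m : place u t < place u m) where

    neg-left : place u (neg1 m) < place u t →
               h n t (A ++ neg1 m ∷ []) (map (exch t m) u) ≡ h n t (A ++ m ∷ neg1 m ∷ []) u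
    neg-left -m<t = begin
      h n t (A ++ neg1 m ∷ []) u′
        ≡⟨ h-insert vD vL m≢t m≢-t g′ m<t′ ⟩
      h n t (A ++ m ∷ neg1 m ∷ []) u′
        ≡⟨ h-step vL g (choice-penultimate A (candidate-true r<m t<m) (candidate-false -m<t)) ⟨
      h n t (A ++ m ∷ neg1 m ∷ []) u ∎
      where
      open ≡-Reasoning
      u′ : List ℤ
      u′ = map (exch t m) u
      g′ : SignedPerm n u′
      g′ = exch-signedPerm g vt vm
      m<t′ : place u′ m < place u′ t
      m<t′ = subst₂ _<_ (sym (place-q-exch vm)) (sym (place-t-exch vm)) t<m

    -- Here h exchanges t first with -m and then with m.
    neg-right : place u t < place u (neg1 m) →
                h n t (A ++ neg1 m ∷ []) (map (exch t m) u) ≡ h n t (A ++ m ∷ neg1 m ∷ []) u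
    neg-right t<-m = begin
      h n t (A ++ neg1 m ∷ []) u′                          ≡⟨ h-step vD g′ chosen′ ⟩
      h n t (A ++ neg1 m ∷ []) (map (exch t (neg1 m)) u′)  ≡⟨ cong (h n t (A ++ neg1 m ∷ [])) commute ⟨
      h n t (A ++ neg1 m ∷ []) u₂                          ≡⟨ h-insert vD vL m≢t m≢-t g₂ m<t₂ ⟩
      h n t (A ++ m ∷ neg1 m ∷ []) u₂                      ≡⟨ h-step vL g₁ chosen₂ ⟨
      h n t (A ++ m ∷ neg1 m ∷ []) u₁                      ≡⟨ h-step vL g chosen₁ ⟨
      h n t (A ++ m ∷ neg1 m ∷ []) u                       ∎
      where
      open ≡-Reasoning
      v-m : ValidEntry n (neg1 m)
      v-m = neg-entry vm
      u′ u₁ u₂ : List ℤ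
      u′ = map (exch t m) u
      u₁ = map (exch t (neg1 m)) u
      u₂ = map (exch t m) u₁
      g′ : SignedPerm n u′
      g′ = exch-signedPerm g vt vm
      g₁ : SignedPerm n u₁
      g₁ = exch-signedPerm g vt v-m
      g₂ : SignedPerm n u₂
      g₂ = exch-signedPerm g₁ vt vm
      -m<-t : place u (neg1 m) < place u (neg1 t)
      -m<-t = subst₂ _<_ (sym (place-neg g vm)) (sym (place-neg g vt)) (reflect-< t<m (place-< g vm))
      place₁ : ∀ v → place u₁ v ≡ place u (exch t (neg1 m) v)
      place₁ v = place-exch {w = u} vt v-m v
      place₁-t : place u₁ t ≡ place u (neg1 m)
      place₁-t = trans (place₁ t) (cong (place u) (exch-t t (neg1 m)))
      place₁-neg-m : place u₁ (neg1 m) ≡ place u t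
      place₁-neg-m = trans (place₁ (neg1 m)) (cong (place u) (exch-q t (neg1 m)))
      place₁-m : place u₁ m ≡ place u (neg1 t)
      place₁-m = trans (place₁ m) (cong (place u) (exch-negq′ t m (entry-nonzero vm)))
      chosen₁ : choice (A ++ m ∷ neg1 m ∷ []) u ≡ just (neg1 m)
      chosen₁ = trans (cong (λ z → choice z u) (sym (ListP.++-assoc A (m ∷ []) (neg1 m ∷ []))))
                      (choice-last (A ++ m ∷ []) (candidate-true r<-m t<-m))
      chosen₂ : choice (A ++ m ∷ neg1 m ∷ []) u₁ ≡ just m
      chosen₂ = choice-penultimate A
        (candidate-true r<m (subst₂ _<_ (sym place₁-t) (sym place₁-m) -m<-t))
        (candidate-false (subst₂ _<_ (sym place₁-neg-m) (sym place₁-t) t<-m))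
      chosen′ : choice (A ++ neg1 m ∷ []) u′ ≡ just (neg1 m)
      chosen′ = choice-last A (candidate-true r<-m (subst₂ _<_ (sym (place-t-exch vm)) (sym place′-neg-m) m<-t))
        where
        place′-neg-m : place u′ (neg1 m) ≡ place u (neg1 t)
        place′-neg-m = trans (place-exch {w = u} vt vm (neg1 m)) (cong (place u) (exch-negq t m (entry-nonzero vm)))
        m<-t : place u m < place u (neg1 t)
        m<-t = subst (place u m <_) (sym (place-neg g vt))
                     (reflect-swap (place-< g vm) (subst (place u t <_) (place-neg g vm) t<-m))
      commute : u₂ ≡ map (exch t (neg1 m)) u′
      commute = trans (sym (ListP.map-∘ u))
        (trans (ListP.map-cong (λ x → exch-comm-neg t m x (entry-nonzero vt) (entry-nonzero vm) m≢t m≢-t) u) (ListP.map-∘ u))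
      m<t₂ : place u₂ m < place u₂ t
      m<t₂ = subst₂ _<_ (sym (trans (place-exch {w = u₁} vt vm m) (trans (cong (place u₁) (exch-q t m)) place₁-t)))
                        (sym (trans (place-exch {w = u₁} vt vm t) (trans (cong (place u₁) (exch-t t m)) place₁-m)))
                        -m<-t

  h-snoc-pair-descent : ∀ {A m u} → All (ValidEntry n) (A ++ m ∷ neg1 m ∷ []) → All (ValidEntry n) (A ++ neg1 m ∷ []) →
    ValidEntry n m → m ≢ t → m ≢ neg1 t → rank n t < rank n m → rank n t < rank n (neg1 m) →
    SignedPerm n u → place u t < place u m →
    h n t (A ++ neg1 m ∷ []) (map (exch t m) u) ≡ h n t (A ++ m ∷ neg1 m ∷ []) u
  h-snoc-pair-descent {A} {m} {u} vL vD vm m≢t m≢-t r<m r<-m g t<m with ℕP.<-cmp (place u (neg1 m)) (place u t)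
  ... | tri< -m<t _ _ = PairDescent.neg-left vL vD vm m≢t m≢-t r<m r<-m g t<m -m<t
  ... | tri≈ _ -m≡t _ = ⊥-elim (m≢-t (sym (≡neg⇒neg≡ (sym (place-injective g (neg-entry vm) vt -m≡t)))))
  ... | tri> _ _ t<-m = PairDescent.neg-right vL vD vm m≢t m≢-t r<m r<-m g t<m t<-m

-- The length function of D_n

infix 5 _≺ᵇ_

-- The order 1 < 2 < … < -2 < -1 of ±[n], which does not depend on n (unlike `rank n`).
_≺ᵇ_ : ℤ → ℤ → Bool
+ a      ≺ᵇ + b      = a <ᵇ b
+ a      ≺ᵇ -[1+ b ] = true
-[1+ a ] ≺ᵇ + b      = false
-[1+ a ] ≺ᵇ -[1+ b ] = b <ᵇ a

indicator : Bool → ℕ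
indicator true  = 1
indicator false = 0

pairInversions : ℤ → ℤ → ℕ
pairInversions x y = indicator (y ≺ᵇ x) + indicator (neg1 y ≺ᵇ x)

inversionsFrom : ℤ → List ℤ → ℕ
inversionsFrom x []       = 0
inversionsFrom x (y ∷ ys) = pairInversions x y + inversionsFrom x ys

dLength : List ℤ → ℕ
dLength []       = 0
dLength (x ∷ xs) = inversionsFrom x xs + dLength xs

oddNegatives : List ℤ → Bool
oddNegatives []       = false
oddNegatives (x ∷ xs) = isNeg x xor oddNegatives xs

oddNegatives-++ : ∀ xs ys → oddNegatives (xs ++ ys) ≡ oddNegatives xs xor oddNegatives ys
oddNegatives-++ []       ys = refl
oddNegatives-++ (x ∷ xs) ys =
  trans (cong (isNeg x xor_) (oddNegatives-++ xs ys)) (sym (BoolP.xor-assoc (isNeg x) (oddNegatives xs) (oddNegatives ys)))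

xor-cancel-middle : ∀ f p b q c → (f xor p) xor (b xor ((f xor q) xor c)) ≡ p xor (b xor (q xor c))
xor-cancel-middle false p b q c = refl
xor-cancel-middle true  p b q c = begin
  not p xor (b xor (not q xor c))      ≡⟨ cong (λ z → not p xor (b xor z)) (BoolP.not-distribˡ-xor q c) ⟨
  not p xor (b xor not (q xor c))      ≡⟨ cong (not p xor_) (BoolP.not-distribʳ-xor b (q xor c)) ⟨
  not p xor not (b xor (q xor c))      ≡⟨ BoolP.not-distribˡ-xor p _ ⟨
  not (p xor not (b xor (q xor c)))    ≡⟨ cong not (BoolP.not-distribʳ-xor p _) ⟨
  not (not (p xor (b xor (q xor c))))  ≡⟨ BoolP.not-involutive _ ⟩
  p xor (b xor (q xor c))              ∎
  where open ≡-Reasoning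

∣∣-≡⇒≡⊎≡neg : ∀ {x y} → ∣ x ∣ ≡ ∣ y ∣ → x ≡ y ⊎ x ≡ neg1 y
∣∣-≡⇒≡⊎≡neg {+ a}      {+ b}      e = inj₁ (cong +_ e)
∣∣-≡⇒≡⊎≡neg {+ zero}   { -[1+ b ]} ()
∣∣-≡⇒≡⊎≡neg {+ suc a}  { -[1+ b ]} e = inj₂ (cong (λ k → + suc k) (ℕP.suc-injective e))
∣∣-≡⇒≡⊎≡neg { -[1+ a ]} {+ zero}   ()
∣∣-≡⇒≡⊎≡neg { -[1+ a ]} {+ suc b}  e = inj₂ (cong -[1+_] (ℕP.suc-injective e))
∣∣-≡⇒≡⊎≡neg { -[1+ a ]} { -[1+ b ]} e = inj₁ (cong -[1+_] (ℕP.suc-injective e))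

absDistinct⇒∣∣-≢ : ∀ {x y} → AbsDistinct x y → ∣ x ∣ ≢ ∣ y ∣
absDistinct⇒∣∣-≢ (x≢y , x≢-y) e = [ x≢y , x≢-y ]′ (∣∣-≡⇒≡⊎≡neg e)

AbsOccurs : ℕ → List ℤ → Set
AbsOccurs p w = ∃ λ z → z ∈ w × ∣ z ∣ ≡ p

absOccurs-tail : ∀ {p z w} → AbsOccurs p (z ∷ w) → ∣ z ∣ ≢ p → AbsOccurs p w
absOccurs-tail (v , here refl , e) ∣z∣≢p = ⊥-elim (∣z∣≢p e)
absOccurs-tail (v , there v∈ , e) _     = v , v∈ , e

absOccurs : ∀ {n w v} → SignedPerm n w → ValidEntry n v → AbsOccurs ∣ v ∣ w
absOccurs {w = w} {v} g vv with sp-covers g vv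
... | inj₁ v∈w  = v , v∈w , refl
... | inj₂ -v∈w = neg1 v , -v∈w , ℤP.∣-i∣≡∣i∣ v

absDistinct-others : ∀ {z p w} → All (AbsDistinct z) w → ∣ z ∣ ≡ p → All (λ y → ∣ y ∣ ≢ p) w
absDistinct-others z-distinct refl = All.map (λ zy e → absDistinct⇒∣∣-≢ zy (sym e)) z-distinct

data Avoids (p p′ : ℕ) (z : ℤ) : Set where
  avoids : ∣ z ∣ ≢ p → ∣ z ∣ ≢ p′ → Avoids p p′ z

data AbsSplit (p p′ : ℕ) : List ℤ → Set where
  abs-split : ∀ B y C → ∣ y ∣ ≡ p → All (Avoids p p′) B → All (Avoids p p′) C → AbsSplit p p′ (B ++ y ∷ C)

abs-split-at : ∀ p p′ w → AllPairs AbsDistinct w → AbsOccurs p w → All (λ z → ∣ z ∣ ≢ p′) w →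
               AbsSplit p p′ w
abs-split-at p p′ (z ∷ w) (z-distinct ∷ d) occurs (∣z∣≢p′ ∷ avoid) with ∣ z ∣ ℕ.≟ p
... | yes refl =
  abs-split [] z w refl [] (All.zipWith (λ (a , b) → avoids a b) (absDistinct-others z-distinct refl , avoid))
... | no ∣z∣≢p with abs-split-at p p′ w d (absOccurs-tail occurs ∣z∣≢p) avoid
...   | abs-split B y C ∣y∣≡p avoidB avoidC =
  abs-split (z ∷ B) y C ∣y∣≡p (avoids ∣z∣≢p ∣z∣≢p′ ∷ avoidB) avoidC

entries-split : ∀ {P : ℤ → Set} A {x} B {y C} → All P (A ++ x ∷ B ++ y ∷ C) →
                All P A × P x × All P B × P y × All P C
entries-split A B ps with AllP.++⁻ A ps
... | pA , (px ∷ rest) with AllP.++⁻ B rest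
...   | pB , (py ∷ pC) = pA , px , pB , py , pC

oddNegatives-split : ∀ A x B y C → oddNegatives (A ++ x ∷ B ++ y ∷ C) ≡
                     oddNegatives A xor (isNeg x xor (oddNegatives B xor (isNeg y xor oddNegatives C)))
oddNegatives-split A x B y C =
  trans (oddNegatives-++ A (x ∷ B ++ y ∷ C))
        (cong (λ z → oddNegatives A xor (isNeg x xor z)) (oddNegatives-++ B (y ∷ C)))

unfold-chain : ∀ {n} A {x} B {y} C → SignedPerm n (A ++ x ∷ B ++ y ∷ C) → ValidEntry n x → ValidEntry n y →
  let w = A ++ x ∷ B ++ y ∷ C in
  place w x < place w y × place w y < place w (neg1 y) × place w (neg1 y) < place w (neg1 x)
unfold-chain {n} A {x} B {y} C g vx vy = x<y , y<-y , -y<-x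
  where
  w : List ℤ
  w = A ++ x ∷ B ++ y ∷ C
  x∈ : x ∈ w
  x∈ = ∈P.∈-++⁺ʳ A (here refl)
  y∈ : y ∈ w
  y∈ = ∈P.∈-++⁺ʳ A (there (∈P.∈-++⁺ʳ B (here refl)))
  x<y : place w x < place w y
  x<y = subst₂ _<_ (sym (place-∈ g x∈)) (sym (place-∈ g y∈))
                   (position-before A (sp-unique g) (∈P.∈-++⁺ʳ B (here refl)))
  y<n : place w y < n
  y<n = place-∈-< g y∈
  y<-y : place w y < place w (neg1 y)
  y<-y = subst (place w y <_) (sym (place-neg g vy)) (ℕP.m+n≤o⇒m≤o∸n (suc (place w y)) (ℕP.+-mono-≤ y<n y<n))
  -y<-x : place w (neg1 y) < place w (neg1 x)
  -y<-x = subst₂ _<_ (sym (place-neg g vy)) (sym (place-neg g vx)) (reflect-< x<y (ℕP.<-≤-trans y<n (ℕP.m≤m+n n n)))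

data LengthChange (α β : ℤ) (w : List ℤ) : Set where
  ascent  : place w α < place w β → dLength (map (exch α β) w) ≡ suc (dLength w) → LengthChange α β w
  descent : place w β < place w α → dLength w ≡ suc (dLength (map (exch α β) w)) → LengthChange α β w

record IsSimpleExchange (n : ℕ) (α β : ℤ) : Set where
  field
    α-valid         : ValidEntry n α
    β-valid         : ValidEntry n β
    length-change   : ∀ {w} → SignedPerm n w → LengthChange α β w
    parity-preserved : ∀ {w} → SignedPerm n w → oddNegatives (map (exch α β) w) ≡ oddNegatives w
open IsSimpleExchange public

-- An exchange of two entries α, β that every other entry compares to in the same way changes dLength by exactly one.
module AdjacentExchange
  (n : ℕ) (α β : ℤ) (vα : ValidEntry n α) (vβ : ValidEntry n β) (∣α∣≢∣β∣ : ∣ α ∣ ≢ ∣ β ∣)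
  (same-order : ∀ z → ∣ z ∣ ≢ ∣ α ∣ → ∣ z ∣ ≢ ∣ β ∣ → ValidEntry n z →
                (α ≺ᵇ z ≡ β ≺ᵇ z) × (z ≺ᵇ α ≡ z ≺ᵇ β))
  (same-order-neg : ∀ z → ∣ z ∣ ≢ ∣ α ∣ → ∣ z ∣ ≢ ∣ β ∣ → ValidEntry n z →
                    (neg1 α ≺ᵇ z ≡ neg1 β ≺ᵇ z) × (z ≺ᵇ neg1 α ≡ z ≺ᵇ neg1 β))
  (inversion-α-β   : pairInversions β α ≡ suc (pairInversions α β))
  (inversion-α-nβ  : pairInversions β (neg1 α) ≡ suc (pairInversions α (neg1 β)))
  (inversion-nα-β  : pairInversions (neg1 α) β ≡ suc (pairInversions (neg1 β) α))
  (inversion-nα-nβ : pairInversions (neg1 α) (neg1 β) ≡ suc (pairInversions (neg1 β) (neg1 α)))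
  (sign-flip : Bool)
  (sign-change : ∀ v → ∣ v ∣ ≡ ∣ α ∣ ⊎ ∣ v ∣ ≡ ∣ β ∣ → isNeg (exch α β v) ≡ sign-flip xor isNeg v)
  where

  σ : ℤ → ℤ
  σ = exch α β

  α≢0 : Nonzero α
  α≢0 = entry-nonzero vα
  β≢0 : Nonzero β
  β≢0 = entry-nonzero vβ

  OffBlock : ℤ → Set
  OffBlock = Avoids ∣ α ∣ ∣ β ∣

  data OnBlock (v : ℤ) : Set where
    on-α : ∣ v ∣ ≡ ∣ α ∣ → OnBlock v
    on-β : ∣ v ∣ ≡ ∣ β ∣ → OnBlock v

  OnBoth : ℤ → ℤ → Set
  OnBoth x y = (∣ x ∣ ≡ ∣ α ∣ × ∣ y ∣ ≡ ∣ β ∣) ⊎ (∣ x ∣ ≡ ∣ β ∣ × ∣ y ∣ ≡ ∣ α ∣)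

  on-block? : ∀ z → OnBlock z ⊎ OffBlock z
  on-block? z with ∣ z ∣ ℕ.≟ ∣ α ∣ | ∣ z ∣ ℕ.≟ ∣ β ∣
  ... | yes e | _     = inj₁ (on-α e)
  ... | no _  | yes e = inj₁ (on-β e)
  ... | no a  | no b  = inj₂ (avoids a b)

  exch-off-block : ∀ {z} → OffBlock z → σ z ≡ z
  exch-off-block {z} (avoids z≢α z≢β) = exch-fixed α β z
    (λ e → z≢α (cong ∣_∣ e)) (λ e → z≢β (cong ∣_∣ e))
    (λ e → z≢α (trans (cong ∣_∣ e) (ℤP.∣-i∣≡∣i∣ α)))
    (λ e → z≢β (trans (cong ∣_∣ e) (ℤP.∣-i∣≡∣i∣ β)))

  map-exch-off-block : ∀ {xs} → All OffBlock xs → map σ xs ≡ xs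
  map-exch-off-block off = ListP.map-id-local (All.map exch-off-block off)

  neg-onBlock : ∀ {v} → OnBlock v → OnBlock (neg1 v)
  neg-onBlock {v} (on-α e) = on-α (trans (ℤP.∣-i∣≡∣i∣ v) e)
  neg-onBlock {v} (on-β e) = on-β (trans (ℤP.∣-i∣≡∣i∣ v) e)

  neg-offBlock : ∀ {v} → OffBlock v → OffBlock (neg1 v)
  neg-offBlock {v} (avoids a b) =
    avoids (λ e → a (trans (sym (ℤP.∣-i∣≡∣i∣ v)) e)) (λ e → b (trans (sym (ℤP.∣-i∣≡∣i∣ v)) e))

  exch-on-block-order : ∀ {v z} → OnBlock v → ValidEntry n z → OffBlock z →
                        (σ v ≺ᵇ z ≡ v ≺ᵇ z) × (z ≺ᵇ σ v ≡ z ≺ᵇ v)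
  exch-on-block-order {v} {z} (on-α e) vz (avoids a b) with ∣∣-≡⇒≡⊎≡neg {v} {α} e
  ... | inj₁ refl = let (p , q) = same-order z a b vz in
    trans (cong (_≺ᵇ z) (exch-t α β)) (sym p) , trans (cong (z ≺ᵇ_) (exch-t α β)) (sym q)
  ... | inj₂ refl = let (p , q) = same-order-neg z a b vz in
    trans (cong (_≺ᵇ z) (exch-negt α β α≢0)) (sym p) , trans (cong (z ≺ᵇ_) (exch-negt α β α≢0)) (sym q)
  exch-on-block-order {v} {z} (on-β e) vz (avoids a b) with ∣∣-≡⇒≡⊎≡neg {v} {β} e
  ... | inj₁ refl = let (p , q) = same-order z a b vz in
    trans (cong (_≺ᵇ z) (exch-q α β)) p , trans (cong (z ≺ᵇ_) (exch-q α β)) q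
  ... | inj₂ refl = let (p , q) = same-order-neg z a b vz in
    trans (cong (_≺ᵇ z) (exch-negq α β β≢0)) p , trans (cong (z ≺ᵇ_) (exch-negq α β β≢0)) q

  pairInversions-exch-left : ∀ {v z} → OnBlock v → ValidEntry n z → OffBlock z →
                             pairInversions (σ v) z ≡ pairInversions v z
  pairInversions-exch-left on vz off = cong₂ _+_
    (cong indicator (proj₂ (exch-on-block-order on vz off)))
    (cong indicator (proj₂ (exch-on-block-order on (neg-entry vz) (neg-offBlock off))))

  pairInversions-exch-right : ∀ {v z} → OnBlock v → ValidEntry n z → OffBlock z →
                              pairInversions z (σ v) ≡ pairInversions z v
  pairInversions-exch-right {v} {z} on vz off = cong₂ _+_
    (cong indicator (proj₁ (exch-on-block-order on vz off)))
    (cong indicator (trans (cong (_≺ᵇ z) (sym (exch-neg α β v α≢0 β≢0)))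
                           (proj₁ (exch-on-block-order (neg-onBlock on) vz off))))

  inversionsFrom-off : ∀ {z} xs → ValidEntry n z → OffBlock z → All (ValidEntry n) xs →
                       inversionsFrom z (map σ xs) ≡ inversionsFrom z xs
  inversionsFrom-off []       vz off _ = refl
  inversionsFrom-off {z} (y ∷ ys) vz off (vy ∷ vys) with on-block? y
  ... | inj₁ on   = cong₂ _+_ (pairInversions-exch-right on vz off) (inversionsFrom-off ys vz off vys)
  ... | inj₂ offy = cong₂ _+_ (cong (pairInversions z) (exch-off-block offy)) (inversionsFrom-off ys vz off vys)

  inversionsFrom-on : ∀ {x} xs → OnBlock x → All (ValidEntry n) xs → All OffBlock xs →
                      inversionsFrom (σ x) (map σ xs) ≡ inversionsFrom x xs
  inversionsFrom-on []       on _ _ = refl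
  inversionsFrom-on {x} (y ∷ ys) on (vy ∷ vys) (offy ∷ offys) = cong₂ _+_
    (trans (cong (pairInversions (σ x)) (exch-off-block offy)) (pairInversions-exch-left on vy offy))
    (inversionsFrom-on ys on vys offys)

  inversionsFrom-on-pair : ∀ {x y} B C → OnBlock x → All (ValidEntry n) B → All OffBlock B →
    ValidEntry n y → All (ValidEntry n) C → All OffBlock C →
    inversionsFrom (σ x) (map σ (B ++ y ∷ C)) + pairInversions x y ≡
    inversionsFrom x (B ++ y ∷ C) + pairInversions (σ x) (σ y)
  inversionsFrom-on-pair {x} {y} [] C on _ _ vy vC offC =
    trans (cong (λ k → (pairInversions (σ x) (σ y) + k) + pairInversions x y) (inversionsFrom-on C on vC offC))
          (xy∙z≈zy∙x (pairInversions (σ x) (σ y)) (inversionsFrom x C) (pairInversions x y))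
  inversionsFrom-on-pair {x} {y} (z ∷ B) C on (vz ∷ vB) (offz ∷ offB) vy vC offC =
    trans (ℕP.+-assoc (pairInversions (σ x) (σ z)) _ (pairInversions x y))
      (trans (cong₂ _+_ (trans (cong (pairInversions (σ x)) (exch-off-block offz)) (pairInversions-exch-left on vz offz))
                        (inversionsFrom-on-pair B C on vB offB vy vC offC))
             (sym (ℕP.+-assoc (pairInversions x z) _ _)))

  dLength-exch-single : ∀ {y} B C → All (ValidEntry n) B → All OffBlock B → OnBlock y → ValidEntry n y →
    All (ValidEntry n) C → All OffBlock C → dLength (map σ (B ++ y ∷ C)) ≡ dLength (B ++ y ∷ C)
  dLength-exch-single {y} [] C _ _ on vy vC offC =
    cong₂ _+_ (inversionsFrom-on C on vC offC) (cong dLength (map-exch-off-block offC))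
  dLength-exch-single {y} (z ∷ B) C (vz ∷ vB) (offz ∷ offB) on vy vC offC = cong₂ _+_
    (trans (cong (λ k → inversionsFrom k (map σ (B ++ y ∷ C))) (exch-off-block offz))
           (inversionsFrom-off (B ++ y ∷ C) vz offz (AllP.++⁺ vB (vy ∷ vC))))
    (dLength-exch-single B C vB offB on vy vC offC)

  dLength-exch-pair : ∀ {x y} A B C → All (ValidEntry n) A → All OffBlock A → OnBlock x → ValidEntry n x →
    All (ValidEntry n) B → All OffBlock B → OnBlock y → ValidEntry n y → All (ValidEntry n) C → All OffBlock C →
    dLength (map σ (A ++ x ∷ B ++ y ∷ C)) + pairInversions x y ≡
    dLength (A ++ x ∷ B ++ y ∷ C) + pairInversions (σ x) (σ y)
  dLength-exch-pair {x} {y} [] B C _ _ onx vx vB offB ony vy vC offC = begin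
    (inversionsFrom (σ x) (map σ (B ++ y ∷ C)) + dLength (map σ (B ++ y ∷ C))) + pairInversions x y
      ≡⟨ cong (λ k → (inversionsFrom (σ x) (map σ (B ++ y ∷ C)) + k) + pairInversions x y)
              (dLength-exch-single B C vB offB ony vy vC offC) ⟩
    (inversionsFrom (σ x) (map σ (B ++ y ∷ C)) + dLength (B ++ y ∷ C)) + pairInversions x y
      ≡⟨ xy∙z≈xz∙y (inversionsFrom (σ x) (map σ (B ++ y ∷ C))) _ (pairInversions x y) ⟩
    (inversionsFrom (σ x) (map σ (B ++ y ∷ C)) + pairInversions x y) + dLength (B ++ y ∷ C)
      ≡⟨ cong (_+ dLength (B ++ y ∷ C)) (inversionsFrom-on-pair B C onx vB offB vy vC offC) ⟩
    (inversionsFrom x (B ++ y ∷ C) + pairInversions (σ x) (σ y)) + dLength (B ++ y ∷ C)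
      ≡⟨ xy∙z≈xz∙y (inversionsFrom x (B ++ y ∷ C)) _ _ ⟩
    (inversionsFrom x (B ++ y ∷ C) + dLength (B ++ y ∷ C)) + pairInversions (σ x) (σ y) ∎
    where open ≡-Reasoning
  dLength-exch-pair {x} {y} (z ∷ A) B C (vz ∷ vA) (offz ∷ offA) onx vx vB offB ony vy vC offC =
    trans (ℕP.+-assoc (inversionsFrom (σ z) (map σ (A ++ x ∷ B ++ y ∷ C))) _ (pairInversions x y))
      (trans (cong₂ _+_
               (trans (cong (λ k → inversionsFrom k (map σ (A ++ x ∷ B ++ y ∷ C))) (exch-off-block offz))
                      (inversionsFrom-off (A ++ x ∷ B ++ y ∷ C) vz offz (AllP.++⁺ vA (vx ∷ AllP.++⁺ vB (vy ∷ vC)))))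
               (dLength-exch-pair A B C vA offA onx vx vB offB ony vy vC offC))
             (sym (ℕP.+-assoc (inversionsFrom z (A ++ x ∷ B ++ y ∷ C)) _ _)))

  data BlockSplit : List ℤ → Set where
    block-split : ∀ A x B y C → All OffBlock A → All OffBlock B → All OffBlock C → OnBoth x y →
                  BlockSplit (A ++ x ∷ B ++ y ∷ C)

  swap-avoids : ∀ {p p′ z} → Avoids p p′ z → Avoids p′ p z
  swap-avoids (avoids a b) = avoids b a

  block-split-go : ∀ w → AllPairs AbsDistinct w → AbsOccurs ∣ α ∣ w → AbsOccurs ∣ β ∣ w → BlockSplit w
  block-split-go [] _ (_ , () , _) _
  block-split-go (z ∷ w) (z-distinct ∷ d) occα occβ with on-block? z
  ... | inj₂ (avoids a b) with block-split-go w d (absOccurs-tail occα a) (absOccurs-tail occβ b)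
  ...   | block-split A x B y C offA offB offC both = block-split (z ∷ A) x B y C (avoids a b ∷ offA) offB offC both
  block-split-go (z ∷ w) (z-distinct ∷ d) occα occβ | inj₁ (on-α e)
    with abs-split-at ∣ β ∣ ∣ α ∣ w d (absOccurs-tail occβ (λ e′ → ∣α∣≢∣β∣ (trans (sym e) e′)))
                      (absDistinct-others z-distinct e)
  ... | abs-split B y C ∣y∣ avoidB avoidC =
    block-split [] z B y C [] (All.map swap-avoids avoidB) (All.map swap-avoids avoidC) (inj₁ (e , ∣y∣))
  block-split-go (z ∷ w) (z-distinct ∷ d) occα occβ | inj₁ (on-β e)
    with abs-split-at ∣ α ∣ ∣ β ∣ w d (absOccurs-tail occα (λ e′ → ∣α∣≢∣β∣ (trans (sym e′) e)))
                      (absDistinct-others z-distinct e)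
  ... | abs-split B y C ∣y∣ avoidB avoidC = block-split [] z B y C [] avoidB avoidC (inj₂ (e , ∣y∣))

  block-split-of : ∀ {w} → SignedPerm n w → BlockSplit w
  block-split-of {w} g = block-split-go w (sp-distinct g) (absOccurs g vα) (absOccurs g vβ)

  PairChange : ℤ → ℤ → Set
  PairChange x y =
    ((x ≡ α ⊎ x ≡ neg1 β) × pairInversions (σ x) (σ y) ≡ suc (pairInversions x y)) ⊎
    ((x ≡ neg1 α ⊎ x ≡ β) × pairInversions x y ≡ suc (pairInversions (σ x) (σ y)))

  pair-change : ∀ x y → OnBoth x y → PairChange x y
  pair-change x y (inj₁ (ex , ey)) with ∣∣-≡⇒≡⊎≡neg {x} {α} ex | ∣∣-≡⇒≡⊎≡neg {y} {β} ey
  ... | inj₁ refl | inj₁ refl =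
    inj₁ (inj₁ refl , trans (cong₂ pairInversions (exch-t α β) (exch-q α β)) inversion-α-β)
  ... | inj₁ refl | inj₂ refl =
    inj₁ (inj₁ refl , trans (cong₂ pairInversions (exch-t α β) (exch-negq α β β≢0)) inversion-α-nβ)
  ... | inj₂ refl | inj₁ refl =
    inj₂ (inj₁ refl , trans inversion-nα-β (cong suc (sym (cong₂ pairInversions (exch-negt α β α≢0) (exch-q α β)))))
  ... | inj₂ refl | inj₂ refl =
    inj₂ (inj₁ refl ,
          trans inversion-nα-nβ (cong suc (sym (cong₂ pairInversions (exch-negt α β α≢0) (exch-negq α β β≢0)))))
  pair-change x y (inj₂ (ex , ey)) with ∣∣-≡⇒≡⊎≡neg {x} {β} ex | ∣∣-≡⇒≡⊎≡neg {y} {α} ey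
  ... | inj₁ refl | inj₁ refl =
    inj₂ (inj₂ refl , trans inversion-α-β (cong suc (sym (cong₂ pairInversions (exch-q α β) (exch-t α β)))))
  ... | inj₁ refl | inj₂ refl =
    inj₂ (inj₂ refl , trans inversion-α-nβ (cong suc (sym (cong₂ pairInversions (exch-q α β) (exch-negt α β α≢0)))))
  ... | inj₂ refl | inj₁ refl =
    inj₁ (inj₂ refl , trans (cong₂ pairInversions (exch-negq α β β≢0) (exch-t α β)) inversion-nα-β)
  ... | inj₂ refl | inj₂ refl =
    inj₁ (inj₂ refl , trans (cong₂ pairInversions (exch-negq α β β≢0) (exch-negt α β α≢0)) inversion-nα-nβ)

  partner-of-α : ∀ {x y} → OnBoth x y → ∣ x ∣ ≡ ∣ α ∣ → ∣ y ∣ ≡ ∣ β ∣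
  partner-of-α (inj₁ (_ , ey)) _ = ey
  partner-of-α (inj₂ (ex , _)) e = ⊥-elim (∣α∣≢∣β∣ (trans (sym e) ex))

  partner-of-β : ∀ {x y} → OnBoth x y → ∣ x ∣ ≡ ∣ β ∣ → ∣ y ∣ ≡ ∣ α ∣
  partner-of-β (inj₁ (ex , _)) e = ⊥-elim (∣α∣≢∣β∣ (trans (sym ex) e))
  partner-of-β (inj₂ (_ , ey)) _ = ey

  dLength-exch : ∀ {w} → SignedPerm n w → LengthChange α β w
  dLength-exch g with block-split-of g
  ... | block-split A x B y C offA offB offC both with entries-split A B (sp-entries g)
  ...   | vA , vx , vB , vy , vC with unfold-chain A B C g vx vy
  ...     | x<y , y<-y , -y<-x = change (pair-change x y both)
    where
    w : List ℤ
    w = A ++ x ∷ B ++ y ∷ C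
    onx : OnBlock x
    onx = [ (λ (e , _) → on-α e) , (λ (e , _) → on-β e) ]′ both
    ony : OnBlock y
    ony = [ (λ (_ , e) → on-β e) , (λ (_ , e) → on-α e) ]′ both
    inversions : dLength (map σ w) + pairInversions x y ≡ dLength w + pairInversions (σ x) (σ y)
    inversions = dLength-exch-pair A B C vA offA onx vx vB offB ony vy vC offC
    x<±y : ∀ {v} → ∣ v ∣ ≡ ∣ y ∣ → place w x < place w v
    x<±y {v} e with ∣∣-≡⇒≡⊎≡neg {v} {y} e
    ... | inj₁ refl = x<y
    ... | inj₂ refl = ℕP.<-trans x<y y<-y
    ±y<-x : ∀ {v} → ∣ v ∣ ≡ ∣ y ∣ → place w v < place w (neg1 x)
    ±y<-x {v} e with ∣∣-≡⇒≡⊎≡neg {v} {y} e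
    ... | inj₁ refl = ℕP.<-trans y<-y -y<-x
    ... | inj₂ refl = -y<-x
    change : PairChange x y → LengthChange α β w
    change (inj₁ (x-first , more)) = ascent (α<β x-first)
      (ℕP.+-cancelʳ-≡ (pairInversions x y) _ _
        (trans inversions (trans (cong (λ k → dLength w + k) more) (ℕP.+-suc (dLength w) (pairInversions x y)))))
      where
      α<β : x ≡ α ⊎ x ≡ neg1 β → place w α < place w β
      α<β (inj₁ refl) = x<±y (sym (partner-of-α {x} {y} both refl))
      α<β (inj₂ refl) = subst (place w α <_) (cong (place w) (ℤP.neg-involutive β))
                              (±y<-x (sym (partner-of-β {x} {y} both (ℤP.∣-i∣≡∣i∣ β))))
    change (inj₂ (x-first , fewer)) = descent (β<α x-first)
      (sym (ℕP.+-cancelʳ-≡ (pairInversions (σ x) (σ y)) _ _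
        (trans (sym (ℕP.+-suc (dLength (map σ w)) (pairInversions (σ x) (σ y))))
               (trans (cong (λ k → dLength (map σ w) + k) (sym fewer)) inversions))))
      where
      β<α : x ≡ neg1 α ⊎ x ≡ β → place w β < place w α
      β<α (inj₁ refl) = subst (place w β <_) (cong (place w) (ℤP.neg-involutive α))
                              (±y<-x (sym (partner-of-α {x} {y} both (ℤP.∣-i∣≡∣i∣ α))))
      β<α (inj₂ refl) = x<±y (sym (partner-of-β {x} {y} both refl))

  oddNegatives-exch : ∀ {w} → SignedPerm n w → oddNegatives (map σ w) ≡ oddNegatives w
  oddNegatives-exch g with block-split-of g
  ... | block-split A x B y C offA offB offC both = begin
    oddNegatives (map σ (A ++ x ∷ B ++ y ∷ C))
      ≡⟨ cong oddNegatives map-σ ⟩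
    oddNegatives (A ++ σ x ∷ B ++ σ y ∷ C)
      ≡⟨ oddNegatives-split A (σ x) B (σ y) C ⟩
    oA xor (isNeg (σ x) xor (oB xor (isNeg (σ y) xor oC)))
      ≡⟨ cong₂ (λ p q → oA xor (p xor (oB xor (q xor oC)))) (sign-change x onx) (sign-change y ony) ⟩
    oA xor ((sign-flip xor isNeg x) xor (oB xor ((sign-flip xor isNeg y) xor oC)))
      ≡⟨ cong (oA xor_) (xor-cancel-middle sign-flip (isNeg x) oB (isNeg y) oC) ⟩
    oA xor (isNeg x xor (oB xor (isNeg y xor oC)))
      ≡⟨ oddNegatives-split A x B y C ⟨
    oddNegatives (A ++ x ∷ B ++ y ∷ C) ∎
    where
    open ≡-Reasoning
    oA oB oC : Bool
    oA = oddNegatives A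
    oB = oddNegatives B
    oC = oddNegatives C
    onx : ∣ x ∣ ≡ ∣ α ∣ ⊎ ∣ x ∣ ≡ ∣ β ∣
    onx = Sum.map proj₁ proj₁ both
    ony : ∣ y ∣ ≡ ∣ α ∣ ⊎ ∣ y ∣ ≡ ∣ β ∣
    ony = Sum.swap (Sum.map proj₂ proj₂ both)
    map-σ : map σ (A ++ x ∷ B ++ y ∷ C) ≡ A ++ σ x ∷ B ++ σ y ∷ C
    map-σ = begin
      map σ (A ++ x ∷ B ++ y ∷ C)
        ≡⟨ ListP.map-++ σ A (x ∷ B ++ y ∷ C) ⟩
      map σ A ++ σ x ∷ map σ (B ++ y ∷ C)
        ≡⟨ cong (λ z → map σ A ++ σ x ∷ z) (ListP.map-++ σ B (y ∷ C)) ⟩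
      map σ A ++ σ x ∷ map σ B ++ σ y ∷ map σ C
        ≡⟨ cong₂ (λ a z → a ++ σ x ∷ z) (map-exch-off-block offA)
                 (cong₂ (λ b c → b ++ σ y ∷ c) (map-exch-off-block offB) (map-exch-off-block offC)) ⟩
      A ++ σ x ∷ B ++ σ y ∷ C ∎

  isSimpleExchange : IsSimpleExchange n α β
  isSimpleExchange = record
    { α-valid = vα ; β-valid = vβ ; length-change = dLength-exch ; parity-preserved = oddNegatives-exch }

-- The Coxeter generators are simple exchanges

<ᵇ-suc-left : ∀ m k → k ≢ suc m → (m <ᵇ k) ≡ (suc m <ᵇ k)
<ᵇ-suc-left m       zero          _  = refl
<ᵇ-suc-left zero    (suc zero)    k≢ = ⊥-elim (k≢ refl)
<ᵇ-suc-left zero    (suc (suc k)) _  = refl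
<ᵇ-suc-left (suc m) (suc k)       k≢ = <ᵇ-suc-left m k (λ e → k≢ (cong suc e))

<ᵇ-suc-right : ∀ k m → k ≢ m → (k <ᵇ m) ≡ (k <ᵇ suc m)
<ᵇ-suc-right zero    zero    k≢ = ⊥-elim (k≢ refl)
<ᵇ-suc-right zero    (suc m) _  = refl
<ᵇ-suc-right (suc k) zero    _  = refl
<ᵇ-suc-right (suc k) (suc m) k≢ = <ᵇ-suc-right k m (λ e → k≢ (cong suc e))

n<ᵇ1+n : ∀ a → (a <ᵇ suc a) ≡ true
n<ᵇ1+n a = <⇒<ᵇ≡true (ℕP.n<1+n a)

1+n<ᵇn : ∀ a → (suc a <ᵇ a) ≡ false
1+n<ᵇn a = ≤⇒<ᵇ≡false (ℕP.n≤1+n a)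

simple-exchange-pos : ∀ n a → suc (suc a) ≤ n → IsSimpleExchange n (+ suc a) (+ suc (suc a))
simple-exchange-pos n a a+2≤n = AdjacentExchange.isSimpleExchange n α β vα vβ ∣α∣≢∣β∣
  same-order same-order-neg inversion-α-β inversion-α-nβ inversion-nα-β inversion-nα-nβ false sign-change
  where
  α β : ℤ
  α = + suc a
  β = + suc (suc a)
  vα : ValidEntry n α
  vα = entry (s≤s z≤n) (ℕP.≤-trans (ℕP.n≤1+n _) a+2≤n)
  vβ : ValidEntry n β
  vβ = entry (s≤s z≤n) a+2≤n
  ∣α∣≢∣β∣ : ∣ α ∣ ≢ ∣ β ∣
  ∣α∣≢∣β∣ e = ℕP.1+n≢n (sym e)
  same-order : ∀ z → ∣ z ∣ ≢ ∣ α ∣ → ∣ z ∣ ≢ ∣ β ∣ → ValidEntry n z →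
               (α ≺ᵇ z ≡ β ≺ᵇ z) × (z ≺ᵇ α ≡ z ≺ᵇ β)
  same-order (+ k)      z≢α z≢β _ = <ᵇ-suc-left (suc a) k z≢β , <ᵇ-suc-right k (suc a) z≢α
  same-order -[1+ j ]   _   _   _ = refl , refl
  same-order-neg : ∀ z → ∣ z ∣ ≢ ∣ α ∣ → ∣ z ∣ ≢ ∣ β ∣ → ValidEntry n z →
                   (neg1 α ≺ᵇ z ≡ neg1 β ≺ᵇ z) × (z ≺ᵇ neg1 α ≡ z ≺ᵇ neg1 β)
  same-order-neg (+ k)    _   _   _ = refl , refl
  same-order-neg -[1+ j ] z≢α z≢β _ =
    <ᵇ-suc-right j a (λ e → z≢α (cong suc e)) , <ᵇ-suc-left a j (λ e → z≢β (cong suc e))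
  inversion-α-β : pairInversions β α ≡ suc (pairInversions α β)
  inversion-α-β rewrite n<ᵇ1+n a | 1+n<ᵇn a = refl
  inversion-α-nβ : pairInversions β (neg1 α) ≡ suc (pairInversions α (neg1 β))
  inversion-α-nβ rewrite n<ᵇ1+n a | 1+n<ᵇn a = refl
  inversion-nα-β : pairInversions (neg1 α) β ≡ suc (pairInversions (neg1 β) α)
  inversion-nα-β rewrite n<ᵇ1+n a | 1+n<ᵇn a = refl
  inversion-nα-nβ : pairInversions (neg1 α) (neg1 β) ≡ suc (pairInversions (neg1 β) (neg1 α))
  inversion-nα-nβ rewrite n<ᵇ1+n a | 1+n<ᵇn a = refl
  sign-change : ∀ v → ∣ v ∣ ≡ ∣ α ∣ ⊎ ∣ v ∣ ≡ ∣ β ∣ → isNeg (exch α β v) ≡ false xor isNeg v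
  sign-change v (inj₁ e) with ∣∣-≡⇒≡⊎≡neg {v} {α} e
  ... | inj₁ refl = cong isNeg (exch-t α β)
  ... | inj₂ refl = cong isNeg (exch-negt α β (λ ()))
  sign-change v (inj₂ e) with ∣∣-≡⇒≡⊎≡neg {v} {β} e
  ... | inj₁ refl = cong isNeg (exch-q α β)
  ... | inj₂ refl = cong isNeg (exch-negq α β (λ ()))

simple-exchange-neg : ∀ m → IsSimpleExchange (suc (suc m)) (+ suc m) -[1+ suc m ]
simple-exchange-neg m = AdjacentExchange.isSimpleExchange n α β vα vβ ∣α∣≢∣β∣
  same-order same-order-neg inversion-α-β inversion-α-nβ inversion-nα-β inversion-nα-nβ true sign-change
  where
  n : ℕ
  n = suc (suc m)
  α β : ℤ
  α = + suc m
  β = -[1+ suc m ]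
  vα : ValidEntry n α
  vα = entry (s≤s z≤n) (ℕP.n≤1+n _)
  vβ : ValidEntry n β
  vβ = entry (s≤s z≤n) ℕP.≤-refl
  ∣α∣≢∣β∣ : ∣ α ∣ ≢ ∣ β ∣
  ∣α∣≢∣β∣ e = ℕP.1+n≢n (sym e)
  small : ∀ z → ∣ z ∣ ≢ ∣ α ∣ → ∣ z ∣ ≢ ∣ β ∣ → ValidEntry n z → ∣ z ∣ ≤ m
  small z z≢α z≢β (entry _ ≤n) = ℕP.≤-pred (ℕP.≤∧≢⇒< (ℕP.≤-pred (ℕP.≤∧≢⇒< ≤n z≢β)) z≢α)
  same-order : ∀ z → ∣ z ∣ ≢ ∣ α ∣ → ∣ z ∣ ≢ ∣ β ∣ → ValidEntry n z →
               (α ≺ᵇ z ≡ β ≺ᵇ z) × (z ≺ᵇ α ≡ z ≺ᵇ β)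
  same-order (+ k) z≢α z≢β vz =
    ≤⇒<ᵇ≡false (ℕP.m≤n⇒m≤1+n (small _ z≢α z≢β vz)) , <⇒<ᵇ≡true (s≤s (small _ z≢α z≢β vz))
  same-order -[1+ j ] z≢α z≢β vz =
    sym (<⇒<ᵇ≡true (ℕP.m≤n⇒m≤1+n (small _ z≢α z≢β vz))) ,
    sym (≤⇒<ᵇ≡false (ℕP.m≤n⇒m≤1+n (ℕP.<⇒≤ (small _ z≢α z≢β vz))))
  same-order-neg : ∀ z → ∣ z ∣ ≢ ∣ α ∣ → ∣ z ∣ ≢ ∣ β ∣ → ValidEntry n z →
                   (neg1 α ≺ᵇ z ≡ neg1 β ≺ᵇ z) × (z ≺ᵇ neg1 α ≡ z ≺ᵇ neg1 β)
  same-order-neg (+ k) z≢α z≢β vz =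
    sym (≤⇒<ᵇ≡false (ℕP.m≤n⇒m≤1+n (ℕP.m≤n⇒m≤1+n (small _ z≢α z≢β vz)))) ,
    sym (<⇒<ᵇ≡true (s≤s (ℕP.m≤n⇒m≤1+n (small _ z≢α z≢β vz))))
  same-order-neg -[1+ j ] z≢α z≢β vz =
    <⇒<ᵇ≡true (small _ z≢α z≢β vz) , ≤⇒<ᵇ≡false (ℕP.<⇒≤ (small _ z≢α z≢β vz))
  inversion-α-β : pairInversions β α ≡ suc (pairInversions α β)
  inversion-α-β = refl
  inversion-α-nβ : pairInversions β (neg1 α) ≡ suc (pairInversions α (neg1 β))
  inversion-α-nβ rewrite 1+n<ᵇn m = refl
  inversion-nα-β : pairInversions (neg1 α) β ≡ suc (pairInversions (neg1 β) α)
  inversion-nα-β rewrite n<ᵇ1+n m = refl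
  inversion-nα-nβ : pairInversions (neg1 α) (neg1 β) ≡ suc (pairInversions (neg1 β) (neg1 α))
  inversion-nα-nβ rewrite n<ᵇ1+n m = refl
  sign-change : ∀ v → ∣ v ∣ ≡ ∣ α ∣ ⊎ ∣ v ∣ ≡ ∣ β ∣ → isNeg (exch α β v) ≡ true xor isNeg v
  sign-change v (inj₁ e) with ∣∣-≡⇒≡⊎≡neg {v} {α} e
  ... | inj₁ refl = cong isNeg (exch-t α β)
  ... | inj₂ refl = cong isNeg (exch-negt α β (λ ()))
  sign-change v (inj₂ e) with ∣∣-≡⇒≡⊎≡neg {v} {β} e
  ... | inj₁ refl = cong isNeg (exch-q α β)
  ... | inj₂ refl = cong isNeg (exch-negq α β (λ ()))

genα genβ : ℕ → ℕ → ℤ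
genα n a = if a ≡ᵇ n then + (n ∸ 1) else + a
genβ n a = if a ≡ᵇ n then neg1 (+ n) else + suc a

genExch : ℕ → ℕ → ℤ → ℤ
genExch n a = exch (genα n a) (genβ n a)

≡ᵇ-refl : ∀ a → (a ≡ᵇ a) ≡ true
≡ᵇ-refl a = Equivalence.to BoolP.T-≡ (ℕP.≡⇒≡ᵇ a a refl)

≢⇒≡ᵇ≡false : ∀ {a b} → a ≢ b → (a ≡ᵇ b) ≡ false
≢⇒≡ᵇ≡false {a} {b} a≢b with a ≡ᵇ b in eq
... | false = refl
... | true  = ⊥-elim (a≢b (ℕP.≡ᵇ⇒≡ a b (subst T (sym eq) _)))

genα-neg : ∀ m → genα (suc (suc m)) (suc (suc m)) ≡ + suc m
genα-neg m rewrite ≡ᵇ-refl m = refl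

genβ-neg : ∀ m → genβ (suc (suc m)) (suc (suc m)) ≡ -[1+ suc m ]
genβ-neg m rewrite ≡ᵇ-refl m = refl

genα-pos : ∀ n a → a ≢ n → genα n a ≡ + a
genα-pos n a a≢n rewrite ≢⇒≡ᵇ≡false a≢n = refl

genβ-pos : ∀ n a → a ≢ n → genβ n a ≡ + suc a
genβ-pos n a a≢n rewrite ≢⇒≡ᵇ≡false a≢n = refl

generator-simple : ∀ {n a} → 2 ≤ n → ValidGen n a → IsSimpleExchange n (genα n a) (genβ n a)
generator-simple {n} {a} (s≤s (s≤s {n = m} _)) (1≤a , a≤n) with a ℕ.≟ n
... | yes refl rewrite genα-neg m | genβ-neg m = simple-exchange-neg m
generator-simple {n} {suc a} _ (1≤a , a≤n) | no a≢n rewrite genα-pos n (suc a) a≢n | genβ-pos n (suc a) a≢n =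
  simple-exchange-pos n a (ℕP.≤∧≢⇒< a≤n a≢n)

-- The function tabulated by `gen n a` in Defs.
genWindowEntry : ℕ → ℕ → ℕ → ℤ
genWindowEntry n a v =
  if a ≡ᵇ n
    then (if v ≡ᵇ (n ∸ 1) then neg1 (+ n) else if v ≡ᵇ n then neg1 (+ (n ∸ 1)) else + v)
    else (if v ≡ᵇ a then + suc a else if v ≡ᵇ suc a then + a else + v)

nth-applyUpTo : ∀ (f : ℕ → ℤ) n k → k < n → nth (applyUpTo f n) k ≡ f k
nth-applyUpTo f (suc n) zero    _        = refl
nth-applyUpTo f (suc n) (suc k) (s≤s k<) = nth-applyUpTo (λ j → f (suc j)) n k k<

nth-gen : ∀ n a k → k < n → nth (gen n a) k ≡ genWindowEntry n a (suc k)
nth-gen n a k k<n =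
  trans (cong (λ z → nth z k) (ListP.map-applyUpTo (λ j → j) (λ j → genWindowEntry n a (suc j)) n))
        (nth-applyUpTo (λ j → genWindowEntry n a (suc j)) n k k<n)

genWindowEntry-neg : ∀ m v → genWindowEntry (suc (suc m)) (suc (suc m)) v ≡ exch (+ suc m) -[1+ suc m ] (+ v)
genWindowEntry-neg m v = by-cases (v ℕ.≟ suc m) (v ℕ.≟ suc (suc m))
  where
  n : ℕ
  n = suc (suc m)
  by-cases : Dec (v ≡ suc m) → Dec (v ≡ n) → genWindowEntry n n v ≡ exch (+ suc m) -[1+ suc m ] (+ v)
  by-cases (yes refl) _ = trans entry-at (sym (exch-t (+ suc m) -[1+ suc m ]))
    where
    entry-at : genWindowEntry n n (suc m) ≡ -[1+ suc m ]
    entry-at rewrite ≡ᵇ-refl m = refl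
  by-cases (no v≢) (yes refl) = trans entry-at (sym (exch-negq (+ suc m) -[1+ suc m ] (λ ())))
    where
    entry-at : genWindowEntry n n n ≡ neg1 (+ suc m)
    entry-at rewrite ≡ᵇ-refl m | ≢⇒≡ᵇ≡false v≢ = refl
  by-cases (no v≢) (no v≢′) =
    trans entry-at (sym (exch-fixed _ _ _ (v≢ ∘ ℤP.+-injective) (λ ()) (λ ()) (v≢′ ∘ ℤP.+-injective)))
    where
    entry-at : genWindowEntry n n v ≡ + v
    entry-at rewrite ≡ᵇ-refl m | ≢⇒≡ᵇ≡false v≢ | ≢⇒≡ᵇ≡false v≢′ = refl

genWindowEntry-pos : ∀ n a v → suc a ≢ n → genWindowEntry n (suc a) v ≡ exch (+ suc a) (+ suc (suc a)) (+ v)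
genWindowEntry-pos n a v a≢n = by-cases (v ℕ.≟ suc a) (v ℕ.≟ suc (suc a))
  where
  by-cases : Dec (v ≡ suc a) → Dec (v ≡ suc (suc a)) → genWindowEntry n (suc a) v ≡ exch (+ suc a) (+ suc (suc a)) (+ v)
  by-cases (yes refl) _ = trans entry-at (sym (exch-t (+ suc a) (+ suc (suc a))))
    where
    entry-at : genWindowEntry n (suc a) (suc a) ≡ + suc (suc a)
    entry-at rewrite ≢⇒≡ᵇ≡false a≢n | ≡ᵇ-refl a = refl
  by-cases (no v≢) (yes refl) = trans entry-at (sym (exch-q (+ suc a) (+ suc (suc a))))
    where
    entry-at : genWindowEntry n (suc a) (suc (suc a)) ≡ + suc a
    entry-at rewrite ≢⇒≡ᵇ≡false a≢n | ≢⇒≡ᵇ≡false v≢ | ≡ᵇ-refl a = refl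
  by-cases (no v≢) (no v≢′) =
    trans entry-at (sym (exch-fixed _ _ _ (v≢ ∘ ℤP.+-injective) (v≢′ ∘ ℤP.+-injective) (λ ()) (λ ())))
    where
    entry-at : genWindowEntry n (suc a) v ≡ + v
    entry-at rewrite ≢⇒≡ᵇ≡false a≢n | ≢⇒≡ᵇ≡false v≢ | ≢⇒≡ᵇ≡false v≢′ = refl

genWindowEntry-exch : ∀ n a v → 2 ≤ n → ValidGen n a → genWindowEntry n a v ≡ genExch n a (+ v)
genWindowEntry-exch n a v (s≤s (s≤s {n = m} _)) _ with a ℕ.≟ n
... | yes refl = trans (genWindowEntry-neg m v) (cong₂ (λ p q → exch p q (+ v)) (sym (genα-neg m)) (sym (genβ-neg m)))
genWindowEntry-exch n (suc a) v _ _ | no a≢n =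
  trans (genWindowEntry-pos n a v a≢n)
        (cong₂ (λ p q → exch p q (+ v)) (sym (genα-pos n (suc a) a≢n)) (sym (genβ-pos n (suc a) a≢n)))

apply-gen : ∀ {n a} → 2 ≤ n → ValidGen n a → ∀ {x} → ValidEntry n x → apply (gen n a) x ≡ genExch n a x
apply-gen n2 va {+ zero}    (entry () _)
apply-gen {n} {a} n2 va {+ suc k}   (entry _ k<n) = trans (nth-gen n a k k<n) (genWindowEntry-exch n a (suc k) n2 va)
apply-gen {n} {a} n2 va { -[1+ k ]} (entry _ k<n) =
  trans (cong neg1 (trans (nth-gen n a k k<n) (genWindowEntry-exch n a (suc k) n2 va)))
        (sym (exch-neg (genα n a) (genβ n a) (+ suc k) (entry-nonzero (α-valid S)) (entry-nonzero (β-valid S))))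
  where
  S : IsSimpleExchange n (genα n a) (genβ n a)
  S = generator-simple n2 va

-- dLength is the Coxeter length

consecutive : ℕ → ℕ → List ℤ
consecutive s zero    = []
consecutive s (suc m) = + s ∷ consecutive (suc s) m

applyUpTo-cong : ∀ {A : Set} (f g : ℕ → A) m → (∀ k → f k ≡ g k) → applyUpTo f m ≡ applyUpTo g m
applyUpTo-cong f g zero    _   = refl
applyUpTo-cong f g (suc m) f≗g = cong₂ _∷_ (f≗g 0) (applyUpTo-cong (f ∘ suc) (g ∘ suc) m (f≗g ∘ suc))

applyUpTo-consecutive : ∀ s m → applyUpTo (λ k → + (s + k)) m ≡ consecutive s m
applyUpTo-consecutive s zero    = refl
applyUpTo-consecutive s (suc m) = cong₂ _∷_ (cong +_ (ℕP.+-identityʳ s))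
  (trans (applyUpTo-cong _ _ m (λ k → cong +_ (ℕP.+-suc s k))) (applyUpTo-consecutive (suc s) m))

idPerm-consecutive : ∀ n → idPerm n ≡ consecutive 1 n
idPerm-consecutive n = trans (ListP.map-upTo (λ k → + suc k) n) (applyUpTo-consecutive 1 n)

length-consecutive : ∀ s m → length (consecutive s m) ≡ m
length-consecutive s zero    = refl
length-consecutive s (suc m) = cong suc (length-consecutive (suc s) m)

nth-consecutive : ∀ s m p → p < m → nth (consecutive s m) p ≡ + (s + p)
nth-consecutive s (suc m) zero    _        = cong +_ (sym (ℕP.+-identityʳ s))
nth-consecutive s (suc m) (suc p) (s≤s p<) = trans (nth-consecutive (suc s) m p p<) (cong +_ (sym (ℕP.+-suc s p)))

∈-consecutive⁻ : ∀ s m {x} → x ∈ consecutive s m → ∃ λ k → x ≡ + k × s ≤ k × k < s + m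
∈-consecutive⁻ s (suc m) (here refl) = s , refl , ℕP.≤-refl , subst (s <_) (sym (ℕP.+-suc s m)) (s≤s (ℕP.m≤m+n s m))
∈-consecutive⁻ s (suc m) (there x∈) =
  let (k , x≡ , s<k , k<) = ∈-consecutive⁻ (suc s) m x∈ in k , x≡ , ℕP.<⇒≤ s<k , subst (k <_) (sym (ℕP.+-suc s m)) k<

∈-consecutive⁺ : ∀ s m k → s ≤ k → k < s + m → + k ∈ consecutive s m
∈-consecutive⁺ s zero    k s≤k k< = ⊥-elim (ℕP.<⇒≱ k< (subst (_≤ k) (sym (ℕP.+-identityʳ s)) s≤k))
∈-consecutive⁺ s (suc m) k s≤k k< with s ℕ.≟ k
... | yes refl = here refl
... | no s≢k   = there (∈-consecutive⁺ (suc s) m k (ℕP.≤∧≢⇒< s≤k s≢k) (subst (k <_) (ℕP.+-suc s m) k<))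

consecutive-signedPerm : ∀ n → SignedPerm n (consecutive 1 n)
consecutive-signedPerm n = record
  { sp-length = length-consecutive 1 n ; sp-entries = entries ; sp-distinct = distinct 1 n (s≤s z≤n) ; sp-covers = covers }
  where
  entries : All (ValidEntry n) (consecutive 1 n)
  entries = All.tabulate (λ x∈ → let (k , x≡ , 1≤k , k<) = ∈-consecutive⁻ 1 n x∈ in
    subst (ValidEntry n) (sym x≡) (entry 1≤k (ℕP.≤-pred k<)))
  distinct : ∀ s m → 1 ≤ s → AllPairs AbsDistinct (consecutive s m)
  distinct s zero    _   = []
  distinct s (suc m) 1≤s = All.tabulate head-distinct ∷ distinct (suc s) m (ℕP.m≤n⇒m≤1+n 1≤s)
    where
    head-distinct : ∀ {x} → x ∈ consecutive (suc s) m → AbsDistinct (+ s) x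
    head-distinct x∈ with ∈-consecutive⁻ (suc s) m x∈
    ... | suc k , refl , s<k , _ = (λ e → ℕP.<-irrefl (ℤP.+-injective e) s<k) , (λ ())
  covers : ∀ {v} → ValidEntry n v → v ∈ consecutive 1 n ⊎ neg1 v ∈ consecutive 1 n
  covers {+ zero}    (entry () _)
  covers {+ suc k}   (entry _ k<n) = inj₁ (∈-consecutive⁺ 1 n (suc k) (s≤s z≤n) (s≤s k<n))
  covers { -[1+ k ]} (entry _ k<n) = inj₂ (∈-consecutive⁺ 1 n (suc k) (s≤s z≤n) (s≤s k<n))

idPerm-signedPerm : ∀ n → SignedPerm n (idPerm n)
idPerm-signedPerm n = subst (SignedPerm n) (sym (idPerm-consecutive n)) (consecutive-signedPerm n)

inversionsFrom-consecutive : ∀ s s′ m → s < s′ → inversionsFrom (+ s) (consecutive s′ m) ≡ 0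
inversionsFrom-consecutive s s′       zero    _   = refl
inversionsFrom-consecutive s (suc s′) (suc m) s<s′ rewrite ≤⇒<ᵇ≡false {suc s′} {s} (ℕP.<⇒≤ s<s′) =
  inversionsFrom-consecutive s (suc (suc s′)) m (ℕP.m≤n⇒m≤1+n s<s′)

dLength-consecutive : ∀ s m → dLength (consecutive s m) ≡ 0
dLength-consecutive s zero    = refl
dLength-consecutive s (suc m) = cong₂ _+_ (inversionsFrom-consecutive s (suc s) m ℕP.≤-refl) (dLength-consecutive (suc s) m)

dLength-idPerm : ∀ n → dLength (idPerm n) ≡ 0
dLength-idPerm n = trans (cong dLength (idPerm-consecutive n)) (dLength-consecutive 1 n)

apply-idPerm : ∀ {n x} → ValidEntry n x → apply (idPerm n) x ≡ x
apply-idPerm {n} {+ zero}    (entry () _)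
apply-idPerm {n} {+ suc k}   (entry _ k<n) = trans (cong (λ z → nth z k) (idPerm-consecutive n)) (nth-consecutive 1 n k k<n)
apply-idPerm {n} { -[1+ k ]} (entry _ k<n) =
  cong neg1 (trans (cong (λ z → nth z k) (idPerm-consecutive n)) (nth-consecutive 1 n k k<n))

nth-extensionality : ∀ (xs ys : List ℤ) → length xs ≡ length ys →
                     (∀ p → p < length xs → nth xs p ≡ nth ys p) → xs ≡ ys
nth-extensionality []       []       _  _    = refl
nth-extensionality (x ∷ xs) (y ∷ ys) eq same =
  cong₂ _∷_ (same 0 (s≤s z≤n)) (nth-extensionality xs ys (ℕP.suc-injective eq) (λ p p< → same (suc p) (s≤s p<)))

oddNegatives-last : ∀ (y : List ℤ) q → length y ≡ suc q → (∀ p → p < q → isNeg (nth y p) ≡ false) →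
                    oddNegatives y ≡ isNeg (nth y q)
oddNegatives-last (x ∷ [])     zero    _  _        = BoolP.xor-identityʳ (isNeg x)
oddNegatives-last (x ∷ y ∷ ys) (suc q) eq positive rewrite positive 0 (s≤s z≤n) =
  oddNegatives-last (y ∷ ys) q (ℕP.suc-injective eq) (λ p p< → positive (suc p) (s≤s p<))

-- Without descents, 1, …, n appear in increasing positions of the unfolding and n - 1 precedes -n, so
-- 1, …, n - 1 fill the first n - 1 places in order; the last entry is then ±n, and + n by evenness.
module WithoutDescent (m : ℕ) {y : List ℤ} (g : SignedPerm (suc (suc m)) y) (even : oddNegatives y ≡ false)
  (no-descent : ∀ a → ValidGen (suc (suc m)) a → place y (genα (suc (suc m)) a) < place y (genβ (suc (suc m)) a)) where

  n : ℕ
  n = suc (suc m)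

  placeOf : ℕ → ℕ
  placeOf k = place y (+ k)

  ascent-pos : ∀ a → suc (suc a) ≤ n → placeOf (suc a) < placeOf (suc (suc a))
  ascent-pos a a+2≤n = subst₂ (λ p q → place y p < place y q) (genα-pos n (suc a) a+1≢n) (genβ-pos n (suc a) a+1≢n)
    (no-descent (suc a) (s≤s z≤n , ℕP.<⇒≤ a+2≤n))
    where
    a+1≢n : suc a ≢ n
    a+1≢n e = ℕP.<-irrefl e a+2≤n

  ascent-neg : placeOf (suc m) < place y -[1+ suc m ]
  ascent-neg = subst₂ (λ p q → place y p < place y q) (genα-neg m) (genβ-neg m) (no-descent n (s≤s z≤n , ℕP.≤-refl))

  placeOf-lower : ∀ j → suc j ≤ n → j ≤ placeOf (suc j)
  placeOf-lower zero    _   = z≤n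
  placeOf-lower (suc j) j+2≤n = ℕP.≤-<-trans (placeOf-lower j (ℕP.<⇒≤ j+2≤n)) (ascent-pos j j+2≤n)

  placeOf-m+1 : placeOf (suc m) ≤ m
  placeOf-m+1 with placeOf (suc m) ℕ.≤? m
  ... | yes ≤m = ≤m
  ... | no ≰m  = ⊥-elim (ℕP.<⇒≱ below-m+1 (ℕP.≰⇒> ≰m))
    where
    n≤placeOf-n : n ≤ placeOf n
    n≤placeOf-n = ℕP.<-≤-trans (s≤s (ℕP.≰⇒> ≰m)) (ascent-pos m ℕP.≤-refl)
    reflected-n : (n + n) ∸ suc n ≡ suc m
    reflected-n = trans (cong (λ k → (m + n) ∸ k) (ℕP.+-comm 1 m)) (ℕP.[m+n]∸[m+o]≡n∸o m n 1)
    below-m+1 : placeOf (suc m) < suc m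
    below-m+1 = ℕP.<-≤-trans (subst (placeOf (suc m) <_) (place-neg g (entry (s≤s z≤n) ℕP.≤-refl)) ascent-neg)
                             (ℕP.≤-trans (ℕP.∸-monoʳ-≤ (n + n) (s≤s n≤placeOf-n)) (ℕP.≤-reflexive reflected-n))

  placeOf-upper : ∀ d j → j + d ≡ m → placeOf (suc j) ≤ j
  placeOf-upper zero    j j+0≡m = subst (λ k → placeOf (suc k) ≤ k) (trans (sym j+0≡m) (ℕP.+-identityʳ j)) placeOf-m+1
  placeOf-upper (suc d) j j+d+1≡m =
    ℕP.≤-pred (ℕP.<-≤-trans (ascent-pos j j+2≤n) (placeOf-upper d (suc j) (trans (sym (ℕP.+-suc j d)) j+d+1≡m)))
    where
    j+2≤n : suc (suc j) ≤ n
    j+2≤n = s≤s (s≤s (subst (j ≤_) j+d+1≡m (ℕP.m≤m+n j (suc d))))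

  placeOf-exact : ∀ j → j ≤ m → placeOf (suc j) ≡ j
  placeOf-exact j j≤m = ℕP.≤-antisym (placeOf-upper (m ∸ j) j (ℕP.m+[n∸m]≡n j≤m))
                                     (placeOf-lower j (s≤s (ℕP.m≤n⇒m≤1+n j≤m)))

  positive-∈ : ∀ j → j ≤ m → + suc j ∈ y
  positive-∈ j j≤m with sp-covers g (entry (s≤s z≤n) (s≤s (ℕP.m≤n⇒m≤1+n j≤m)))
  ... | inj₁ j+1∈ = j+1∈
  ... | inj₂ -j-1∈ = ⊥-elim (ℕP.<⇒≱ (s≤s (subst (_≤ m) (sym (placeOf-exact j j≤m)) j≤m))
                                    (ℕP.≤-trans (ℕP.n≤1+n (suc m)) (place-∉ g j+1∉)))
    where
    j+1∉ : + suc j ∉ y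
    j+1∉ j+1∈ = sp-∉-neg g j+1∈ -j-1∈ refl

  nth-positive : ∀ j → j ≤ m → nth y j ≡ + suc j
  nth-positive j j≤m = begin
    nth y j
      ≡⟨ cong (nth y) (trans (sym (placeOf-exact j j≤m)) (place-∈ g (positive-∈ j j≤m))) ⟩
    nth y (position (+ suc j) y)
      ≡⟨ lookup-position (positive-∈ j j≤m) ⟩
    + suc j ∎
    where open ≡-Reasoning

  last-entry : nth y (suc m) ≡ + n
  last-entry = by-sign z (abs-n (∣ z ∣ ℕ.≟ n)) positive
    where
    z : ℤ
    z = nth y (suc m)
    m+1<length : suc m < length y
    m+1<length = subst (suc m <_) (sym (sp-length g)) ℕP.≤-refl
    z∈y : z ∈ y
    z∈y = lookup-∈ y (suc m) m+1<length
    vz : ValidEntry n z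
    vz = All.lookup (sp-entries g) z∈y
    not-small : ∀ k → ∣ z ∣ ≡ suc k → k ≤ m → ⊥
    not-small k e k≤m with ∣∣-≡⇒≡⊎≡neg {z} {+ suc k} e
    ... | inj₁ z≡ = ℕP.<-irrefl (trans (sym (trans (cong (λ v → position v y) z≡)
                                                   (trans (sym (place-∈ g (positive-∈ k k≤m))) (placeOf-exact k k≤m))))
                                      (position-lookup (sp-unique g) (suc m) m+1<length)) (s≤s k≤m)
    ... | inj₂ z≡ = sp-∉-neg g (positive-∈ k k≤m) z∈y (sym (≡neg⇒neg≡ z≡))
    abs-n : Dec (∣ z ∣ ≡ n) → ∣ z ∣ ≡ n
    abs-n (yes e) = e
    abs-n (no ∣z∣≢n) with ∣ z ∣ in eq | entry-lower vz | entry-upper vz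
    ... | zero  | () | _
    ... | suc k | _  | k<n = ⊥-elim (not-small k eq (ℕP.≤-pred (ℕP.≤-pred (ℕP.≤∧≢⇒< k<n ∣z∣≢n))))
    positive : isNeg z ≡ false
    positive = trans (sym (oddNegatives-last y (suc m) (sp-length g) (λ p p< → cong isNeg (nth-positive p (ℕP.≤-pred p<)))))
                     even
    by-sign : ∀ v → ∣ v ∣ ≡ n → isNeg v ≡ false → v ≡ + n
    by-sign (+ k) e _ = cong +_ e

  window-is-identity : y ≡ idPerm n
  window-is-identity = begin
    y
      ≡⟨ nth-extensionality y (consecutive 1 n) (trans (sp-length g) (sym (length-consecutive 1 n))) same-entries ⟩
    consecutive 1 n
      ≡⟨ idPerm-consecutive n ⟨
    idPerm n ∎
    where
    open ≡-Reasoning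
    same-entries : ∀ p → p < length y → nth y p ≡ nth (consecutive 1 n) p
    same-entries p p< with p ℕ.≤? m
    ... | yes p≤m = trans (nth-positive p p≤m) (sym (nth-consecutive 1 n p (s≤s (ℕP.m≤n⇒m≤1+n p≤m))))
    ... | no p≰m = begin
      nth y p                        ≡⟨ cong (nth y) p≡m+1 ⟩
      nth y (suc m)                  ≡⟨ last-entry ⟩
      + n                            ≡⟨ nth-consecutive 1 n (suc m) ℕP.≤-refl ⟨
      nth (consecutive 1 n) (suc m)  ≡⟨ cong (nth (consecutive 1 n)) p≡m+1 ⟨
      nth (consecutive 1 n) p        ∎
      where
      p≡m+1 : p ≡ suc m
      p≡m+1 = ℕP.≤-antisym (ℕP.≤-pred (subst (p <_) (sp-length g) p<)) (ℕP.≰⇒> p≰m)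

compose-gen : ∀ {n a w} → 2 ≤ n → ValidGen n a → SignedPerm n w → compose (gen n a) w ≡ map (genExch n a) w
compose-gen n2 va g = ListP.map-cong-local (All.map (apply-gen n2 va) (sp-entries g))

genExch-signedPerm : ∀ {n a w} → 2 ≤ n → ValidGen n a → SignedPerm n w → SignedPerm n (map (genExch n a) w)
genExch-signedPerm {n} {a} n2 va g = exch-signedPerm g (α-valid S) (β-valid S)
  where
  S : IsSimpleExchange n (genα n a) (genβ n a)
  S = generator-simple n2 va

genExch-even : ∀ {n a w} → 2 ≤ n → ValidGen n a → SignedPerm n w → oddNegatives w ≡ false →
               oddNegatives (map (genExch n a) w) ≡ false
genExch-even n2 va g even = trans (parity-preserved (generator-simple n2 va) g) even

map-genExch-involutive : ∀ {n a} → 2 ≤ n → ValidGen n a → ∀ w → map (genExch n a) (map (genExch n a) w) ≡ w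
map-genExch-involutive {n} {a} n2 va w = trans (sym (ListP.map-∘ w))
  (trans (ListP.map-cong (λ x → exch-involutive _ _ x (entry-nonzero (α-valid S)) (entry-nonzero (β-valid S))) w)
         (ListP.map-id w))
  where
  S : IsSimpleExchange n (genα n a) (genβ n a)
  S = generator-simple n2 va

prodW-signedPerm : ∀ {n} → 2 ≤ n → ∀ ws → All (ValidGen n) ws → SignedPerm n (prodW n ws)
prodW-signedPerm {n} n2 []       _           = idPerm-signedPerm n
prodW-signedPerm {n} n2 (a ∷ ws) (va ∷ vws) =
  subst (SignedPerm n) (sym (compose-gen n2 va (prodW-signedPerm n2 ws vws)))
        (genExch-signedPerm n2 va (prodW-signedPerm n2 ws vws))

dLength-prodW-≤ : ∀ {n} → 2 ≤ n → ∀ ws → All (ValidGen n) ws → dLength (prodW n ws) ≤ length ws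
dLength-prodW-≤ {n} n2 [] _ = ℕP.≤-reflexive (dLength-idPerm n)
dLength-prodW-≤ {n} n2 (a ∷ ws) (va ∷ vws)
  rewrite compose-gen n2 va (prodW-signedPerm n2 ws vws)
  with length-change (generator-simple n2 va) (prodW-signedPerm n2 ws vws)
... | ascent _ longer  = subst (_≤ suc (length ws)) (sym longer) (s≤s (dLength-prodW-≤ n2 ws vws))
... | descent _ shorter =
  ℕP.≤-trans (ℕP.n≤1+n _)
             (ℕP.≤-trans (ℕP.≤-reflexive (sym shorter)) (ℕP.m≤n⇒m≤1+n (dLength-prodW-≤ n2 ws vws)))

HasDescent : ℕ → List ℤ → Set
HasDescent n y = Σ ℕ λ a → ValidGen n a × dLength y ≡ suc (dLength (map (genExch n a) y))

AscentsUpTo : ℕ → List ℤ → ℕ → Set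
AscentsUpTo n y k = ∀ a → ValidGen n a → a ≤ k → place y (genα n a) < place y (genβ n a)

descent-or-ascents : ∀ {n y} → 2 ≤ n → SignedPerm n y → ∀ k → k ≤ n → HasDescent n y ⊎ AscentsUpTo n y k
descent-or-ascents n2 g zero    _ = inj₂ (λ a (1≤a , _) a≤0 → ⊥-elim (ℕP.<⇒≱ 1≤a a≤0))
descent-or-ascents {n} {y} n2 g (suc k) k<n with descent-or-ascents n2 g k (ℕP.<⇒≤ k<n)
... | inj₁ descent-found = inj₁ descent-found
... | inj₂ ascents with length-change (generator-simple n2 (s≤s z≤n , k<n)) g
...   | descent _ shorter = inj₁ (suc k , (s≤s z≤n , k<n) , shorter)
...   | ascent α<β _ = inj₂ extended
  where
  extended : AscentsUpTo n y (suc k)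
  extended a va a≤k+1 with a ℕ.≟ suc k
  ... | yes refl = α<β
  ... | no a≢    = ascents a va (ℕP.≤-pred (ℕP.≤∧≢⇒< a≤k+1 a≢))

word-of-length : ∀ {n} → 2 ≤ n → ∀ k {y} → dLength y ≡ k → SignedPerm n y → oddNegatives y ≡ false →
                 Σ (List ℕ) λ ws → All (ValidGen n) ws × length ws ≡ k × prodW n ws ≡ y
word-of-length {n} n2 k {y} len g even with descent-or-ascents n2 g n ℕP.≤-refl
word-of-length n2 zero    len g even | inj₁ (a , va , shorter) = ⊥-elim (ℕP.1+n≢0 (trans (sym shorter) len))
word-of-length {n} n2 (suc k) {y} len g even | inj₁ (a , va , shorter) =
  let g′ = genExch-signedPerm n2 va g
      even′ = genExch-even n2 va g even
      (ws , vws , length-ws , prodW-ws) = word-of-length n2 k (ℕP.suc-injective (trans (sym shorter) len)) g′ even′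
  in a ∷ ws , va ∷ vws , cong suc length-ws ,
     trans (cong (compose (gen n a)) prodW-ws) (trans (compose-gen n2 va g′) (map-genExch-involutive n2 va y))
word-of-length {suc zero} (s≤s ()) k len g even | inj₂ _
word-of-length {suc (suc m)} n2 k {y} len g even | inj₂ ascents
  with WithoutDescent.window-is-identity m g even (λ a va → ascents a va (proj₂ va))
... | refl = [] , [] , trans (sym (dLength-idPerm (suc (suc m)))) len , refl

hasLength-dLength : ∀ {n y} → 2 ≤ n → SignedPerm n y → oddNegatives y ≡ false → HasLength n y (dLength y)
hasLength-dLength {n} {y} n2 g even =
  word-of-length n2 (dLength y) refl g even ,
  λ ws vws prodW-ws → subst (λ z → dLength z ≤ length ws) prodW-ws (dLength-prodW-≤ n2 ws vws)

hasLength-gen-compose : ∀ {n a y} → 2 ≤ n → ValidGen n a → SignedPerm n y → oddNegatives y ≡ false →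
                        HasLength n (compose (gen n a) y) (dLength (map (genExch n a) y))
hasLength-gen-compose {n} {a} {y} n2 va g even =
  subst (λ z → HasLength n z (dLength (map (genExch n a) y))) (sym (compose-gen n2 va g))
        (hasLength-dLength n2 (genExch-signedPerm n2 va g) (genExch-even n2 va g even))

demStep-ascent : ∀ {n a y} → 2 ≤ n → ValidGen n a → SignedPerm n y → oddNegatives y ≡ false →
                 place y (genα n a) < place y (genβ n a) → DemStep n a y (map (genExch n a) y)
demStep-ascent {n} {a} {y} n2 va g even α<β with length-change (generator-simple n2 va) g
... | descent β<α _ = ⊥-elim (ℕP.<-asym α<β β<α)
... | ascent _ longer =
  dLength (map (genExch n a) y) , dLength y , hasLength-gen-compose n2 va g even , hasLength-dLength n2 g even ,
  inj₁ (subst (dLength y <_) (sym longer) ℕP.≤-refl , sym (compose-gen n2 va g))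

demStep-descent : ∀ {n a y} → 2 ≤ n → ValidGen n a → SignedPerm n y → oddNegatives y ≡ false →
                  place y (genβ n a) < place y (genα n a) → DemStep n a y y
demStep-descent {n} {a} {y} n2 va g even β<α with length-change (generator-simple n2 va) g
... | ascent α<β _ = ⊥-elim (ℕP.<-asym β<α α<β)
... | descent _ shorter =
  dLength (map (genExch n a) y) , dLength y , hasLength-gen-compose n2 va g even , hasLength-dLength n2 g even ,
  inj₂ (ℕP.≤-trans (ℕP.n≤1+n _) (ℕP.≤-reflexive (sym shorter)) , refl)

-- Words in the generators acting on entries

act : ℕ → List ℕ → ℤ → ℤ
act n Q = apply (prodW n Q)

nth-map : ∀ (f : ℤ → ℤ) (v : List ℤ) k → k < length v → nth (map f v) k ≡ f (nth v k)
nth-map f (x ∷ v) zero    _        = refl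
nth-map f (x ∷ v) (suc k) (s≤s k<) = nth-map f v k k<

nth-compose-gen : ∀ {n a v k} → 2 ≤ n → ValidGen n a → SignedPerm n v → k < n →
                  nth (compose (gen n a) v) k ≡ genExch n a (nth v k)
nth-compose-gen {n} {a} {v} {k} n2 va g k<n =
  trans (nth-map (apply (gen n a)) v k k<) (apply-gen n2 va (All.lookup (sp-entries g) (lookup-∈ v k k<)))
  where
  k< : k < length v
  k< = subst (k <_) (sym (sp-length g)) k<n

apply-compose-gen : ∀ {n a v x} → 2 ≤ n → ValidGen n a → SignedPerm n v → ValidEntry n x →
                    apply (compose (gen n a) v) x ≡ genExch n a (apply v x)
apply-compose-gen {x = + zero}    n2 va g (entry () _)
apply-compose-gen {x = + suc k}   n2 va g (entry _ k<n) = nth-compose-gen n2 va g k<n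
apply-compose-gen {n} {a} {v} { -[1+ k ]} n2 va g (entry _ k<n) =
  trans (cong neg1 (nth-compose-gen n2 va g k<n))
        (sym (exch-neg (genα n a) (genβ n a) (nth v k) (entry-nonzero (α-valid S)) (entry-nonzero (β-valid S))))
  where
  S : IsSimpleExchange n (genα n a) (genβ n a)
  S = generator-simple n2 va

act-cons : ∀ {n} → 2 ≤ n → ∀ {a ws x} → ValidGen n a → All (ValidGen n) ws → ValidEntry n x →
           act n (a ∷ ws) x ≡ genExch n a (act n ws x)
act-cons n2 va vws vx = apply-compose-gen n2 va (prodW-signedPerm n2 _ vws) vx

act-signedMap : ∀ {n} → 2 ≤ n → ∀ ws → All (ValidGen n) ws → SignedMap n (act n ws)
act-signedMap {n} n2 [] _ = record
  { maps-entries = λ vx → subst (ValidEntry n) (sym (apply-idPerm vx)) vx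
  ; commutes-neg = λ vx → trans (apply-idPerm (neg-entry vx)) (cong neg1 (sym (apply-idPerm vx)))
  ; injective    = λ vx vy e → trans (sym (apply-idPerm vx)) (trans e (apply-idPerm vy))
  }
act-signedMap {n} n2 (a ∷ ws) (va ∷ vws) = record
  { maps-entries = λ vx → subst (ValidEntry n) (sym (act-cons n2 va vws vx)) (exch-valid vα vβ (maps-entries Φ vx))
  ; commutes-neg = λ {x} vx → begin
      act n (a ∷ ws) (neg1 x)
        ≡⟨ act-cons n2 va vws (neg-entry vx) ⟩
      genExch n a (act n ws (neg1 x))
        ≡⟨ cong (genExch n a) (commutes-neg Φ vx) ⟩
      genExch n a (neg1 (act n ws x))
        ≡⟨ exch-neg (genα n a) (genβ n a) (act n ws x) (entry-nonzero vα) (entry-nonzero vβ) ⟩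
      neg1 (genExch n a (act n ws x))
        ≡⟨ cong neg1 (act-cons n2 va vws vx) ⟨
      neg1 (act n (a ∷ ws) x) ∎
  ; injective = λ vx vy e → injective Φ vx vy
      (exch-injective _ _ (entry-nonzero vα) (entry-nonzero vβ)
        (trans (sym (act-cons n2 va vws vx)) (trans e (act-cons n2 va vws vy))))
  }
  where
  open ≡-Reasoning
  Φ : SignedMap n (act n ws)
  Φ = act-signedMap n2 ws vws
  vα : ValidEntry n (genα n a)
  vα = α-valid (generator-simple n2 va)
  vβ : ValidEntry n (genβ n a)
  vβ = β-valid (generator-simple n2 va)

act-++ : ∀ {n} → 2 ≤ n → ∀ xs {ys x} → All (ValidGen n) xs → All (ValidGen n) ys → ValidEntry n x →
         act n (xs ++ ys) x ≡ act n xs (act n ys x)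
act-++ {n} n2 []       {ys} _ vys vx = sym (apply-idPerm (maps-entries (act-signedMap n2 ys vys) vx))
act-++ {n} n2 (a ∷ xs) {ys} {x} (va ∷ vxs) vys vx = begin
  act n (a ∷ xs ++ ys) x               ≡⟨ act-cons n2 va (AllP.++⁺ vxs vys) vx ⟩
  genExch n a (act n (xs ++ ys) x)     ≡⟨ cong (genExch n a) (act-++ n2 xs vxs vys vx) ⟩
  genExch n a (act n xs (act n ys x))  ≡⟨ act-cons n2 va vxs (maps-entries (act-signedMap n2 ys vys) vx) ⟨
  act n (a ∷ xs) (act n ys x)          ∎
  where open ≡-Reasoning

act-snoc : ∀ {n} → 2 ≤ n → ∀ Q {a x} → All (ValidGen n) Q → ValidGen n a → ValidEntry n x →
           act n (Q ++ a ∷ []) x ≡ act n Q (genExch n a x)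
act-snoc n2 Q vQ va vx =
  trans (act-++ n2 Q vQ (va ∷ []) vx) (cong (act _ Q) (trans (act-cons n2 va [] vx) (cong (genExch _ _) (apply-idPerm vx))))

compose-prodW-signedPerm : ∀ {n} → 2 ≤ n → ∀ ws {w} → All (ValidGen n) ws → SignedPerm n w →
                           SignedPerm n (compose (prodW n ws) w)
compose-prodW-signedPerm {n} n2 [] {w} _ g =
  subst (SignedPerm n) (sym (ListP.map-id-local (All.map apply-idPerm (sp-entries g)))) g
compose-prodW-signedPerm {n} n2 (a ∷ ws) {w} (va ∷ vws) g =
  subst (SignedPerm n) (trans (sym (ListP.map-∘ w)) (sym (ListP.map-cong-local (All.map (act-cons n2 va vws) (sp-entries g)))))
        (genExch-signedPerm n2 va (compose-prodW-signedPerm n2 ws vws g))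

place-act : ∀ {n} → 2 ≤ n → ∀ ws {w v} → All (ValidGen n) ws → SignedPerm n w → ValidEntry n v →
            place (compose (prodW n ws) w) (act n ws v) ≡ place w v
place-act {n} n2 [] {w} {v} _ g vv =
  cong₂ place (ListP.map-id-local (All.map apply-idPerm (sp-entries g))) (apply-idPerm vv)
place-act {n} n2 (a ∷ ws) {w} {v} (va ∷ vws) g vv = begin
  place (map (act n (a ∷ ws)) w) (act n (a ∷ ws) v)
    ≡⟨ cong₂ place (ListP.map-cong-local (All.map (act-cons n2 va vws) (sp-entries g))) (act-cons n2 va vws vv) ⟩
  place (map (genExch n a ∘ act n ws) w) (genExch n a (act n ws v))
    ≡⟨ cong (λ z → place z (genExch n a (act n ws v))) (ListP.map-∘ w) ⟩
  place (map (genExch n a) (map (act n ws) w)) (genExch n a (act n ws v))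
    ≡⟨ place-exch {w = map (act n ws) w} vα vβ (genExch n a (act n ws v)) ⟩
  place (map (act n ws) w) (genExch n a (genExch n a (act n ws v)))
    ≡⟨ cong (place (map (act n ws) w)) (exch-involutive _ _ _ (entry-nonzero vα) (entry-nonzero vβ)) ⟩
  place (map (act n ws) w) (act n ws v)
    ≡⟨ place-act n2 ws vws g vv ⟩
  place w v ∎
  where
  open ≡-Reasoning
  vα : ValidEntry n (genα n a)
  vα = α-valid (generator-simple n2 va)
  vβ : ValidEntry n (genβ n a)
  vβ = β-valid (generator-simple n2 va)

-- Appending a generator to Q

DemazureClaim : ℕ → ℤ → List ℕ → List ℤ → Set
DemazureClaim n t Q L =
  ∀ w → SignedPerm n w → oddNegatives w ≡ false → Demazure n Q w (h n t L (compose (prodW n Q) w))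

demazure-snoc : ∀ {n} Q {a w y z} → DemStep n a w y → Demazure n Q y z → Demazure n (Q ++ a ∷ []) w z
demazure-snoc []      s dem-nil         = dem-cons dem-nil s
demazure-snoc (b ∷ Q) s (dem-cons d s′) = dem-cons (demazure-snoc Q s d) s′

demazureClaim-[] : ∀ {n t} → ValidEntry n t → DemazureClaim n t [] []
demazureClaim-[] {n} {t} vt w g _ = subst (Demazure n [] w) (sym h-identity) dem-nil
  where
  h-identity : h n t [] (compose (idPerm n) w) ≡ w
  h-identity = trans (cong (h n t []) (ListP.map-id-local (All.map apply-idPerm (sp-entries g))))
                     (Algorithm.h-run n t vt [] g (Algorithm.stop refl))

-- If Q carries the exchanged pair of s_a to (t, q), possibly as (-q, -t), then Q s_a = (t q) Q,
-- and the two cases of s_a ⋆ w match the two cases of the last step of h.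
module AppendGenerator {n : ℕ} (n2 : 2 ≤ n) {t : ℤ} (vt : ValidEntry n t)
  (Q : List ℕ) (vQ : All (ValidGen n) Q) {a : ℕ} (va : ValidGen n a)
  (L₁ L₂ : List ℤ) {q : ℤ} (vq : ValidEntry n q)
  (transports : (act n Q (genα n a) ≡ t × act n Q (genβ n a) ≡ q) ⊎
                (act n Q (genα n a) ≡ neg1 q × act n Q (genβ n a) ≡ neg1 t))
  (h-ascent : ∀ {u} → SignedPerm n u → place u q < place u t → h n t L₁ u ≡ h n t L₂ u)
  (h-descent : ∀ {u} → SignedPerm n u → place u t < place u q → h n t L₁ (map (exch t q) u) ≡ h n t L₂ u)
  where

  α β : ℤ
  α = genα n a
  β = genβ n a
  vα : ValidEntry n α
  vα = α-valid (generator-simple n2 va)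
  vβ : ValidEntry n β
  vβ = β-valid (generator-simple n2 va)
  σ : ℤ → ℤ
  σ = genExch n a
  Qa : List ℕ
  Qa = Q ++ a ∷ []
  vQa : All (ValidGen n) Qa
  vQa = AllP.++⁺ vQ (va ∷ [])

  Transport : Set
  Transport = (act n Q α ≡ t × act n Q β ≡ q) ⊎ (act n Q α ≡ neg1 q × act n Q β ≡ neg1 t)

  act-Qa : ∀ {x} → ValidEntry n x → act n Qa x ≡ act n Q (σ x)
  act-Qa = act-snoc n2 Q vQ va

  exch-act : ∀ {x} → ValidEntry n x → exch t q (act n Q (σ x)) ≡ act n Q x
  exch-act {x} vx = sym (begin
    act n Q x
      ≡⟨ cong (act n Q) (exch-involutive α β x (entry-nonzero vα) (entry-nonzero vβ)) ⟨
    act n Q (σ (σ x))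
      ≡⟨ exch-conjugate (act-signedMap n2 Q vQ) vα vβ (exch-valid vα vβ vx) ⟩
    exch (act n Q α) (act n Q β) (act n Q (σ x))
      ≡⟨ by-transport transports ⟩
    exch t q (act n Q (σ x)) ∎)
    where
    open ≡-Reasoning
    by-transport : Transport → exch (act n Q α) (act n Q β) (act n Q (σ x)) ≡ exch t q (act n Q (σ x))
    by-transport (inj₁ (α↦t , β↦q))   = cong₂ (λ p r → exch p r (act n Q (σ x))) α↦t β↦q
    by-transport (inj₂ (α↦-q , β↦-t)) = trans (cong₂ (λ p r → exch p r (act n Q (σ x))) α↦-q β↦-t)
                                              (exch-neg-swap t q (act n Q (σ x)) (entry-nonzero vt) (entry-nonzero vq))

  module _ (w : List ℤ) (g : SignedPerm n w) where

    u : List ℤ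
    u = compose (prodW n Qa) w

    u-signedPerm : SignedPerm n u
    u-signedPerm = compose-prodW-signedPerm n2 Qa vQa g

    place-act-σ : ∀ {x} → ValidEntry n x → place u (act n Q (σ x)) ≡ place w x
    place-act-σ vx = trans (cong (place u) (sym (act-Qa vx))) (place-act n2 Qa vQa g vx)

    place-Qβ : place u (act n Q β) ≡ place w α
    place-Qβ = trans (cong (place u ∘ act n Q) (sym (exch-t α β))) (place-act-σ vα)

    place-Qα : place u (act n Q α) ≡ place w β
    place-Qα = trans (cong (place u ∘ act n Q) (sym (exch-q α β))) (place-act-σ vβ)

    ascent⇒q<t : place w α < place w β → place u q < place u t
    ascent⇒q<t = by-transport transports
      where
      by-transport : Transport → place w α < place w β → place u q < place u t
      by-transport (inj₁ (α↦t , β↦q)) α<β =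
        subst₂ _<_ (trans (sym place-Qβ) (cong (place u) β↦q)) (trans (sym place-Qα) (cong (place u) α↦t)) α<β
      by-transport (inj₂ (α↦-q , β↦-t)) α<β = reflect-<⁻ (place-< u-signedPerm vt) (place-< u-signedPerm vq)
        (subst₂ _<_ (trans (sym place-Qβ) (trans (cong (place u) β↦-t) (place-neg u-signedPerm vt)))
                    (trans (sym place-Qα) (trans (cong (place u) α↦-q) (place-neg u-signedPerm vq))) α<β)

    descent⇒t<q : place w β < place w α → place u t < place u q
    descent⇒t<q = by-transport transports
      where
      by-transport : Transport → place w β < place w α → place u t < place u q
      by-transport (inj₁ (α↦t , β↦q)) β<α =
        subst₂ _<_ (trans (sym place-Qα) (cong (place u) α↦t)) (trans (sym place-Qβ) (cong (place u) β↦q)) β<α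
      by-transport (inj₂ (α↦-q , β↦-t)) β<α = reflect-<⁻ (place-< u-signedPerm vq) (place-< u-signedPerm vt)
        (subst₂ _<_ (trans (sym place-Qα) (trans (cong (place u) α↦-q) (place-neg u-signedPerm vq)))
                    (trans (sym place-Qβ) (trans (cong (place u) β↦-t) (place-neg u-signedPerm vt))) β<α)

    exch-u : map (exch t q) u ≡ compose (prodW n Q) w
    exch-u = trans (sym (ListP.map-∘ w))
      (ListP.map-cong-local (All.map (λ vx → trans (cong (exch t q) (act-Qa vx)) (exch-act vx)) (sp-entries g)))

    compose-σ : compose (prodW n Q) (map σ w) ≡ u
    compose-σ = trans (sym (ListP.map-∘ w)) (ListP.map-cong-local (All.map (λ vx → sym (act-Qa vx)) (sp-entries g)))

  append-generator : DemazureClaim n t Q L₁ → DemazureClaim n t Qa L₂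
  append-generator claim w g even with length-change (generator-simple n2 va) g
  ... | ascent α<β _ = demazure-snoc Q (demStep-ascent n2 va g even α<β)
    (subst (Demazure n Q (map σ w))
           (trans (cong (h n t L₁) (compose-σ w g)) (h-ascent (u-signedPerm w g) (ascent⇒q<t w g α<β)))
           (claim (map σ w) (genExch-signedPerm n2 va g) (genExch-even n2 va g even)))
  ... | descent β<α _ = demazure-snoc Q (demStep-descent n2 va g even β<α)
    (subst (Demazure n Q w)
           (trans (cong (h n t L₁) (sym (exch-u w g))) (h-descent (u-signedPerm w g) (descent⇒t<q w g β<α)))
           (claim w g even))

-- The words of the theorem

rangeFrom : ℕ → ℕ → List ℕ
rangeFrom s d = map (λ k → s + k) (upTo d)

rangeFromDown : ℕ → ℕ → List ℕ
rangeFromDown s d = reverse (rangeFrom s d)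

rangeFrom-snoc : ∀ s d → rangeFrom s (suc d) ≡ rangeFrom s d ++ (s + d) ∷ []
rangeFrom-snoc s d = trans (cong (map (λ k → s + k)) (sym (ListP.applyUpTo-∷ʳ (λ k → k) d)))
                           (ListP.map-++ (λ k → s + k) (upTo d) (d ∷ []))

rangeFrom-cons : ∀ s d → rangeFrom s (suc d) ≡ s ∷ rangeFrom (suc s) d
rangeFrom-cons s d = trans (ListP.map-upTo (λ k → s + k) (suc d)) (cong₂ _∷_ (ℕP.+-identityʳ s)
  (trans (applyUpTo-cong _ _ d (ℕP.+-suc s)) (sym (ListP.map-upTo (λ k → suc s + k) d))))

rangeFromDown-snoc : ∀ s d → rangeFromDown s (suc d) ≡ rangeFromDown (suc s) d ++ s ∷ []
rangeFromDown-snoc s d = trans (cong reverse (rangeFrom-cons s d)) (ListP.unfold-reverse s (rangeFrom (suc s) d))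

rangeFrom-valid : ∀ {n} s d → 1 ≤ s → s + d ≤ suc n → All (ValidGen n) (rangeFrom s d)
rangeFrom-valid s d 1≤s s+d≤ = All.tabulate (λ k∈ → let (k , k∈upTo , eq) = ∈P.∈-map⁻ (λ k → s + k) k∈ in
  subst (λ z → 1 ≤ z × z ≤ _) (sym eq)
        (ℕP.≤-trans 1≤s (ℕP.m≤m+n s k) ,
         ℕP.≤-pred (ℕP.<-≤-trans (ℕP.+-monoʳ-< s (∈P.∈-upTo⁻ k∈upTo)) s+d≤)))

rangeFromDown-valid : ∀ {n} s d → 1 ≤ s → s + d ≤ suc n → All (ValidGen n) (rangeFromDown s d)
rangeFromDown-valid s d 1≤s s+d≤ = All.tabulate (All.lookup (rangeFrom-valid s d 1≤s s+d≤) ∘ AnyP.reverse⁻)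

pos-valid : ∀ {n} s d → 1 ≤ s → s + d ≤ suc n → All (ValidEntry n) (pos (rangeFrom s d))
pos-valid s d 1≤s s+d≤ = AllP.map⁺ (All.map (λ (l , u) → entry l u) (rangeFrom-valid s d 1≤s s+d≤))

neg-valid : ∀ {n} s d → 1 ≤ s → s + d ≤ suc n → All (ValidEntry n) (neg (rangeFromDown s d))
neg-valid s d 1≤s s+d≤ = AllP.map⁺ (All.map (λ (l , u) → neg-entry (entry l u)) (rangeFromDown-valid s d 1≤s s+d≤))

module Cases (m : ℕ) where

  n : ℕ
  n = suc (suc m)

  n2 : 2 ≤ n
  n2 = s≤s (s≤s z≤n)

  genExch-pos : ∀ a → 1 ≤ a → a ≤ suc m → ∀ x → genExch n a x ≡ exch (+ a) (+ suc a) x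
  genExch-pos (suc a) _ a<n x = cong₂ (λ p q → exch p q x) (genα-pos n (suc a) a≢n) (genβ-pos n (suc a) a≢n)
    where
    a≢n : suc a ≢ n
    a≢n e = ℕP.<-irrefl e (s≤s a<n)

  genExch-neg : ∀ x → genExch n n x ≡ exch (+ suc m) -[1+ suc m ] x
  genExch-neg x = cong₂ (λ p q → exch p q x) (genα-neg m) (genβ-neg m)

  exch-pos-fixed : ∀ a k → 1 ≤ a → k ≢ a → k ≢ suc a → exch (+ a) (+ suc a) (+ k) ≡ + k
  exch-pos-fixed (suc a) k _ k≢a k≢a+1 =
    exch-fixed _ _ _ (λ e → k≢a (ℤP.+-injective e)) (λ e → k≢a+1 (ℤP.+-injective e)) (λ ()) (λ ())

  valid-pos : ∀ k → 1 ≤ k → k ≤ n → ValidEntry n (+ k)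
  valid-pos k 1≤k k≤n = entry 1≤k k≤n

  valid-n : ValidGen n n
  valid-n = s≤s z≤n , ℕP.≤-refl

  rangeFrom-validₙ : ∀ s d → 1 ≤ s → s + d ≤ n → All (ValidGen n) (rangeFrom s d)
  rangeFrom-validₙ s d 1≤s s+d≤n = rangeFrom-valid s d 1≤s (ℕP.m≤n⇒m≤1+n s+d≤n)

  rangeFromDown-validₙ : ∀ s d → 1 ≤ s → s + d ≤ n → All (ValidGen n) (rangeFromDown s d)
  rangeFromDown-validₙ s d 1≤s s+d≤n = rangeFromDown-valid s d 1≤s (ℕP.m≤n⇒m≤1+n s+d≤n)

  +-suc-≤ : ∀ s d → s + suc d ≤ n → s + d ≤ n
  +-suc-≤ s d s+d+1≤n = ℕP.≤-trans (ℕP.+-monoʳ-≤ s (ℕP.n≤1+n d)) s+d+1≤n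

  act-rangeFrom-snoc : ∀ s d {x} → 1 ≤ s → s + suc d ≤ n → ValidEntry n x →
    act n (rangeFrom s (suc d)) x ≡ act n (rangeFrom s d) (exch (+ (s + d)) (+ suc (s + d)) x)
  act-rangeFrom-snoc s d {x} 1≤s s+d+1≤n vx = begin
    act n (rangeFrom s (suc d)) x
      ≡⟨ cong (λ Q → act n Q x) (rangeFrom-snoc s d) ⟩
    act n (rangeFrom s d ++ (s + d) ∷ []) x
      ≡⟨ act-snoc n2 (rangeFrom s d) (rangeFrom-validₙ s d 1≤s (+-suc-≤ s d s+d+1≤n)) valid-s+d vx ⟩
    act n (rangeFrom s d) (genExch n (s + d) x)
      ≡⟨ cong (act n (rangeFrom s d)) (genExch-pos (s + d) (proj₁ valid-s+d) s+d≤m+1 x) ⟩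
    act n (rangeFrom s d) (exch (+ (s + d)) (+ suc (s + d)) x) ∎
    where
    open ≡-Reasoning
    s+d≤m+1 : s + d ≤ suc m
    s+d≤m+1 = ℕP.≤-pred (subst (_≤ n) (ℕP.+-suc s d) s+d+1≤n)
    valid-s+d : ValidGen n (s + d)
    valid-s+d = ℕP.≤-trans 1≤s (ℕP.m≤m+n s d) , ℕP.m≤n⇒m≤1+n s+d≤m+1

  act-rangeFrom-above : ∀ s d k → 1 ≤ s → s + d ≤ n → s + d < k → k ≤ n → act n (rangeFrom s d) (+ k) ≡ + k
  act-rangeFrom-above s zero    k 1≤s _ s<k k≤n =
    apply-idPerm (valid-pos k (ℕP.≤-trans 1≤s (ℕP.≤-trans (ℕP.m≤m+n s 0) (ℕP.<⇒≤ s<k))) k≤n)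
  act-rangeFrom-above s (suc d) k 1≤s s+d+1≤n s+d+1<k k≤n = begin
    act n (rangeFrom s (suc d)) (+ k)
      ≡⟨ act-rangeFrom-snoc s d 1≤s s+d+1≤n vk ⟩
    act n (rangeFrom s d) (exch (+ (s + d)) (+ suc (s + d)) (+ k))
      ≡⟨ cong (act n (rangeFrom s d)) k-fixed ⟩
    act n (rangeFrom s d) (+ k)
      ≡⟨ act-rangeFrom-above s d k 1≤s (+-suc-≤ s d s+d+1≤n) s+d<k k≤n ⟩
    + k ∎
    where
    open ≡-Reasoning
    s+d+1<k′ : suc (s + d) < k
    s+d+1<k′ = subst (_< k) (ℕP.+-suc s d) s+d+1<k
    s+d<k : s + d < k
    s+d<k = ℕP.<-trans (ℕP.n<1+n (s + d)) s+d+1<k′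
    vk : ValidEntry n (+ k)
    vk = valid-pos k (ℕP.≤-trans 1≤s (ℕP.≤-trans (ℕP.m≤m+n s (suc d)) (ℕP.<⇒≤ s+d+1<k))) k≤n
    k-fixed : exch (+ (s + d)) (+ suc (s + d)) (+ k) ≡ + k
    k-fixed = exch-pos-fixed (s + d) k (ℕP.≤-trans 1≤s (ℕP.m≤m+n s d))
                             (λ e → ℕP.<-irrefl (sym e) s+d<k) (λ e → ℕP.<-irrefl (sym e) s+d+1<k′)

  act-rangeFrom-top : ∀ s d → 1 ≤ s → s + d ≤ n → act n (rangeFrom s d) (+ (s + d)) ≡ + s
  act-rangeFrom-top s zero    1≤s s≤n =
    trans (apply-idPerm (valid-pos (s + 0) (ℕP.≤-trans 1≤s (ℕP.m≤m+n s 0)) s≤n)) (cong +_ (ℕP.+-identityʳ s))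
  act-rangeFrom-top s (suc d) 1≤s s+d+1≤n = begin
    act n (rangeFrom s (suc d)) (+ (s + suc d))
      ≡⟨ cong (λ z → act n (rangeFrom s (suc d)) (+ z)) (ℕP.+-suc s d) ⟩
    act n (rangeFrom s (suc d)) (+ suc (s + d))
      ≡⟨ act-rangeFrom-snoc s d 1≤s s+d+1≤n (valid-pos (suc (s + d)) (s≤s z≤n) s+d+1≤n′) ⟩
    act n (rangeFrom s d) (exch (+ (s + d)) (+ suc (s + d)) (+ suc (s + d)))
      ≡⟨ cong (act n (rangeFrom s d)) (exch-q (+ (s + d)) (+ suc (s + d))) ⟩
    act n (rangeFrom s d) (+ (s + d))
      ≡⟨ act-rangeFrom-top s d 1≤s (+-suc-≤ s d s+d+1≤n) ⟩
    + s ∎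
    where
    open ≡-Reasoning
    s+d+1≤n′ : suc (s + d) ≤ n
    s+d+1≤n′ = subst (_≤ n) (ℕP.+-suc s d) s+d+1≤n

  act-rangeFrom-inside : ∀ s d k → 1 ≤ s → s + d ≤ n → s ≤ k → k < s + d →
                         act n (rangeFrom s d) (+ k) ≡ + suc k
  act-rangeFrom-inside s zero    k 1≤s _ s≤k k<s = ⊥-elim (ℕP.<⇒≱ k<s (subst (_≤ k) (sym (ℕP.+-identityʳ s)) s≤k))
  act-rangeFrom-inside s (suc d) k 1≤s s+d+1≤n s≤k k<s+d+1 with k ℕ.≟ s + d
  ... | yes refl = begin
    act n (rangeFrom s (suc d)) (+ (s + d))
      ≡⟨ act-rangeFrom-snoc s d 1≤s s+d+1≤n vk ⟩
    act n (rangeFrom s d) (exch (+ (s + d)) (+ suc (s + d)) (+ (s + d)))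
      ≡⟨ cong (act n (rangeFrom s d)) (exch-t (+ (s + d)) (+ suc (s + d))) ⟩
    act n (rangeFrom s d) (+ suc (s + d))
      ≡⟨ act-rangeFrom-above s d (suc (s + d)) 1≤s (+-suc-≤ s d s+d+1≤n) ℕP.≤-refl s+d+1≤n′ ⟩
    + suc (s + d) ∎
    where
    open ≡-Reasoning
    s+d+1≤n′ : suc (s + d) ≤ n
    s+d+1≤n′ = subst (_≤ n) (ℕP.+-suc s d) s+d+1≤n
    vk : ValidEntry n (+ (s + d))
    vk = valid-pos (s + d) (ℕP.≤-trans 1≤s s≤k) (ℕP.≤-trans (ℕP.<⇒≤ k<s+d+1) s+d+1≤n)
  ... | no k≢s+d = begin
    act n (rangeFrom s (suc d)) (+ k)
      ≡⟨ act-rangeFrom-snoc s d 1≤s s+d+1≤n vk ⟩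
    act n (rangeFrom s d) (exch (+ (s + d)) (+ suc (s + d)) (+ k))
      ≡⟨ cong (act n (rangeFrom s d)) k-fixed ⟩
    act n (rangeFrom s d) (+ k)
      ≡⟨ act-rangeFrom-inside s d k 1≤s (+-suc-≤ s d s+d+1≤n) s≤k k<s+d ⟩
    + suc k ∎
    where
    open ≡-Reasoning
    k≤s+d : k < suc (s + d)
    k≤s+d = subst (k <_) (ℕP.+-suc s d) k<s+d+1
    k<s+d : k < s + d
    k<s+d = ℕP.≤∧≢⇒< (ℕP.≤-pred k≤s+d) k≢s+d
    vk : ValidEntry n (+ k)
    vk = valid-pos k (ℕP.≤-trans 1≤s s≤k) (ℕP.≤-trans (ℕP.<⇒≤ k<s+d+1) s+d+1≤n)
    k-fixed : exch (+ (s + d)) (+ suc (s + d)) (+ k) ≡ + k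
    k-fixed = exch-pos-fixed (s + d) k (ℕP.≤-trans 1≤s (ℕP.m≤m+n s d)) k≢s+d (λ e → ℕP.<-irrefl e k≤s+d)

  act-rangeFromDown-snoc : ∀ s d {x} → 1 ≤ s → s + suc d ≤ n → ValidEntry n x →
    act n (rangeFromDown s (suc d)) x ≡ act n (rangeFromDown (suc s) d) (exch (+ s) (+ suc s) x)
  act-rangeFromDown-snoc s d {x} 1≤s s+d+1≤n vx = begin
    act n (rangeFromDown s (suc d)) x
      ≡⟨ cong (λ Q → act n Q x) (rangeFromDown-snoc s d) ⟩
    act n (rangeFromDown (suc s) d ++ s ∷ []) x
      ≡⟨ act-snoc n2 (rangeFromDown (suc s) d) (rangeFromDown-validₙ (suc s) d (s≤s z≤n) s+1+d≤n) valid-s vx ⟩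
    act n (rangeFromDown (suc s) d) (genExch n s x)
      ≡⟨ cong (act n (rangeFromDown (suc s) d)) (genExch-pos s 1≤s s≤m+1 x) ⟩
    act n (rangeFromDown (suc s) d) (exch (+ s) (+ suc s) x) ∎
    where
    open ≡-Reasoning
    s+1+d≤n : suc s + d ≤ n
    s+1+d≤n = subst (_≤ n) (ℕP.+-suc s d) s+d+1≤n
    s≤m+1 : s ≤ suc m
    s≤m+1 = ℕP.≤-pred (ℕP.≤-trans (s≤s (ℕP.m≤m+n s d)) s+1+d≤n)
    valid-s : ValidGen n s
    valid-s = 1≤s , ℕP.m≤n⇒m≤1+n s≤m+1

  act-rangeFromDown-below : ∀ s d k → 1 ≤ s → s + d ≤ n → 1 ≤ k → k < s →
                            act n (rangeFromDown s d) (+ k) ≡ + k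
  act-rangeFromDown-below s zero    k 1≤s s≤n 1≤k k<s =
    apply-idPerm (valid-pos k 1≤k (ℕP.≤-trans (ℕP.<⇒≤ k<s) (ℕP.≤-trans (ℕP.m≤m+n s 0) s≤n)))
  act-rangeFromDown-below s (suc d) k 1≤s s+d+1≤n 1≤k k<s = begin
    act n (rangeFromDown s (suc d)) (+ k)
      ≡⟨ act-rangeFromDown-snoc s d 1≤s s+d+1≤n
           (valid-pos k 1≤k (ℕP.≤-trans (ℕP.<⇒≤ k<s) (ℕP.≤-trans (ℕP.m≤m+n s (suc d)) s+d+1≤n))) ⟩
    act n (rangeFromDown (suc s) d) (exch (+ s) (+ suc s) (+ k))
      ≡⟨ cong (act n (rangeFromDown (suc s) d))
              (exch-pos-fixed s k 1≤s (λ e → ℕP.<-irrefl e k<s) (λ e → ℕP.<-irrefl e k<s+1)) ⟩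
    act n (rangeFromDown (suc s) d) (+ k)
      ≡⟨ act-rangeFromDown-below (suc s) d k (s≤s z≤n) (subst (_≤ n) (ℕP.+-suc s d) s+d+1≤n) 1≤k k<s+1 ⟩
    + k ∎
    where
    open ≡-Reasoning
    k<s+1 : k < suc s
    k<s+1 = ℕP.<-trans k<s (ℕP.n<1+n s)

  act-rangeFromDown-bottom : ∀ s d → 1 ≤ s → s + d ≤ n → act n (rangeFromDown s d) (+ s) ≡ + (s + d)
  act-rangeFromDown-bottom s zero    1≤s s≤n =
    trans (apply-idPerm (valid-pos s 1≤s (ℕP.≤-trans (ℕP.m≤m+n s 0) s≤n))) (cong +_ (sym (ℕP.+-identityʳ s)))
  act-rangeFromDown-bottom s (suc d) 1≤s s+d+1≤n = begin
    act n (rangeFromDown s (suc d)) (+ s)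
      ≡⟨ act-rangeFromDown-snoc s d 1≤s s+d+1≤n (valid-pos s 1≤s (ℕP.≤-trans (ℕP.m≤m+n s (suc d)) s+d+1≤n)) ⟩
    act n (rangeFromDown (suc s) d) (exch (+ s) (+ suc s) (+ s))
      ≡⟨ cong (act n (rangeFromDown (suc s) d)) (exch-t (+ s) (+ suc s)) ⟩
    act n (rangeFromDown (suc s) d) (+ suc s)
      ≡⟨ act-rangeFromDown-bottom (suc s) d (s≤s z≤n) (subst (_≤ n) (ℕP.+-suc s d) s+d+1≤n) ⟩
    + (suc s + d)
      ≡⟨ cong +_ (ℕP.+-suc s d) ⟨
    + (s + suc d) ∎
    where open ≡-Reasoning

  genα-genβ-pos : ∀ a → 1 ≤ a → a ≤ suc m → (genα n a ≡ + a) × (genβ n a ≡ + suc a)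
  genα-genβ-pos (suc a) _ a<n = genα-pos n (suc a) a≢n , genβ-pos n (suc a) a≢n
    where
    a≢n : suc a ≢ n
    a≢n e = ℕP.<-irrefl e (s≤s a<n)

  rank-pos<rank-neg : ∀ k j → k ≤ suc m → j ≤ suc m → rank n (+ k) < rank n -[1+ j ]
  rank-pos<rank-neg k j k≤m+1 j≤m+1 =
    ℕP.≤-trans (s≤s k≤m+1)
               (ℕP.≤-trans (ℕP.≤-reflexive (sym 2n∸n≡n)) (ℕP.∸-monoʳ-≤ (2 * n) (ℕP.m≤n⇒m≤1+n j≤m+1)))
    where
    2n∸n≡n : 2 * n ∸ n ≡ n
    2n∸n≡n = trans (ℕP.m+n∸m≡n n (n + 0)) (ℕP.+-identityʳ n)

  module ForEntry (i₀ : ℕ) (i₀≤m : i₀ ≤ m) where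

    i : ℕ
    i = suc i₀

    t : ℤ
    t = + i

    vt : ValidEntry n t
    vt = entry (s≤s z≤n) (ℕP.m≤n⇒m≤1+n (s≤s i₀≤m))

    1≤i : 1 ≤ i
    1≤i = s≤s z≤n

    valid-n-entry : ValidEntry n (+ n)
    valid-n-entry = entry (s≤s z≤n) ℕP.≤-refl

    negative-not-t : ∀ j → i ≤ j → -[1+ j ] ≢ t × -[1+ j ] ≢ neg1 t
    negative-not-t j i≤j = (λ ()) , (λ e → ℕP.<-irrefl (sym (ℤP.-[1+-injective e)) i≤j)

    claim-ascending : ∀ d → i + d ≤ n → DemazureClaim n t (rangeFrom i d) (pos (rangeFrom (suc i) d))
    claim-ascending zero    _ = demazureClaim-[] vt
    claim-ascending (suc d) i+d+1≤n = subst₂ (DemazureClaim n t) (sym (rangeFrom-snoc i d)) (sym L′≡)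
      (AppendGenerator.append-generator n2 vt (rangeFrom i d) (rangeFrom-validₙ i d 1≤i i+d≤n) va L (L ++ q ∷ []) vq
        (inj₁ (α↦t , β↦q))
        (λ g q<t → Algorithm.h-snoc-ascent n t vt vL vL′ q≢t q≢-t g q<t)
        (λ g t<q → Algorithm.h-snoc-descent n t vt vL vL′ vq q≢t q≢-t g (s≤s (ℕP.m≤m+n i d)) t<q)
        (claim-ascending d i+d≤n))
      where
      i+d≤n : i + d ≤ n
      i+d≤n = +-suc-≤ i d i+d+1≤n
      i+d+1≤n′ : suc (i + d) ≤ n
      i+d+1≤n′ = subst (_≤ n) (ℕP.+-suc i d) i+d+1≤n
      va : ValidGen n (i + d)
      va = ℕP.≤-trans 1≤i (ℕP.m≤m+n i d) , i+d≤n
      q : ℤ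
      q = + suc (i + d)
      vq : ValidEntry n q
      vq = entry (s≤s z≤n) i+d+1≤n′
      L : List ℤ
      L = pos (rangeFrom (suc i) d)
      L′≡ : pos (rangeFrom (suc i) (suc d)) ≡ L ++ q ∷ []
      L′≡ = trans (cong pos (rangeFrom-snoc (suc i) d)) (ListP.map-++ +_ (rangeFrom (suc i) d) (suc i + d ∷ []))
      vL : All (ValidEntry n) L
      vL = pos-valid (suc i) d (s≤s z≤n) (s≤s i+d≤n)
      vL′ : All (ValidEntry n) (L ++ q ∷ [])
      vL′ = AllP.++⁺ vL (vq ∷ [])
      q≢t : q ≢ t
      q≢t e = ℕP.<-irrefl (sym (ℤP.+-injective e)) (s≤s (ℕP.m≤m+n i d))
      q≢-t : q ≢ neg1 t
      q≢-t ()
      genα-genβ : (genα n (i + d) ≡ + (i + d)) × (genβ n (i + d) ≡ q)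
      genα-genβ = genα-genβ-pos (i + d) (proj₁ va) (ℕP.≤-pred i+d+1≤n′)
      α↦t : act n (rangeFrom i d) (genα n (i + d)) ≡ t
      α↦t = trans (cong (act n (rangeFrom i d)) (proj₁ genα-genβ)) (act-rangeFrom-top i d 1≤i i+d≤n)
      β↦q : act n (rangeFrom i d) (genβ n (i + d)) ≡ q
      β↦q = trans (cong (act n (rangeFrom i d)) (proj₂ genα-genβ))
                  (act-rangeFrom-above i d (suc (i + d)) 1≤i i+d≤n ℕP.≤-refl i+d+1≤n′)

    -- R = s_i ⋯ s_{n-2}, the ascending part of the words in cases (b)–(e).
    module ToTheEnd (d : ℕ) (i+d≡m+1 : i + d ≡ suc m) where

      i+d≤n : i + d ≤ n
      i+d≤n = subst (_≤ n) (sym i+d≡m+1) (ℕP.n≤1+n _)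

      R : List ℕ
      R = rangeFrom i d

      valid-R : All (ValidGen n) R
      valid-R = rangeFrom-validₙ i d 1≤i i+d≤n

      act-R-m+1 : act n R (+ suc m) ≡ t
      act-R-m+1 = trans (cong (λ z → act n R (+ z)) (sym i+d≡m+1)) (act-rangeFrom-top i d 1≤i i+d≤n)

      act-R-n : act n R (+ n) ≡ + n
      act-R-n = act-rangeFrom-above i d n 1≤i i+d≤n (subst (_< n) (sym i+d≡m+1) ℕP.≤-refl) ℕP.≤-refl

      act-R-neg : ∀ {x} → ValidEntry n x → act n R (neg1 x) ≡ neg1 (act n R x)
      act-R-neg = commutes-neg (act-signedMap n2 R valid-R)

      claim-through-n : DemazureClaim n t (R ++ n ∷ []) (pos (rangeFrom (suc i) d) ++ -[1+ suc m ] ∷ [])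
      claim-through-n = AppendGenerator.append-generator n2 vt R valid-R valid-n L (L ++ q ∷ []) vq
        (inj₁ (α↦t , β↦q))
        (λ g q<t → Algorithm.h-snoc-ascent n t vt vL vL′ q≢t q≢-t g q<t)
        (λ g t<q → Algorithm.h-snoc-descent n t vt vL vL′ vq q≢t q≢-t g
                     (rank-pos<rank-neg i (suc m) (s≤s i₀≤m) ℕP.≤-refl) t<q)
        (claim-ascending d i+d≤n)
        where
        q : ℤ
        q = -[1+ suc m ]
        vq : ValidEntry n q
        vq = neg-entry valid-n-entry
        L : List ℤ
        L = pos (rangeFrom (suc i) d)
        vL : All (ValidEntry n) L
        vL = pos-valid (suc i) d (s≤s z≤n) (s≤s i+d≤n)
        vL′ : All (ValidEntry n) (L ++ q ∷ [])
        vL′ = AllP.++⁺ vL (vq ∷ [])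
        q≢t : q ≢ t
        q≢t = proj₁ (negative-not-t (suc m) (s≤s i₀≤m))
        q≢-t : q ≢ neg1 t
        q≢-t = proj₂ (negative-not-t (suc m) (s≤s i₀≤m))
        α↦t : act n R (genα n n) ≡ t
        α↦t = trans (cong (act n R) (genα-neg m)) act-R-m+1
        β↦q : act n R (genβ n n) ≡ q
        β↦q = trans (cong (act n R) (genβ-neg m)) (trans (act-R-neg valid-n-entry) (cong neg1 act-R-n))

      claim-turn : DemazureClaim n t (R ++ n ∷ rangeFromDown (suc m) 1)
                                     (pos (rangeFrom (suc i) (suc d)) ++ neg (rangeFromDown n 1))
      claim-turn = subst₂ (DemazureClaim n t) (sym Q≡) (sym L≡)
        (AppendGenerator.append-generator n2 vt (R ++ n ∷ []) (AllP.++⁺ valid-R (valid-n ∷ [])) valid-m+1 L₁ L₂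
                                          valid-n-entry
          (inj₂ (α↦-n , β↦-t))
          (λ g n<t → Algorithm.h-insert n t vt vL₁ vL₂ n≢t n≢-t g n<t)
          (λ g t<n → Algorithm.h-snoc-pair-descent n t vt vL₂ vL₁ valid-n-entry n≢t n≢-t (s≤s (s≤s i₀≤m))
                       (rank-pos<rank-neg i (suc m) (s≤s i₀≤m) ℕP.≤-refl) g t<n)
          claim-through-n)
        where
        valid-m+1 : ValidGen n (suc m)
        valid-m+1 = s≤s z≤n , ℕP.n≤1+n _
        A : List ℤ
        A = pos (rangeFrom (suc i) d)
        L₁ L₂ : List ℤ
        L₁ = A ++ -[1+ suc m ] ∷ []
        L₂ = A ++ + n ∷ -[1+ suc m ] ∷ []
        Q≡ : R ++ n ∷ rangeFromDown (suc m) 1 ≡ (R ++ n ∷ []) ++ suc m ∷ []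
        Q≡ = trans (cong (λ z → R ++ n ∷ z ∷ []) (ℕP.+-identityʳ (suc m)))
                   (sym (ListP.++-assoc R (n ∷ []) (suc m ∷ [])))
        L≡ : pos (rangeFrom (suc i) (suc d)) ++ neg (rangeFromDown n 1) ≡ L₂
        L≡ = trans (cong₂ _++_
                      (trans (cong pos (rangeFrom-snoc (suc i) d))
                             (trans (ListP.map-++ +_ (rangeFrom (suc i) d) (suc i + d ∷ []))
                                    (cong (λ z → A ++ + z ∷ []) (cong suc i+d≡m+1))))
                      (cong (λ z → neg1 (+ z) ∷ []) (ℕP.+-identityʳ n)))
                   (ListP.++-assoc A (+ n ∷ []) (-[1+ suc m ] ∷ []))
        vA : All (ValidEntry n) A
        vA = pos-valid (suc i) d (s≤s z≤n) (s≤s i+d≤n)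
        vL₁ : All (ValidEntry n) L₁
        vL₁ = AllP.++⁺ vA (neg-entry valid-n-entry ∷ [])
        vL₂ : All (ValidEntry n) L₂
        vL₂ = AllP.++⁺ vA (valid-n-entry ∷ neg-entry valid-n-entry ∷ [])
        n≢t : + n ≢ t
        n≢t e = ℕP.<-irrefl (ℤP.+-injective (sym e)) (s≤s (s≤s i₀≤m))
        n≢-t : + n ≢ neg1 t
        n≢-t ()
        act-Rn : ∀ {x} → ValidEntry n x → act n (R ++ n ∷ []) x ≡ act n R (exch (+ suc m) -[1+ suc m ] x)
        act-Rn {x} vx = trans (act-snoc n2 R valid-R valid-n vx) (cong (act n R) (genExch-neg x))
        α↦-n : act n (R ++ n ∷ []) (genα n (suc m)) ≡ neg1 (+ n)
        α↦-n = begin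
          act n (R ++ n ∷ []) (genα n (suc m))
            ≡⟨ cong (act n (R ++ n ∷ [])) (proj₁ (genα-genβ-pos (suc m) (s≤s z≤n) ℕP.≤-refl)) ⟩
          act n (R ++ n ∷ []) (+ suc m)
            ≡⟨ act-Rn {+ suc m} (entry (s≤s z≤n) (ℕP.n≤1+n _)) ⟩
          act n R (exch (+ suc m) -[1+ suc m ] (+ suc m))
            ≡⟨ cong (act n R) (exch-t (+ suc m) -[1+ suc m ]) ⟩
          act n R (neg1 (+ n))
            ≡⟨ act-R-neg valid-n-entry ⟩
          neg1 (act n R (+ n))
            ≡⟨ cong neg1 act-R-n ⟩
          neg1 (+ n) ∎
          where open ≡-Reasoning
        β↦-t : act n (R ++ n ∷ []) (genβ n (suc m)) ≡ neg1 t
        β↦-t = begin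
          act n (R ++ n ∷ []) (genβ n (suc m))
            ≡⟨ cong (act n (R ++ n ∷ [])) (proj₂ (genα-genβ-pos (suc m) (s≤s z≤n) ℕP.≤-refl)) ⟩
          act n (R ++ n ∷ []) (+ n)
            ≡⟨ act-Rn valid-n-entry ⟩
          act n R (exch (+ suc m) -[1+ suc m ] (+ n))
            ≡⟨ cong (act n R) (exch-negq (+ suc m) -[1+ suc m ] (λ ())) ⟩
          act n R (neg1 (+ suc m))
            ≡⟨ act-R-neg {+ suc m} (entry (s≤s z≤n) (ℕP.n≤1+n _)) ⟩
          neg1 (act n R (+ suc m))
            ≡⟨ cong neg1 act-R-m+1 ⟩
          neg1 t ∎
          where open ≡-Reasoning

      claim-descending : ∀ e j → j + e ≡ n → 1 ≤ e → i ≤ j →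
        DemazureClaim n t (R ++ n ∷ rangeFromDown j e) (pos (rangeFrom (suc i) (suc d)) ++ neg (rangeFromDown (suc j) e))
      claim-descending (suc zero) j j+1≡n _ _ with ℕP.suc-injective (trans (ℕP.+-comm 1 j) j+1≡n)
      ... | refl = claim-turn
      claim-descending (suc (suc e)) j j+e+2≡n _ i≤j = subst₂ (DemazureClaim n t) (sym Q≡) (sym L≡)
        (AppendGenerator.append-generator n2 vt Q (AllP.++⁺ valid-R (valid-n ∷ valid-D)) valid-j L (L ++ q ∷ []) vq
          (inj₂ (α↦-q , β↦-t))
          (λ g q<t → Algorithm.h-snoc-ascent n t vt vL vL′ q≢t q≢-t g q<t)
          (λ g t<q → Algorithm.h-snoc-descent n t vt vL vL′ vq q≢t q≢-t g
                       (rank-pos<rank-neg i j (ℕP.≤-trans i≤j j≤m+1) j≤m+1) t<q)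
          (claim-descending (suc e) (suc j) j+1+e+1≡n (s≤s z≤n) (ℕP.m≤n⇒m≤1+n i≤j)))
        where
        j+1+e+1≡n : suc j + suc e ≡ n
        j+1+e+1≡n = trans (sym (ℕP.+-suc j (suc e))) j+e+2≡n
        j≤m : j ≤ m
        j≤m = ℕP.≤-pred (ℕP.≤-pred (subst (suc (suc j) ≤_) j+e+2≡n
                (subst (_≤ j + suc (suc e)) (ℕP.+-comm j 2) (ℕP.+-monoʳ-≤ j (s≤s (s≤s z≤n))))))
        j≤m+1 : j ≤ suc m
        j≤m+1 = ℕP.m≤n⇒m≤1+n j≤m
        1≤j : 1 ≤ j
        1≤j = ℕP.≤-trans 1≤i i≤j
        D : List ℕ
        D = rangeFromDown (suc j) (suc e)
        valid-D : All (ValidGen n) D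
        valid-D = rangeFromDown-validₙ (suc j) (suc e) (s≤s z≤n) (ℕP.≤-reflexive j+1+e+1≡n)
        Q : List ℕ
        Q = R ++ n ∷ D
        valid-j : ValidGen n j
        valid-j = 1≤j , ℕP.m≤n⇒m≤1+n j≤m+1
        q : ℤ
        q = -[1+ j ]
        vq : ValidEntry n q
        vq = entry (s≤s z≤n) (s≤s j≤m+1)
        P : List ℤ
        P = pos (rangeFrom (suc i) (suc d))
        L : List ℤ
        L = P ++ neg (rangeFromDown (suc (suc j)) (suc e))
        Q≡ : R ++ n ∷ rangeFromDown j (suc (suc e)) ≡ Q ++ j ∷ []
        Q≡ = trans (cong (λ z → R ++ n ∷ z) (rangeFromDown-snoc j (suc e))) (sym (ListP.++-assoc R (n ∷ D) (j ∷ [])))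
        L≡ : P ++ neg (rangeFromDown (suc j) (suc (suc e))) ≡ L ++ q ∷ []
        L≡ = trans (cong (λ z → P ++ neg z) (rangeFromDown-snoc (suc j) (suc e)))
               (trans (cong (P ++_) (ListP.map-++ (λ k → neg1 (+ k)) (rangeFromDown (suc (suc j)) (suc e)) (suc j ∷ [])))
                      (sym (ListP.++-assoc P (neg (rangeFromDown (suc (suc j)) (suc e))) (q ∷ []))))
        vL : All (ValidEntry n) L
        vL = AllP.++⁺ (pos-valid (suc i) (suc d) (s≤s z≤n)
                                 (s≤s (ℕP.≤-reflexive (trans (ℕP.+-suc i d) (cong suc i+d≡m+1)))))
                      (neg-valid (suc (suc j)) (suc e) (s≤s z≤n) (s≤s (ℕP.≤-reflexive j+1+e+1≡n)))
        vL′ : All (ValidEntry n) (L ++ q ∷ [])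
        vL′ = AllP.++⁺ vL (vq ∷ [])
        q≢t : q ≢ t
        q≢t = proj₁ (negative-not-t j i≤j)
        q≢-t : q ≢ neg1 t
        q≢-t = proj₂ (negative-not-t j i≤j)
        act-Q : ∀ {x} → ValidEntry n x → act n Q x ≡ act n R (exch (+ suc m) -[1+ suc m ] (act n D x))
        act-Q {x} vx = trans (act-++ n2 R valid-R (valid-n ∷ valid-D) vx)
                         (cong (act n R) (trans (act-cons n2 valid-n valid-D vx) (genExch-neg (act n D x))))
        genα-genβ : (genα n j ≡ + j) × (genβ n j ≡ + suc j)
        genα-genβ = genα-genβ-pos j 1≤j j≤m+1
        α↦-q : act n Q (genα n j) ≡ + suc j
        α↦-q = begin
          act n Q (genα n j)
            ≡⟨ cong (act n Q) (proj₁ genα-genβ) ⟩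
          act n Q (+ j)
            ≡⟨ act-Q {+ j} (entry 1≤j (ℕP.m≤n⇒m≤1+n j≤m+1)) ⟩
          act n R (exch (+ suc m) -[1+ suc m ] (act n D (+ j)))
            ≡⟨ cong (λ z → act n R (exch (+ suc m) -[1+ suc m ] z))
              (act-rangeFromDown-below (suc j) (suc e) j (s≤s z≤n) (ℕP.≤-reflexive j+1+e+1≡n) 1≤j ℕP.≤-refl) ⟩
          act n R (exch (+ suc m) -[1+ suc m ] (+ j))
            ≡⟨ cong (act n R) (exch-fixed _ _ _ (λ e → ℕP.<-irrefl (ℤP.+-injective e) (s≤s j≤m)) (λ ()) (λ ())
              (λ e → ℕP.<-irrefl (ℤP.+-injective e) (s≤s j≤m+1))) ⟩
          act n R (+ j)
            ≡⟨ act-rangeFrom-inside i d j 1≤i i+d≤n i≤j (subst (j <_) (sym i+d≡m+1) (s≤s j≤m)) ⟩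
          + suc j ∎
          where open ≡-Reasoning
        β↦-t : act n Q (genβ n j) ≡ neg1 t
        β↦-t = begin
          act n Q (genβ n j)
            ≡⟨ cong (act n Q) (proj₂ genα-genβ) ⟩
          act n Q (+ suc j)
            ≡⟨ act-Q {+ suc j} (entry (s≤s z≤n) (s≤s j≤m+1)) ⟩
          act n R (exch (+ suc m) -[1+ suc m ] (act n D (+ suc j)))
            ≡⟨ cong (λ z → act n R (exch (+ suc m) -[1+ suc m ] z))
              (trans (act-rangeFromDown-bottom (suc j) (suc e) (s≤s z≤n) (ℕP.≤-reflexive j+1+e+1≡n))
              (cong +_ j+1+e+1≡n)) ⟩
          act n R (exch (+ suc m) -[1+ suc m ] (+ n))
            ≡⟨ cong (act n R) (exch-negq (+ suc m) -[1+ suc m ] (λ ())) ⟩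
          act n R (neg1 (+ suc m))
            ≡⟨ act-R-neg {+ suc m} (entry (s≤s z≤n) (ℕP.n≤1+n _)) ⟩
          neg1 (act n R (+ suc m))
            ≡⟨ cong neg1 act-R-m+1 ⟩
          neg1 t ∎
          where open ≡-Reasoning

-- Windows of elements of D_n

isOdd : ℕ → Bool
isOdd zero    = false
isOdd (suc k) = not (isOdd k)

isOdd-double : ∀ k → isOdd (k + k) ≡ false
isOdd-double zero    = refl
isOdd-double (suc k) rewrite ℕP.+-suc k k = trans (BoolP.not-involutive (isOdd (k + k))) (isOdd-double k)

oddNegatives-count : ∀ w → oddNegatives w ≡ isOdd (length (filterᵇ isNeg w))
oddNegatives-count []      = refl
oddNegatives-count (x ∷ w) rewrite filterᵇ-unfold isNeg x w with isNeg x
... | true  = cong not (oddNegatives-count w)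
... | false = oddNegatives-count w

inD-even : ∀ {n w} → InD n w → oddNegatives w ≡ false
inD-even {n} {w} (_ , _ , k , count≡2k) = begin
  oddNegatives w                    ≡⟨ oddNegatives-count w ⟩
  isOdd (length (filterᵇ isNeg w))  ≡⟨ cong isOdd count≡2k ⟩
  isOdd (k + (k + 0))               ≡⟨ cong (λ j → isOdd (k + j)) (ℕP.+-identityʳ k) ⟩
  isOdd (k + k)                     ≡⟨ isOdd-double k ⟩
  false                             ∎
  where open ≡-Reasoning

inD-signedPerm : ∀ {n w} → InD n w → SignedPerm n w
inD-signedPerm {n} {w} (length≡n , abs↭ , _) = record
  { sp-length = length≡n ; sp-entries = entries ; sp-distinct = distinct ; sp-covers = covers }
  where
  unique-abs : Unique (map ∣_∣ w)
  unique-abs = unique-resp-↭ (↭-sym abs↭) (UniqueP.map⁺ ℕP.suc-injective (UniqueP.upTo⁺ n))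
  distinct : AllPairs AbsDistinct w
  distinct = AllPairs.map absDistinct (AllPairsP.map⁻ unique-abs)
    where
    absDistinct : ∀ {x y} → ∣ x ∣ ≢ ∣ y ∣ → AbsDistinct x y
    absDistinct {y = y} ∣x∣≢∣y∣ = (λ e → ∣x∣≢∣y∣ (cong ∣_∣ e)) , (λ e → ∣x∣≢∣y∣ (trans (cong ∣_∣ e) (ℤP.∣-i∣≡∣i∣ y)))
  abs-in-range : ∀ {k} → k ∈ map ∣_∣ w → ∃ λ j → k ≡ suc j × j < n
  abs-in-range k∈ =
    let (j , j∈ , k≡) = ∈P.∈-map⁻ suc (PermutationP.∈-resp-↭ abs↭ k∈) in j , k≡ , ∈P.∈-upTo⁻ j∈
  entries : All (ValidEntry n) w
  entries = All.tabulate (λ x∈ → let (j , ∣x∣≡ , j<n) = abs-in-range (∈P.∈-map⁺ ∣_∣ x∈) in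
    entry (subst (1 ≤_) (sym ∣x∣≡) (s≤s z≤n)) (subst (_≤ n) (sym ∣x∣≡) j<n))
  covers : ∀ {v} → ValidEntry n v → v ∈ w ⊎ neg1 v ∈ w
  covers {v} (entry 1≤ ≤n) with ∣ v ∣ in eq | 1≤ | ≤n
  ... | zero  | () | _
  ... | suc k | _  | k<n
    with ∈P.∈-map⁻ ∣_∣ (PermutationP.∈-resp-↭ (↭-sym abs↭) (∈P.∈-map⁺ suc (∈P.∈-upTo⁺ {n = n} k<n)))
  ...   | z , z∈w , k+1≡∣z∣ with ∣∣-≡⇒≡⊎≡neg {v} {z} (trans eq k+1≡∣z∣)
  ...     | inj₁ refl = inj₁ z∈w
  ...     | inj₂ v≡-z = inj₂ (subst (_∈ w) (sym (≡neg⇒neg≡ v≡-z)) z∈w)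

admissible-claim : ∀ {n i Q L} → 2 ≤ n → 1 ≤ i → i ≤ n ∸ 1 → Admissible n i Q L → DemazureClaim n (+ i) Q L
admissible-claim {suc (suc m)} {suc i₀} _ _ i≤m+1 = by-case
  where
  open Cases m
  i₀≤m : i₀ ≤ m
  i₀≤m = ℕP.≤-pred i≤m+1
  open ForEntry i₀ i₀≤m
  to-the-end : i + (m ∸ i₀) ≡ suc m
  to-the-end = cong suc (ℕP.m+[n∸m]≡n i₀≤m)
  by-case : ∀ {Q L} → Admissible n i Q L → DemazureClaim n t Q L
  by-case (caseA j _ i≤j j≤m+1) =
    claim-ascending (suc j ∸ i) (subst (_≤ n) (sym (ℕP.m+[n∸m]≡n (ℕP.m≤n⇒m≤1+n i≤j))) (s≤s j≤m+1))
  by-case (caseB j _ i≤j j≤m+1) =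
    subst (λ d → DemazureClaim n t (rangeFrom i (m ∸ i₀) ++ n ∷ rangeFromDown j (n ∸ j))
                                   (pos (rangeFrom (suc i) d) ++ neg (rangeFromDown (suc j) (n ∸ j))))
          (sym (ℕP.+-∸-assoc 1 i₀≤m))
          (ToTheEnd.claim-descending (m ∸ i₀) to-the-end (n ∸ j) j (ℕP.m+[n∸m]≡n (ℕP.m≤n⇒m≤1+n j≤m+1))
                                     (subst (1 ≤_) (sym (ℕP.+-∸-assoc 1 j≤m+1)) (s≤s z≤n)) i≤j)
  by-case (caseC refl) = subst₂ (DemazureClaim n t) Q≡ L≡ (ToTheEnd.claim-turn 0 (ℕP.+-identityʳ i))
    where
    Q≡ : rangeFrom i 0 ++ n ∷ rangeFromDown (suc m) 1 ≡ n ∷ suc m ∷ []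
    Q≡ = cong (λ k → n ∷ k ∷ []) (ℕP.+-identityʳ (suc m))
    L≡ : pos (rangeFrom (suc i) 1) ++ neg (rangeFromDown n 1) ≡ + n ∷ neg1 (+ n) ∷ []
    L≡ = cong₂ (λ a b → + a ∷ neg1 (+ b) ∷ []) (ℕP.+-identityʳ n) (ℕP.+-identityʳ n)
  by-case (caseD _)    = ToTheEnd.claim-through-n (m ∸ i₀) to-the-end
  by-case (caseE refl) = ToTheEnd.claim-through-n 0 (ℕP.+-identityʳ i)

mainTheorem2 : (n i : ℕ) → 2 ≤ n → 1 ≤ i → i ≤ n ∸ 1 →
    (Q : List ℕ) (L : List ℤ) → Admissible n i Q L →
    (w : List ℤ) → InD n w →
    Demazure n Q w (h n (+ i) L (compose (prodW n Q) w))
mainTheorem2 n i 2≤n 1≤i i≤n-1 Q L admissible w w∈Dₙ =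
  admissible-claim 2≤n 1≤i i≤n-1 admissible w (inD-signedPerm w∈Dₙ) (inD-even w∈Dₙ)
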